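{- Let $G$ be a graph on $n$ vertices and let $G'$ (on $n+1$ vertices) be obtained from $G$ by a vertex $d$-split. Then the corank of $G'$ in $\mathcal{H}_d(n+1)$ is at most the corank of $G$ in $\mathcal{H}_d(n)$, and the corank of $G'$ in $\mathcal{P}_d(n+1)$ is at most the corank of $G$ in $\mathcal{P}_d(n)$. In particular, if $G$ is independent in $\mathcal{H}_d(n)$ (resp. $\mathcal{P}_d(n)$), then $G'$ is independent in $\mathcal{H}_d(n+1)$ (resp. $\mathcal{P}_d(n+1)$).
   Context: A vertex $d$-split of $G$: choose a vertex $v$ of degree at least $d-1$ and partition its neighbors into three parts $A,B,C$ with $|B|=d-1$; remove all edges $vw$ with $w\in C$, and add a new vertex $v'$ whose neighbors are exactly $B\cup C\cup\{v\}$. The corank of an edge set $E$ in a matroid is $|E|-\operatorname{rank}(E)$. Graphs on a vertex set of size $m$ are identified with subsets of $\binom{[m]}{2}$. For vectors $\mathbf{p}_1,\dots,\mathbf{p}_m\in\mathbb{R}^d$ the hyperconnectivity matrix has rows indexed by pairs $\{i,j\}$ ($i<j$), $md$ columns in $m$ blocks of size $d$, and row $\{i,j\}$ has $\mathbf{p}_j$ in block $i$, $-\mathbf{p}_i$ in block $j$, zeros elsewhere; $\mathcal{H}_d(m)$ is its row matroid for sufficiently generic $\mathbf{p}\in(\mathbb{R}^d)^m$. $\mathcal{P}_d(m)$ is the row matroid of the same matrix with $\mathbf{p}_i=(1,t_i,\dots,t_i^{d-1})$ for sufficiently generic reals $t_1,\dots,t_m$.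
   Formalization: The vectors $\mathbf{p}_1,\dots,\mathbf{p}_m$ and the parameters $t_1,\dots,t_m$ defining $\mathcal{H}_d(m)$ and $\mathcal{P}_d(m)$ are taken over ℚ rather than ℝ. -}

module Defs where

open import Data.Bool using (Bool; true; false; _∧_; _∨_; not; if_then_else_)
open import Data.Nat using (ℕ; zero; suc; _<ᵇ_; _∸_; _≤_)
open import Data.Fin using (Fin; zero; suc; toℕ; _≟_)
open import Data.Fin.Base using () renaming (fromℕ to fromℕ')
open import Data.List using (List; []; _∷_; [_]; length; filterᵇ; concatMap; allFin; foldr)
open import Data.List.Membership.Propositional using (_∈_)
open import Data.Maybe using (Maybe; just; nothing)
import Data.Maybe as Maybe
open import Data.Product using (Σ; ∃; _×_; _,_)
open import Data.Rational using (ℚ; 0ℚ; 1ℚ; _+_; _*_; -_)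
open import Relation.Binary.PropositionalEquality using (_≡_)
open import Relation.Nullary.Decidable using (⌊_⌋)

record Graph (m : ℕ) : Set where
  field
    adj   : Fin m → Fin m → Bool
    sym   : ∀ i j → adj i j ≡ adj j i
    irref : ∀ i → adj i i ≡ false
open Graph public

allPairs : (m : ℕ) → List (Fin m × Fin m)
allPairs m = concatMap (λ i → concatMap (λ j → if toℕ i <ᵇ toℕ j then [ (i , j) ] else []) (allFin m)) (allFin m)

-- The edge set of a graph as a subset of binom([m],2) (listed without repetition).
edges : ∀ {m} → Graph m → List (Fin m × Fin m)
edges {m} G = filterᵇ (λ { (i , j) → adj G i j }) (allPairs m)

numEdges : ∀ {m} → Graph m → ℕ
numEdges G = length (edges G)

_⊆G_ : ∀ {m} → Graph m → Graph m → Set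
I ⊆G E = ∀ i j → adj I i j ≡ true → adj E i j ≡ true

-- A matroid on binom([m],2), given by its independence predicate on edge sets.
IndepPred : ℕ → Set₁
IndepPred m = Graph m → Set

_==_ : ∀ {m} → Fin m → Fin m → Bool
a == b = ⌊ a ≟ b ⌋

Config : ℕ → ℕ → Set
Config d m = Fin m → Fin d → ℚ

-- Row {i,j} of the hyperconnectivity matrix; columns indexed by (block k, coordinate c).
hyperRow : ∀ {d m} → Config d m → Fin m × Fin m → Fin m → Fin d → ℚ
hyperRow p (i , j) k c =
  if k == i then p j c else (if k == j then - (p i c) else 0ℚ)

sumℚ : List ℚ → ℚ
sumℚ = foldr _+_ 0ℚ

RowsIndep : ∀ {d m} → Config d m → Graph m → Set
RowsIndep {d} {m} p I =
  (λc : Fin m × Fin m → ℚ) →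
  (∀ (k : Fin m) (c : Fin d) →
     sumℚ (Data.List.map (λ e → λc e * hyperRow p e k c) (edges I)) ≡ 0ℚ) →
  ∀ e → e ∈ edges I → λc e ≡ 0ℚ

-- Generic hyperconnectivity matroid H_d(m): a set is independent iff the rows are
-- independent for some (equivalently, for sufficiently generic) configuration.
Hd : (d m : ℕ) → IndepPred m
Hd d m I = Σ (Config d m) λ p → RowsIndep p I

_^ℚ_ : ℚ → ℕ → ℚ
x ^ℚ zero = 1ℚ
x ^ℚ suc k = x * (x ^ℚ k)

moment : ∀ {d m} → (Fin m → ℚ) → Config d m
moment t i c = t i ^ℚ toℕ c

Pd : (d m : ℕ) → IndepPred m
Pd d m I = Σ (Fin m → ℚ) λ t → RowsIndep (moment {d} t) I

IsRank : ∀ {m} → IndepPred m → Graph m → ℕ → Set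
IsRank M E r =
  (Σ (Graph _) λ I → I ⊆G E × M I × numEdges I ≡ r) ×
  (∀ I → I ⊆G E → M I → numEdges I ≤ r)

IsCorank : ∀ {m} → IndepPred m → Graph m → ℕ → Set
IsCorank M E k = Σ ℕ λ r → IsRank M E r × k ≡ numEdges E ∸ r

-- Fin (suc n) viewed as old vertices (just) plus the new last vertex (nothing).
view : ∀ {n} → Fin (suc n) → Maybe (Fin n)
view {zero} zero = nothing
view {suc n} zero = just zero
view {suc n} (suc x) = Maybe.map suc (view x)

-- Adjacency of the split graph: old vertices keep their names, new vertex v' = last.
splitAdj : ∀ {n} → Graph n → Fin n → (Fin n → Bool) → (Fin n → Bool) →
           Fin (suc n) → Fin (suc n) → Bool
splitAdj G v B C x y with view x | view y
... | just a  | just b  = adj G a b ∧ not (((a == v) ∧ C b) ∨ ((b == v) ∧ C a))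
... | just a  | nothing = (a == v) ∨ B a ∨ C a
... | nothing | just b  = (b == v) ∨ B b ∨ C b
... | nothing | nothing = false

-- G' is obtained from G by a vertex d-split: a vertex v, a partition A,B,C of N(v)
-- with |B| = d-1, and G' = G - {vw : w ∈ C} + new vertex v' adjacent to B ∪ C ∪ {v}.
IsVertexSplit : ∀ {n} → ℕ → Graph n → Graph (suc n) → Set
IsVertexSplit {n} d G G' =
  Σ (Fin n) λ v → Σ (Fin n → Bool) λ A → Σ (Fin n → Bool) λ B → Σ (Fin n → Bool) λ C →
    (∀ w → adj G v w ≡ (A w ∨ B w ∨ C w)) ×
    (∀ w → A w ∧ B w ≡ false) × (∀ w → A w ∧ C w ≡ false) × (∀ w → B w ∧ C w ≡ false) ×
    length (filterᵇ B (allFin n)) ≡ d ∸ 1 ×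
    (∀ x y → adj G' x y ≡ splitAdj G v B C x y)

-- Rows of the hyperconnectivity matrix at p are independent exactly when the only stress supported on
-- the graph (antisymmetric edge weights ω with Σⱼ ωₖⱼ pⱼ = 0 at every vertex k) is zero.
-- Take a configuration in which I ⊆ G is stress-free and move it along a line: a pencil A + s B with A
-- injective is singular for only finitely many s, so some s keeps I stress-free and makes the d points
-- at v and B linearly independent (for 𝒫_d the parameters are moved, the stress map is a polynomial
-- pencil, which is linearised, and Vandermonde gives the independence). By circuit exchange I grows,
-- without losing edges, to a stress-free J ⊆ G containing the edges from v to B. Splitting J with v′
-- placed at the position of v keeps it stress-free, and adds d edges. So every independent set of G
-- lifts to one of G′ with d more edges, while |E(G′)| = |E(G)| + d: the corank cannot increase.

module Submission where

open import Defs hiding (sym)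
open import Algebra.Bundles using (Ring)
import Algebra.Properties.Semiring.Sum as SemiringSum
open import Data.Bool as Bool using (Bool; true; false; if_then_else_; T; _∧_; _∨_; not)
open import Data.Bool.Properties using (T-≡; ∧-identityʳ; ∧-zeroʳ; ∧-conicalˡ; ∧-conicalʳ; ∨-comm; ∨-conicalˡ; ∨-assoc; ∨-zeroʳ; ∧-assoc)
open import Data.Empty using (⊥-elim)
open import Data.Fin as Fin using (Fin; zero; suc; punchIn; toℕ; inject₁; fromℕ)
import Data.Fin.Properties as Fin
import Data.Integer as ℤ
open import Data.List as List using (List; []; _∷_; [_]; length; allFin; filter; filterᵇ; concatMap; upTo)
import Data.List.Properties as List
open import Data.List.Membership.Propositional using (_∈_)
import Data.List.Membership.Propositional.Properties as Membership
open import Data.List.Relation.Unary.All as All using (All; []; _∷_)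
import Data.List.Relation.Unary.All.Properties as All
import Data.List.Relation.Unary.Any as Any
import Data.List.Relation.Unary.Any.Properties as AnyP
open import Data.List.Relation.Unary.AllPairs using (_∷_)
open import Data.List.Relation.Unary.Any using (here; there)
open import Data.List.Relation.Unary.Unique.Propositional using (Unique)
import Data.List.Relation.Unary.Unique.Propositional.Properties as Unique
open import Data.Maybe using (just; nothing)
open import Data.Nat as ℕ using (ℕ; suc; _≤_; _<ᵇ_; _∸_)
import Data.Nat.Coprimality as Coprimality
import Data.Nat.ListAction as ℕL
import Data.Nat.ListAction.Properties as ℕL
import Data.Nat.Properties as ℕ
open import Data.Nat.Solver using () renaming (module +-*-Solver to ℕSolver)
open import Data.Product using (Σ; _×_; _,_; proj₁; proj₂; ∃-syntax)
open import Data.Rational as ℚ using (ℚ; 0ℚ; 1ℚ; _+_; _*_; -_; _-_)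
import Data.Rational.Properties as ℚ
open import Data.Rational.Solver using (module +-*-Solver)
open import Data.Sum using (_⊎_; inj₁; inj₂)
open import Data.Vec.Functional using (insertAt)
open import Data.Vec.Functional.Properties using (insertAt-lookup; insertAt-punchIn)
open import Function using (_∘_; _↔_; Inverse; Equivalence)
open import Relation.Binary.Definitions using (tri<; tri≈; tri>)
open import Relation.Binary.PropositionalEquality using (_≡_; _≢_; refl; sym; trans; cong; cong₂; cong-app; subst; module ≡-Reasoning)
open import Relation.Nullary using (¬_; Dec; yes; no)
open import Relation.Nullary.Decidable using (¬?; T?; toSum; decidable-stable; _×-dec_; _→-dec_; dec-true; dec-false; isYes≗does)
open import Relation.Unary using (Decidable; _∩_)
open import Relation.Unary.Properties using (∁?)

open +-*-Solver using (solve; _:+_; _:*_; :-_; _:=_; con)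

module Σℚ = SemiringSum (Ring.semiring ℚ.+-*-ring)
module Σℕ = SemiringSum ℕ.+-*-semiring
open Σℚ using (sum; sum-syntax; sum-cong-≗; sum-remove; ∑-distrib-+; *-distribˡ-sum; ∑-comm; sum-init-last)

true≢false : true ≢ false
true≢false ()

false≢true : false ≢ true
false≢true ()

==-refl : ∀ {n} (i : Fin n) → (i == i) ≡ true
==-refl i = trans (isYes≗does (i Fin.≟ i)) (dec-true (i Fin.≟ i) refl)

≢⇒==-false : ∀ {n} {i j : Fin n} → i ≢ j → (i == j) ≡ false
≢⇒==-false {i = i} {j} i≢j = trans (isYes≗does (i Fin.≟ j)) (dec-false (i Fin.≟ j) i≢j)

==⇒≡ : ∀ {n} {i j : Fin n} → (i == j) ≡ true → i ≡ j
==⇒≡ {i = i} {j} e with i Fin.≟ j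
... | yes i≡j = i≡j

==-sym : ∀ {n} (i j : Fin n) → (i == j) ≡ (j == i)
==-sym i j with i Fin.≟ j
... | yes refl = sym (==-refl i)
... | no i≢j = sym (≢⇒==-false (i≢j ∘ sym))

when : Bool → ℚ → ℚ
when b x = if b then x else 0ℚ

when-true : ∀ {b} x → b ≡ true → when b x ≡ x
when-true x refl = refl

when-false : ∀ {b} x → b ≡ false → when b x ≡ 0ℚ
when-false x refl = refl

when-0 : ∀ b → when b 0ℚ ≡ 0ℚ
when-0 true = refl
when-0 false = refl

when-+ : ∀ b x y → when b (x + y) ≡ when b x + when b y
when-+ true x y = refl
when-+ false x y = refl

when-*ˡ : ∀ b a x → when b (a * x) ≡ a * when b x
when-*ˡ true a x = refl
when-*ˡ false a x = sym (ℚ.*-zeroʳ a)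

when-*ʳ : ∀ b x a → when b (x * a) ≡ when b x * a
when-*ʳ true x a = refl
when-*ʳ false x a = sym (ℚ.*-zeroˡ a)

when-neg : ∀ b x → when b (- x) ≡ - when b x
when-neg true x = refl
when-neg false x = refl

x*y≡0⇒x≡0 : ∀ x y → x * y ≡ 0ℚ → y ≢ 0ℚ → x ≡ 0ℚ
x*y≡0⇒x≡0 x y xy≡0 y≢0 = begin
  x                 ≡⟨ solve 2 (λ x y⁻¹ → x := x :* con 1ℚ) refl x y⁻¹ ⟩
  x * 1ℚ            ≡⟨ cong (x *_) (ℚ.*-inverseʳ y) ⟨
  x * (y * y⁻¹)     ≡⟨ ℚ.*-assoc x y y⁻¹ ⟨
  (x * y) * y⁻¹     ≡⟨ cong (_* y⁻¹) xy≡0 ⟩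
  0ℚ * y⁻¹          ≡⟨ ℚ.*-zeroˡ y⁻¹ ⟩
  0ℚ                ∎
  where
  open ≡-Reasoning
  instance _ = ℚ.≢-nonZero y≢0
  y⁻¹ = ℚ.1/ y

x-y≡0⇒x≡y : ∀ {x y} → x - y ≡ 0ℚ → x ≡ y
x-y≡0⇒x≡y {x} {y} x-y≡0 = begin
  x             ≡⟨ solve 2 (λ x y → x := (x :+ (:- y)) :+ y) refl x y ⟩
  (x - y) + y   ≡⟨ cong (_+ y) x-y≡0 ⟩
  0ℚ + y        ≡⟨ ℚ.+-identityˡ y ⟩
  y             ∎
  where open ≡-Reasoning

x≢y⇒x-y≢0 : ∀ {x y} → x ≢ y → x - y ≢ 0ℚ
x≢y⇒x-y≢0 x≢y = x≢y ∘ x-y≡0⇒x≡y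

x+y≡0⇒x≡-y : ∀ {x y} → x + y ≡ 0ℚ → x ≡ - y
x+y≡0⇒x≡-y {x} {y} x+y≡0 = begin
  x              ≡⟨ solve 2 (λ x y → x := (x :+ y) :+ (:- y)) refl x y ⟩
  (x + y) + - y  ≡⟨ cong (_+ - y) x+y≡0 ⟩
  0ℚ + - y       ≡⟨ ℚ.+-identityˡ (- y) ⟩
  - y            ∎
  where open ≡-Reasoning

-x≡0 : ∀ {x} → x ≡ 0ℚ → - x ≡ 0ℚ
-x≡0 refl = refl

sum-zero : ∀ {n} {f : Fin n → ℚ} → (∀ i → f i ≡ 0ℚ) → sum f ≡ 0ℚ
sum-zero {n} f≡0 = trans (sum-cong-≗ f≡0) (Σℚ.sum-replicate-zero n)

sum-neg : ∀ {n} (f : Fin n → ℚ) → ∑[ i < n ] (- f i) ≡ - sum f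
sum-neg {ℕ.zero} f = refl
sum-neg {ℕ.suc n} f = trans (cong (- f zero +_) (sum-neg (f ∘ suc))) (sym (ℚ.neg-distrib-+ (f zero) _))

sum-when : ∀ {n} b (f : Fin n → ℚ) → ∑[ j < n ] when b (f j) ≡ when b (sum f)
sum-when true f = refl
sum-when {n} false f = sum-zero {n} (λ _ → refl)

sum-δ : ∀ {n} (k : Fin n) (f : Fin n → ℚ) → ∑[ i < n ] when (i == k) (f i) ≡ f k
sum-δ {ℕ.suc n} k f = begin
  ∑[ i < ℕ.suc n ] when (i == k) (f i)
    ≡⟨ sum-remove {i = k} (λ i → when (i == k) (f i)) ⟩
  when (k == k) (f k) + ∑[ j < n ] when (punchIn k j == k) (f (punchIn k j))
    ≡⟨ cong₂ _+_ (when-true (f k) (==-refl k)) (sum-zero (λ j → when-false _ (≢⇒==-false (Fin.punchInᵢ≢i k j)))) ⟩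
  f k + 0ℚ
    ≡⟨ ℚ.+-identityʳ (f k) ⟩
  f k ∎
  where open ≡-Reasoning

sum-δ′ : ∀ {n} (k : Fin n) (f : Fin n → ℚ) → ∑[ i < n ] when (k == i) (f i) ≡ f k
sum-δ′ k f = trans (sum-cong-≗ (λ i → cong (λ b → when b (f i)) (==-sym k i))) (sum-δ k f)

-- Linear algebra over ℚ

record Enumeration (X : Set) : Set where
  field
    elements : List X
    complete : ∀ x → x ∈ elements

  size : ℕ
  size = length elements
open Enumeration public

allFinᴱ : ∀ n → Enumeration (Fin n)
allFinᴱ n = record { elements = allFin n ; complete = Membership.∈-allFin }

_×ᴱ_ : ∀ {X Y} → Enumeration X → Enumeration Y → Enumeration (X × Y)
EX ×ᴱ EY = record
  { elements = List.cartesianProduct (elements EX) (elements EY)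
  ; complete = λ (x , y) → Membership.∈-cartesianProduct⁺ (complete EX x) (complete EY y) }

_⊎ᴱ_ : ∀ {X Y} → Enumeration X → Enumeration Y → Enumeration (X ⊎ Y)
EX ⊎ᴱ EY = record { elements = List.map inj₁ (elements EX) List.++ List.map inj₂ (elements EY) ; complete = complete′ }
  where
  complete′ : ∀ z → z ∈ List.map inj₁ (elements EX) List.++ List.map inj₂ (elements EY)
  complete′ (inj₁ x) = Membership.∈-++⁺ˡ (Membership.∈-map⁺ inj₁ (complete EX x))
  complete′ (inj₂ y) = Membership.∈-++⁺ʳ _ (Membership.∈-map⁺ inj₂ (complete EY y))

Nontrivial : ∀ {A : Set} → (A → ℚ) → Set
Nontrivial {A} c = Σ A λ a → c a ≢ 0ℚ

module _ {X : Set} where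

  Independent : ∀ {K} → List X → (Fin K → X → ℚ) → Set
  Independent {K} cols vs =
    ∀ (c : Fin K → ℚ) → (∀ x → x ∈ cols → ∑[ i < K ] (c i * vs i x) ≡ 0ℚ) → ∀ i → c i ≡ 0ℚ

  Dependent : ∀ {K} → List X → (Fin K → X → ℚ) → Set
  Dependent {K} cols vs =
    Σ (Fin K → ℚ) λ c → Nontrivial c × (∀ x → x ∈ cols → ∑[ i < K ] (c i * vs i x) ≡ 0ℚ)

≡-or-punchIn : ∀ {K} (i k : Fin (ℕ.suc K)) → i ≡ k ⊎ Σ (Fin K) (λ j → punchIn i j ≡ k)
≡-or-punchIn i k with i Fin.≟ k
... | yes i≡k = inj₁ i≡k
... | no i≢k = inj₂ (Fin.punchOut i≢k , Fin.punchIn-punchOut i≢k)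

module Pivot {X : Set} {K} (vs : Fin (ℕ.suc K) → X → ℚ) (x : X) (i : Fin (ℕ.suc K)) (pivot≢0 : vs i x ≢ 0ℚ) where

  instance _ = ℚ.≢-nonZero pivot≢0

  ratio : Fin K → ℚ
  ratio j = vs (punchIn i j) x * ℚ.1/ (vs i x)

  reduced : Fin K → X → ℚ
  reduced j y = vs (punchIn i j) y - ratio j * vs i y

  reduced-pivot : ∀ j → reduced j x ≡ 0ℚ
  reduced-pivot j = begin
    vs (punchIn i j) x - (vs (punchIn i j) x * ℚ.1/ (vs i x)) * vs i x
      ≡⟨ cong (λ z → vs (punchIn i j) x - z) (ℚ.*-assoc (vs (punchIn i j) x) _ (vs i x)) ⟩
    vs (punchIn i j) x - vs (punchIn i j) x * (ℚ.1/ (vs i x) * vs i x)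
      ≡⟨ cong (λ z → vs (punchIn i j) x - vs (punchIn i j) x * z) (ℚ.*-inverseˡ (vs i x)) ⟩
    vs (punchIn i j) x - vs (punchIn i j) x * 1ℚ
      ≡⟨ solve 1 (λ a → a :+ (:- (a :* con 1ℚ)) := con 0ℚ) refl (vs (punchIn i j) x) ⟩
    0ℚ ∎
    where open ≡-Reasoning

  combination-split : ∀ (c : Fin (ℕ.suc K) → ℚ) y →
    ∑[ k < ℕ.suc K ] (c k * vs k y) ≡
      ∑[ j < K ] (c (punchIn i j) * reduced j y) + (c i + ∑[ j < K ] (c (punchIn i j) * ratio j)) * vs i y
  combination-split c y = begin
    ∑[ k < ℕ.suc K ] (c k * vs k y)
      ≡⟨ sum-remove {i = i} (λ k → c k * vs k y) ⟩
    c i * vs i y + S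
      ≡⟨ solve 4 (λ ci v S R → ci :* v :+ S := (S :+ (:- (R :* v))) :+ (ci :+ R) :* v) refl (c i) (vs i y) S R ⟩
    (S - R * vs i y) + (c i + R) * vs i y
      ≡⟨ cong (_+ (c i + R) * vs i y) reduced-sum ⟨
    ∑[ j < K ] (μ j * reduced j y) + (c i + R) * vs i y ∎
    where
    open ≡-Reasoning
    μ = c ∘ punchIn i
    S = ∑[ j < K ] (μ j * vs (punchIn i j) y)
    R = ∑[ j < K ] (μ j * ratio j)
    reduced-sum : ∑[ j < K ] (μ j * reduced j y) ≡ S - R * vs i y
    reduced-sum = begin
      ∑[ j < K ] (μ j * reduced j y)
        ≡⟨ sum-cong-≗ (λ j → solve 4 (λ m a r b → m :* (a :+ (:- (r :* b))) := m :* a :+ (:- b) :* (m :* r)) refl (μ j) (vs (punchIn i j) y) (ratio j) (vs i y)) ⟩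
      ∑[ j < K ] (μ j * vs (punchIn i j) y + (- vs i y) * (μ j * ratio j))
        ≡⟨ ∑-distrib-+ (λ j → μ j * vs (punchIn i j) y) _ ⟩
      S + ∑[ j < K ] ((- vs i y) * (μ j * ratio j))
        ≡⟨ cong (S +_) (*-distribˡ-sum (- vs i y) (λ j → μ j * ratio j)) ⟨
      S + (- vs i y) * R
        ≡⟨ solve 3 (λ S v R → S :+ (:- v) :* R := S :+ (:- (R :* v))) refl S (vs i y) R ⟩
      S - R * vs i y ∎

  lift-dependent : ∀ {xs} → Dependent xs reduced → Dependent (x ∷ xs) vs
  lift-dependent {xs} (μ , (j , μj≢0) , μ-dep) = c , (punchIn i j , c-nontrivial) , c-dep
    where
    c = insertAt μ i (- ∑[ j < K ] (μ j * ratio j))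
    c-nontrivial : c (punchIn i j) ≢ 0ℚ
    c-nontrivial = subst (_≢ 0ℚ) (sym (insertAt-punchIn μ i _ j)) μj≢0
    pivot-coefficient : c i + ∑[ j < K ] (c (punchIn i j) * ratio j) ≡ 0ℚ
    pivot-coefficient = begin
      c i + ∑[ j < K ] (c (punchIn i j) * ratio j)
        ≡⟨ cong₂ (λ a b → a + b) (insertAt-lookup μ i _) (sum-cong-≗ (λ j → cong (_* ratio j) (insertAt-punchIn μ i _ j))) ⟩
      - ∑[ j < K ] (μ j * ratio j) + ∑[ j < K ] (μ j * ratio j)
        ≡⟨ ℚ.+-inverseˡ (∑[ j < K ] (μ j * ratio j)) ⟩
      0ℚ ∎
      where open ≡-Reasoning
    reduce : ∀ y → ∑[ k < ℕ.suc K ] (c k * vs k y) ≡ ∑[ j < K ] (μ j * reduced j y)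
    reduce y = begin
      ∑[ k < ℕ.suc K ] (c k * vs k y)
        ≡⟨ combination-split c y ⟩
      ∑[ j < K ] (c (punchIn i j) * reduced j y) + (c i + ∑[ j < K ] (c (punchIn i j) * ratio j)) * vs i y
        ≡⟨ cong₂ (λ a b → a + b * vs i y) (sum-cong-≗ (λ j → cong (_* reduced j y) (insertAt-punchIn μ i _ j))) pivot-coefficient ⟩
      ∑[ j < K ] (μ j * reduced j y) + 0ℚ * vs i y
        ≡⟨ solve 2 (λ a b → a :+ con 0ℚ :* b := a) refl _ (vs i y) ⟩
      ∑[ j < K ] (μ j * reduced j y) ∎
      where open ≡-Reasoning
    c-dep : ∀ y → y ∈ x ∷ xs → ∑[ k < ℕ.suc K ] (c k * vs k y) ≡ 0ℚ
    c-dep y (here refl) = trans (reduce y) (sum-zero (λ j → trans (cong (μ j *_) (reduced-pivot j)) (ℚ.*-zeroʳ (μ j))))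
    c-dep y (there y∈xs) = trans (reduce y) (μ-dep y y∈xs)

  lift-independent : ∀ {xs} → Independent xs reduced → Independent (x ∷ xs) vs
  lift-independent {xs} independent c c-dep = c≡0
    where
    μ = c ∘ punchIn i
    a = c i + ∑[ j < K ] (μ j * ratio j)
    a≡0 : a ≡ 0ℚ
    a≡0 = x*y≡0⇒x≡0 a (vs i x) (begin
      a * vs i x
        ≡⟨ ℚ.+-identityˡ (a * vs i x) ⟨
      0ℚ + a * vs i x
        ≡⟨ cong (_+ a * vs i x) (sum-zero (λ j → trans (cong (μ j *_) (reduced-pivot j)) (ℚ.*-zeroʳ (μ j)))) ⟨
      ∑[ j < K ] (μ j * reduced j x) + a * vs i x
        ≡⟨ combination-split c x ⟨
      ∑[ k < ℕ.suc K ] (c k * vs k x)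
        ≡⟨ c-dep x (here refl) ⟩
      0ℚ ∎) pivot≢0
      where open ≡-Reasoning
    μ-dep : ∀ y → y ∈ xs → ∑[ j < K ] (μ j * reduced j y) ≡ 0ℚ
    μ-dep y y∈xs = begin
      ∑[ j < K ] (μ j * reduced j y)
        ≡⟨ solve 2 (λ s b → s := s :+ con 0ℚ :* b) refl _ (vs i y) ⟩
      ∑[ j < K ] (μ j * reduced j y) + 0ℚ * vs i y
        ≡⟨ cong (λ z → ∑[ j < K ] (μ j * reduced j y) + z * vs i y) a≡0 ⟨
      ∑[ j < K ] (μ j * reduced j y) + a * vs i y
        ≡⟨ combination-split c y ⟨
      ∑[ k < ℕ.suc K ] (c k * vs k y)
        ≡⟨ c-dep y (there y∈xs) ⟩
      0ℚ ∎
      where open ≡-Reasoning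
    μ≡0 : ∀ j → μ j ≡ 0ℚ
    μ≡0 = independent μ μ-dep
    ci≡0 : c i ≡ 0ℚ
    ci≡0 = begin
      c i                                  ≡⟨ ℚ.+-identityʳ (c i) ⟨
      c i + 0ℚ                             ≡⟨ cong (c i +_) (sum-zero (λ j → trans (cong (_* ratio j) (μ≡0 j)) (ℚ.*-zeroˡ (ratio j)))) ⟨
      a                                    ≡⟨ a≡0 ⟩
      0ℚ                                   ∎
      where open ≡-Reasoning
    c≡0 : ∀ k → c k ≡ 0ℚ
    c≡0 k with ≡-or-punchIn i k
    ... | inj₁ refl = ci≡0
    ... | inj₂ (j , refl) = μ≡0 j

-- Gaussian elimination, one pivot column at a time.
dependent-or-independent : ∀ {X : Set} (cols : List X) {K} (vs : Fin K → X → ℚ) →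
  Dependent cols vs ⊎ (Independent cols vs × K ≤ length cols)
dependent-or-independent [] {ℕ.zero} vs = inj₂ ((λ c _ ()) , ℕ.z≤n)
dependent-or-independent [] {ℕ.suc K} vs = inj₁ (c , (zero , λ ()) , λ x ())
  where
  c : Fin (ℕ.suc K) → ℚ
  c zero = 1ℚ
  c (suc _) = 0ℚ
dependent-or-independent (x ∷ xs) {K} vs with Fin.any? (λ i → ¬? (vs i x ℚ.≟ 0ℚ))
dependent-or-independent (x ∷ xs) {K} vs | no no-pivot with dependent-or-independent xs vs
... | inj₁ (c , c≢0 , c-dep) = inj₁ (c , c≢0 , c-dep′)
  where
  c-dep′ : ∀ y → y ∈ x ∷ xs → ∑[ i < K ] (c i * vs i y) ≡ 0ℚ
  c-dep′ y (here refl) = sum-zero (λ i → trans (cong (c i *_) (column-zero i)) (ℚ.*-zeroʳ (c i)))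
    where
    column-zero : ∀ i → vs i x ≡ 0ℚ
    column-zero i with vs i x ℚ.≟ 0ℚ
    ... | yes vsix≡0 = vsix≡0
    ... | no vsix≢0 = ⊥-elim (no-pivot (i , vsix≢0))
  c-dep′ y (there y∈xs) = c-dep y y∈xs
... | inj₂ (independent , K≤) = inj₂ ((λ c c-dep → independent c (λ y → c-dep y ∘ there)) , ℕ.m≤n⇒m≤1+n K≤)
dependent-or-independent (x ∷ xs) {ℕ.suc K} vs | yes (i , pivot≢0) with dependent-or-independent xs (Pivot.reduced vs x i pivot≢0)
... | inj₁ dependent = inj₁ (Pivot.lift-dependent vs x i pivot≢0 dependent)
... | inj₂ (independent , K≤) = inj₂ (Pivot.lift-independent vs x i pivot≢0 independent , ℕ.s≤s K≤)

record Linear (U X : Set) : Set where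
  field
    app      : (U → ℚ) → X → ℚ
    app-cong : ∀ {f g} → (∀ u → f u ≡ g u) → ∀ x → app f x ≡ app g x
    app-+    : ∀ f g x → app (λ u → f u + g u) x ≡ app f x + app g x
    app-*    : ∀ a f x → app (λ u → a * f u) x ≡ a * app f x
open Linear public

Kernel : ∀ {U X} → Linear U X → (U → ℚ) → Set
Kernel L f = ∀ x → app L f x ≡ 0ℚ

Injective : ∀ {U X} → Linear U X → Set
Injective {U} L = ∀ (f : U → ℚ) → Kernel L f → ∀ u → f u ≡ 0ℚ

app-0 : ∀ {U X} (L : Linear U X) x → app L (λ _ → 0ℚ) x ≡ 0ℚ
app-0 L x = begin
  app L (λ _ → 0ℚ) x         ≡⟨ app-cong L (λ _ → ℚ.*-zeroˡ 0ℚ) x ⟨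
  app L (λ _ → 0ℚ * 0ℚ) x    ≡⟨ app-* L 0ℚ (λ _ → 0ℚ) x ⟩
  0ℚ * app L (λ _ → 0ℚ) x    ≡⟨ ℚ.*-zeroˡ (app L (λ _ → 0ℚ) x) ⟩
  0ℚ                         ∎
  where open ≡-Reasoning

app-sum : ∀ {U X} (L : Linear U X) {J} (a : Fin J → ℚ) (F : Fin J → U → ℚ) x →
  app L (λ u → ∑[ j < J ] (a j * F j u)) x ≡ ∑[ j < J ] (a j * app L (F j) x)
app-sum L {ℕ.zero} a F x = app-0 L x
app-sum L {ℕ.suc J} a F x = begin
  app L (λ u → a zero * F zero u + ∑[ j < J ] (a (suc j) * F (suc j) u)) x
    ≡⟨ app-+ L (λ u → a zero * F zero u) _ x ⟩
  app L (λ u → a zero * F zero u) x + app L (λ u → ∑[ j < J ] (a (suc j) * F (suc j) u)) x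
    ≡⟨ cong₂ _+_ (app-* L (a zero) (F zero) x) (app-sum L (a ∘ suc) (F ∘ suc) x) ⟩
  a zero * app L (F zero) x + ∑[ j < J ] (a (suc j) * app L (F (suc j)) x) ∎
  where open ≡-Reasoning

δ : ∀ {K} → Fin K → Fin K → ℚ
δ t u = when (t == u) 1ℚ

app-expand : ∀ {K X} (L : Linear (Fin K) X) f x → app L f x ≡ ∑[ t < K ] (f t * app L (δ t) x)
app-expand {K} L f x = trans (app-cong L expand x) (app-sum L f δ x)
  where
  *-when-1 : ∀ b y → y * when b 1ℚ ≡ when b y
  *-when-1 true y = ℚ.*-identityʳ y
  *-when-1 false y = ℚ.*-zeroʳ y
  expand : ∀ u → f u ≡ ∑[ t < K ] (f t * δ t u)
  expand u = sym (trans (sum-cong-≗ (λ t → *-when-1 (t == u) (f t))) (sum-δ u f))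

injective-or-kernel : ∀ {K X} (L : Linear (Fin K) X) → Enumeration X →
  Injective L ⊎ Σ (Fin K → ℚ) (λ f → Nontrivial f × Kernel L f)
injective-or-kernel L EX with dependent-or-independent (elements EX) (λ t → app L (δ t))
... | inj₁ (f , f≢0 , f-dep) = inj₂ (f , f≢0 , λ x → trans (app-expand L f x) (f-dep x (complete EX x)))
... | inj₂ (independent , _) = inj₁ (λ f f-ker → independent f (λ x _ → trans (sym (app-expand L f x)) (f-ker x)))

precompose : ∀ {U V X} → (U → V) → Linear U X → Linear V X
precompose e L = record
  { app = λ f → app L (f ∘ e)
  ; app-cong = λ f≗g → app-cong L (f≗g ∘ e)
  ; app-+ = λ f g → app-+ L (f ∘ e) (g ∘ e)
  ; app-* = λ a f → app-* L a (f ∘ e) }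

injective-or-kernel-↔ : ∀ {K U X} → Fin K ↔ U → (L : Linear U X) → Enumeration X →
  Injective L ⊎ Σ (U → ℚ) (λ f → Nontrivial f × Kernel L f)
injective-or-kernel-↔ K↔U L EX with injective-or-kernel (precompose from L) EX
  where open Inverse K↔U
... | inj₁ injective = inj₁ λ f f-ker u →
  trans (cong f (sym (strictlyInverseˡ u)))
        (injective (f ∘ to) (λ x → trans (app-cong L (λ u → cong f (strictlyInverseˡ u)) x) (f-ker x)) (from u))
  where open Inverse K↔U
... | inj₂ (g , (t , gt≢0) , g-ker) = inj₂ (g ∘ from , (to t , subst (λ s → g s ≢ 0ℚ) (sym (strictlyInverseʳ t)) gt≢0) , g-ker)
  where open Inverse K↔U

module Pencil {U X : Set} (EU : Enumeration U) (A B : Linear U X) (A-injective : Injective A) where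

  -- Applying A to Σ cⱼ σⱼ Λⱼ gives − B (Σ cⱼ Λⱼ).
  dependency-scaled : ∀ {J} (σ : Fin J → ℚ) (Λ : Fin J → U → ℚ) →
    (∀ j x → σ j * app A (Λ j) x + app B (Λ j) x ≡ 0ℚ) →
    ∀ (c : Fin J → ℚ) → (∀ u → ∑[ j < J ] (c j * Λ j u) ≡ 0ℚ) → ∀ u → ∑[ j < J ] ((c j * σ j) * Λ j u) ≡ 0ℚ
  dependency-scaled {J} σ Λ eigen c c-dep = A-injective _ λ x → begin
    app A (λ u → ∑[ j < J ] ((c j * σ j) * Λ j u)) x
      ≡⟨ app-sum A (λ j → c j * σ j) Λ x ⟩
    ∑[ j < J ] ((c j * σ j) * app A (Λ j) x)
      ≡⟨ sum-cong-≗ (λ j → trans (ℚ.*-assoc (c j) (σ j) _) (cong (c j *_) (x+y≡0⇒x≡-y (eigen j x)))) ⟩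
    ∑[ j < J ] (c j * - app B (Λ j) x)
      ≡⟨ sum-cong-≗ (λ j → ℚ.neg-distribʳ-* (c j) (app B (Λ j) x)) ⟨
    ∑[ j < J ] (- (c j * app B (Λ j) x))
      ≡⟨ sum-neg (λ j → c j * app B (Λ j) x) ⟩
    - ∑[ j < J ] (c j * app B (Λ j) x)
      ≡⟨ cong -_ (app-sum B c Λ x) ⟨
    - app B (λ u → ∑[ j < J ] (c j * Λ j u)) x
      ≡⟨ cong -_ (trans (app-cong B c-dep x) (app-0 B x)) ⟩
    0ℚ ∎
    where open ≡-Reasoning

  -- The Λ j are eigenvectors of − A⁻¹ B for distinct eigenvalues.
  eigenvectors-independent : ∀ {J} (σ : Fin J → ℚ) (Λ : Fin J → U → ℚ) →
    (∀ i j → σ i ≡ σ j → i ≡ j) → (∀ j → Nontrivial (Λ j)) →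
    (∀ j x → σ j * app A (Λ j) x + app B (Λ j) x ≡ 0ℚ) →
    ∀ (c : Fin J → ℚ) → (∀ u → ∑[ j < J ] (c j * Λ j u) ≡ 0ℚ) → ∀ j → c j ≡ 0ℚ
  eigenvectors-independent {ℕ.zero} σ Λ σ-injective Λ≢0 eigen c c-dep ()
  eigenvectors-independent {ℕ.suc J} σ Λ σ-injective Λ≢0 eigen c c-dep = c≡0
    where
    open ≡-Reasoning
    d : Fin (ℕ.suc J) → ℚ
    d j = c j * (σ j - σ zero)
    d-dep : ∀ u → ∑[ j < ℕ.suc J ] (d j * Λ j u) ≡ 0ℚ
    d-dep u = begin
      ∑[ j < ℕ.suc J ] (d j * Λ j u)
        ≡⟨ sum-cong-≗ (λ j → solve 4 (λ c s s₀ l → (c :* (s :+ (:- s₀))) :* l := (c :* s) :* l :+ (:- s₀) :* (c :* l)) refl (c j) (σ j) (σ zero) (Λ j u)) ⟩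
      ∑[ j < ℕ.suc J ] ((c j * σ j) * Λ j u + (- σ zero) * (c j * Λ j u))
        ≡⟨ ∑-distrib-+ (λ j → (c j * σ j) * Λ j u) (λ j → (- σ zero) * (c j * Λ j u)) ⟩
      ∑[ j < ℕ.suc J ] ((c j * σ j) * Λ j u) + ∑[ j < ℕ.suc J ] ((- σ zero) * (c j * Λ j u))
        ≡⟨ cong₂ _+_ (dependency-scaled σ Λ eigen c c-dep u) (trans (sym (*-distribˡ-sum (- σ zero) (λ j → c j * Λ j u))) (cong ((- σ zero) *_) (c-dep u))) ⟩
      0ℚ + (- σ zero) * 0ℚ
        ≡⟨ solve 1 (λ s → con 0ℚ :+ s :* con 0ℚ := con 0ℚ) refl (- σ zero) ⟩
      0ℚ ∎
    d₀≡0 : d zero ≡ 0ℚ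
    d₀≡0 = trans (cong (c zero *_) (ℚ.+-inverseʳ (σ zero))) (ℚ.*-zeroʳ (c zero))
    d-dep-tail : ∀ u → ∑[ j < J ] (d (suc j) * Λ (suc j) u) ≡ 0ℚ
    d-dep-tail u = begin
      ∑[ j < J ] (d (suc j) * Λ (suc j) u)             ≡⟨ ℚ.+-identityˡ _ ⟨
      0ℚ + ∑[ j < J ] (d (suc j) * Λ (suc j) u)        ≡⟨ cong (_+ ∑[ j < J ] (d (suc j) * Λ (suc j) u)) (trans (cong (_* Λ zero u) d₀≡0) (ℚ.*-zeroˡ (Λ zero u))) ⟨
      ∑[ j < ℕ.suc J ] (d j * Λ j u)                    ≡⟨ d-dep u ⟩
      0ℚ                                               ∎
    c-tail≡0 : ∀ j → c (suc j) ≡ 0ℚ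
    c-tail≡0 j = x*y≡0⇒x≡0 (c (suc j)) _
      (eigenvectors-independent (σ ∘ suc) (Λ ∘ suc) (λ i j → Fin.suc-injective ∘ σ-injective (suc i) (suc j)) (Λ≢0 ∘ suc) (eigen ∘ suc) (d ∘ suc) d-dep-tail j)
      (x≢y⇒x-y≢0 (λ σj≡σ₀ → Fin.0≢1+n (sym (σ-injective (suc j) zero σj≡σ₀))))
    c₀≡0 : c zero ≡ 0ℚ
    c₀≡0 = x*y≡0⇒x≡0 (c zero) (Λ zero u₀) (begin
      c zero * Λ zero u₀                                          ≡⟨ ℚ.+-identityʳ _ ⟨
      c zero * Λ zero u₀ + 0ℚ                                     ≡⟨ cong (c zero * Λ zero u₀ +_) (sum-zero (λ j → trans (cong (_* Λ (suc j) u₀) (c-tail≡0 j)) (ℚ.*-zeroˡ (Λ (suc j) u₀)))) ⟨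
      ∑[ j < ℕ.suc J ] (c j * Λ j u₀)                               ≡⟨ c-dep u₀ ⟩
      0ℚ                                                          ∎) Λ₀u₀≢0
      where
      u₀ = proj₁ (Λ≢0 zero)
      Λ₀u₀≢0 = proj₂ (Λ≢0 zero)
    c≡0 : ∀ j → c j ≡ 0ℚ
    c≡0 zero = c₀≡0
    c≡0 (suc j) = c-tail≡0 j

  eigenvalues-bounded : ∀ {J} (σ : Fin J → ℚ) (Λ : Fin J → U → ℚ) →
    (∀ i j → σ i ≡ σ j → i ≡ j) → (∀ j → Nontrivial (Λ j)) →
    (∀ j x → σ j * app A (Λ j) x + app B (Λ j) x ≡ 0ℚ) → J ≤ size EU
  eigenvalues-bounded σ Λ σ-injective Λ≢0 eigen with dependent-or-independent (elements EU) Λ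
  ... | inj₂ (_ , J≤) = J≤
  ... | inj₁ (c , (j , cj≢0) , c-dep) =
    ⊥-elim (cj≢0 (eigenvectors-independent σ Λ σ-injective Λ≢0 eigen c (λ u → c-dep u (complete EU u)) j))

  eigenvalues-bounded′ : ∀ {J} (σ : Fin J → ℚ) (Λ : Fin J → U → ℚ) →
    (∀ i j → σ i ≡ σ j → i ≡ j) → (∀ j → Nontrivial (Λ j)) →
    (∀ j x → app A (Λ j) x + σ j * app B (Λ j) x ≡ 0ℚ) → J ≤ size EU
  eigenvalues-bounded′ {J} σ Λ σ-injective Λ≢0 eigen = eigenvalues-bounded σ⁻¹ Λ σ⁻¹-injective Λ≢0 eigen⁻¹
    where
    σ≢0 : ∀ j → σ j ≢ 0ℚ
    σ≢0 j σj≡0 = proj₂ (Λ≢0 j) (A-injective (Λ j) (λ x → begin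
      app A (Λ j) x                              ≡⟨ ℚ.+-identityʳ _ ⟨
      app A (Λ j) x + 0ℚ                         ≡⟨ cong (app A (Λ j) x +_) (trans (cong (_* app B (Λ j) x) σj≡0) (ℚ.*-zeroˡ (app B (Λ j) x))) ⟨
      app A (Λ j) x + σ j * app B (Λ j) x        ≡⟨ eigen j x ⟩
      0ℚ                                         ∎) (proj₁ (Λ≢0 j)))
      where open ≡-Reasoning
    σ⁻¹ : Fin J → ℚ
    σ⁻¹ j = ℚ.1/_ (σ j) {{ℚ.≢-nonZero (σ≢0 j)}}
    σσ⁻¹≡1 : ∀ j → σ j * σ⁻¹ j ≡ 1ℚ
    σσ⁻¹≡1 j = ℚ.*-inverseʳ (σ j) {{ℚ.≢-nonZero (σ≢0 j)}}
    σ⁻¹-injective : ∀ i j → σ⁻¹ i ≡ σ⁻¹ j → i ≡ j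
    σ⁻¹-injective i j σ⁻¹i≡σ⁻¹j = σ-injective i j (begin
      σ i                       ≡⟨ ℚ.*-identityʳ (σ i) ⟨
      σ i * 1ℚ                  ≡⟨ cong (σ i *_) (σσ⁻¹≡1 j) ⟨
      σ i * (σ j * σ⁻¹ j)       ≡⟨ cong (λ z → σ i * (σ j * z)) σ⁻¹i≡σ⁻¹j ⟨
      σ i * (σ j * σ⁻¹ i)       ≡⟨ solve 3 (λ a b c → a :* (b :* c) := (a :* c) :* b) refl (σ i) (σ j) (σ⁻¹ i) ⟩
      (σ i * σ⁻¹ i) * σ j       ≡⟨ cong (_* σ j) (σσ⁻¹≡1 i) ⟩
      1ℚ * σ j                  ≡⟨ ℚ.*-identityˡ (σ j) ⟩
      σ j                       ∎)
      where open ≡-Reasoning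
    eigen⁻¹ : ∀ j x → σ⁻¹ j * app A (Λ j) x + app B (Λ j) x ≡ 0ℚ
    eigen⁻¹ j x = begin
      σ⁻¹ j * a + b                                  ≡⟨ solve 4 (λ i s a b → i :* a :+ b := i :* (a :+ s :* b) :+ (con 1ℚ :+ (:- (s :* i))) :* b) refl (σ⁻¹ j) (σ j) a b ⟩
      σ⁻¹ j * (a + σ j * b) + (1ℚ - σ j * σ⁻¹ j) * b ≡⟨ cong₂ (λ z w → σ⁻¹ j * z + (1ℚ - w) * b) (eigen j x) (σσ⁻¹≡1 j) ⟩
      σ⁻¹ j * 0ℚ + (1ℚ - 1ℚ) * b                     ≡⟨ solve 2 (λ i b → i :* con 0ℚ :+ (con 1ℚ :+ (:- con 1ℚ)) :* b := con 0ℚ) refl (σ⁻¹ j) b ⟩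
      0ℚ                                             ∎
      where
      open ≡-Reasoning
      a = app A (Λ j) x
      b = app B (Λ j) x

-- Properties of natural numbers with finitely many exceptions

toℚ : ℕ → ℚ
toℚ k = ℚ.mkℚ (ℤ.+ k) 0 (Coprimality.sym (Coprimality.1-coprimeTo k))

toℚ-injective : ∀ {k l} → toℚ k ≡ toℚ l → k ≡ l
toℚ-injective toℚk≡toℚl = cong ℤ.∣_∣ (cong ℚ.numerator toℚk≡toℚl)

FailsAtMost : ℕ → (ℕ → Set) → Set
FailsAtMost N P = ∀ ks → Unique ks → All (¬_ ∘ P) ks → length ks ≤ N

failsAtMost⇒∃ : ∀ {N P} → FailsAtMost N P → Decidable P → Σ ℕ P
failsAtMost⇒∃ {N} {P} few P? with Any.any? P? (upTo (ℕ.suc N))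
... | yes some = Any.satisfied some
... | no none = ⊥-elim (ℕ.<-irrefl refl (subst (_≤ N) (List.length-upTo (ℕ.suc N))
                  (few (upTo (ℕ.suc N)) (Unique.upTo⁺ (ℕ.suc N)) (All.¬Any⇒All¬ _ none))))

failsAtMost-mono : ∀ {N} {P Q : ℕ → Set} → (∀ k → P k → Q k) → FailsAtMost N P → FailsAtMost N Q
failsAtMost-mono P⇒Q few ks ks-unique ks-fail = few ks ks-unique (All.map (λ ¬Q P → ¬Q (P⇒Q _ P)) ks-fail)

length-filter-∁ : ∀ {A : Set} {P : A → Set} (P? : Decidable P) xs →
  length xs ≡ length (filter (∁? P?) xs) ℕ.+ length (filter P? xs)
length-filter-∁ P? [] = refl
length-filter-∁ P? (x ∷ xs) with P? x
... | yes _ = trans (cong ℕ.suc (length-filter-∁ P? xs)) (sym (ℕ.+-suc _ _))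
... | no _ = cong ℕ.suc (length-filter-∁ P? xs)

failsAtMost-∩ : ∀ {N M} {P Q : ℕ → Set} → FailsAtMost N P → FailsAtMost M Q → Decidable P →
  FailsAtMost (N ℕ.+ M) (P ∩ Q)
failsAtMost-∩ {N} {M} {P} {Q} P-few Q-few P? ks ks-unique ks-fail = begin
  length ks                                              ≡⟨ length-filter-∁ P? ks ⟩
  length (filter (∁? P?) ks) ℕ.+ length (filter P? ks)   ≤⟨ ℕ.+-mono-≤ fail-P fail-Q ⟩
  N ℕ.+ M                                                ∎
  where
  open ℕ.≤-Reasoning
  fail-P = P-few _ (Unique.filter⁺ (∁? P?) ks-unique) (All.all-filter (∁? P?) ks)
  fail-Q = Q-few _ (Unique.filter⁺ P? ks-unique)
                   (All.zipWith (λ (p , ¬pq) q → ¬pq (p , q)) (All.all-filter P? ks , All.filter⁺ P? ks-fail))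

lookup-injective : ∀ {A : Set} {xs : List A} → Unique xs → ∀ i j → List.lookup xs i ≡ List.lookup xs j → i ≡ j
lookup-injective (_ ∷ _) zero zero _ = refl
lookup-injective (x∉ ∷ _) zero (suc j) eq = ⊥-elim (All.lookup x∉ (Membership.∈-lookup j) eq)
lookup-injective (x∉ ∷ _) (suc i) zero eq = ⊥-elim (All.lookup x∉ (Membership.∈-lookup i) (sym eq))
lookup-injective (_ ∷ unique) (suc i) (suc j) eq = cong suc (lookup-injective unique i j eq)

module _ {U X : Set} (EU : Enumeration U) (A B : Linear U X) (A-injective : Injective A) where
  open Pencil EU A B A-injective

  pencil-failsAtMost : (P : ℕ → Set) →
    (∀ k → ¬ P k → Σ (U → ℚ) λ f → Nontrivial f × (∀ x → toℚ k * app A f x + app B f x ≡ 0ℚ)) →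
    FailsAtMost (size EU) P
  pencil-failsAtMost P witness ks ks-unique ks-fail =
    eigenvalues-bounded σ (λ j → proj₁ (W j)) σ-injective (λ j → proj₁ (proj₂ (W j))) (λ j → proj₂ (proj₂ (W j)))
    where
    W = λ j → witness (List.lookup ks j) (All.lookup ks-fail (Membership.∈-lookup j))
    σ = λ j → toℚ (List.lookup ks j)
    σ-injective = λ i j → lookup-injective ks-unique i j ∘ toℚ-injective

  pencil-failsAtMost′ : (P : ℕ → Set) →
    (∀ k → ¬ P k → Σ (U → ℚ) λ f → Nontrivial f × (∀ x → app A f x + toℚ k * app B f x ≡ 0ℚ)) →
    FailsAtMost (size EU) P
  pencil-failsAtMost′ P witness ks ks-unique ks-fail =
    eigenvalues-bounded′ σ (λ j → proj₁ (W j)) σ-injective (λ j → proj₁ (proj₂ (W j))) (λ j → proj₂ (proj₂ (W j)))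
    where
    W = λ j → witness (List.lookup ks j) (All.lookup ks-fail (Membership.∈-lookup j))
    σ = λ j → toℚ (List.lookup ks j)
    σ-injective = λ i j → lookup-injective ks-unique i j ∘ toℚ-injective

-- Stresses and the hyperconnectivity matrix

_≺_ : ∀ {m} → Fin m → Fin m → Bool
i ≺ j = toℕ i <ᵇ toℕ j

≺⇒< : ∀ {m} {i j : Fin m} → (i ≺ j) ≡ true → toℕ i ℕ.< toℕ j
≺⇒< {i = i} {j} i≺j = ℕ.<ᵇ⇒< (toℕ i) (toℕ j) (subst T (sym i≺j) _)

<⇒≺ : ∀ {m} {i j : Fin m} → toℕ i ℕ.< toℕ j → (i ≺ j) ≡ true
<⇒≺ {i = i} {j} i<j with i ≺ j in eq
... | true = refl
... | false = ⊥-elim (subst T eq (ℕ.<⇒<ᵇ i<j))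

≺-asym : ∀ {m} (i j : Fin m) → (i ≺ j) ≡ true → (j ≺ i) ≡ false
≺-asym i j i≺j with j ≺ i in j≺i
... | false = refl
... | true = ⊥-elim (ℕ.<-asym (≺⇒< {i = i} {j} i≺j) (≺⇒< {i = j} {i} j≺i))

≺-irrefl : ∀ {m} (i : Fin m) → (i ≺ i) ≡ false
≺-irrefl i with i ≺ i in i≺i
... | false = refl
... | true = ⊥-elim (ℕ.<-irrefl refl (≺⇒< {i = i} {i} i≺i))

≺-connex : ∀ {m} (i j : Fin m) → (i ≺ j) ≡ false → (j ≺ i) ≡ false → i ≡ j
≺-connex i j i⊀j j⊀i with ℕ.<-cmp (toℕ i) (toℕ j)
... | tri< i<j _ _ = ⊥-elim (false≢true (trans (sym i⊀j) (<⇒≺ {i = i} {j} i<j)))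
... | tri≈ _ i≡j _ = Fin.toℕ-injective i≡j
... | tri> _ _ j<i = ⊥-elim (false≢true (trans (sym j⊀i) (<⇒≺ {i = j} {i} j<i)))

sumℚ-++ : ∀ xs ys → sumℚ (xs List.++ ys) ≡ sumℚ xs + sumℚ ys
sumℚ-++ [] ys = sym (ℚ.+-identityˡ (sumℚ ys))
sumℚ-++ (x ∷ xs) ys = trans (cong (x +_) (sumℚ-++ xs ys)) (sym (ℚ.+-assoc x (sumℚ xs) (sumℚ ys)))

sumℚ-filterᵇ : ∀ {A : Set} (p : A → Bool) (g : A → ℚ) xs →
  sumℚ (List.map g (filterᵇ p xs)) ≡ sumℚ (List.map (λ x → when (p x) (g x)) xs)
sumℚ-filterᵇ p g [] = refl
sumℚ-filterᵇ p g (x ∷ xs) with p x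
... | true = cong (g x +_) (sumℚ-filterᵇ p g xs)
... | false = trans (sumℚ-filterᵇ p g xs) (sym (ℚ.+-identityˡ _))

sumℚ-concatMap : ∀ {A B : Set} (g : B → ℚ) (f : A → List B) xs →
  sumℚ (List.map g (concatMap f xs)) ≡ sumℚ (List.map (λ x → sumℚ (List.map g (f x))) xs)
sumℚ-concatMap g f [] = refl
sumℚ-concatMap g f (x ∷ xs) = begin
  sumℚ (List.map g (f x List.++ concatMap f xs))                ≡⟨ cong sumℚ (List.map-++ g (f x) (concatMap f xs)) ⟩
  sumℚ (List.map g (f x) List.++ List.map g (concatMap f xs))   ≡⟨ sumℚ-++ (List.map g (f x)) _ ⟩
  sumℚ (List.map g (f x)) + sumℚ (List.map g (concatMap f xs))  ≡⟨ cong (sumℚ (List.map g (f x)) +_) (sumℚ-concatMap g f xs) ⟩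
  sumℚ (List.map g (f x)) + sumℚ (List.map (λ x → sumℚ (List.map g (f x))) xs) ∎
  where open ≡-Reasoning

sumℚ-tabulate : ∀ {A : Set} {n} (f : A → ℚ) (g : Fin n → A) → sumℚ (List.map f (List.tabulate g)) ≡ sum (f ∘ g)
sumℚ-tabulate {n = ℕ.zero} f g = refl
sumℚ-tabulate {n = ℕ.suc n} f g = cong (f (g zero) +_) (sumℚ-tabulate f (g ∘ suc))

sumℚ-allFin : ∀ {n} (f : Fin n → ℚ) → sumℚ (List.map f (allFin n)) ≡ sum f
sumℚ-allFin f = sumℚ-tabulate f (λ i → i)

sumℚ-singleton-if : ∀ {A : Set} (g : A → ℚ) b x → sumℚ (List.map g (if b then [ x ] else [])) ≡ when b (g x)
sumℚ-singleton-if g true x = ℚ.+-identityʳ (g x)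
sumℚ-singleton-if g false x = refl

sumℚ-edges : ∀ {m} (I : Graph m) (g : Fin m × Fin m → ℚ) →
  sumℚ (List.map g (edges I)) ≡ ∑[ i < m ] ∑[ j < m ] when (i ≺ j) (when (adj I i j) (g (i , j)))
sumℚ-edges {m} I g = begin
  sumℚ (List.map g (edges I))
    ≡⟨ sumℚ-filterᵇ _ g (allPairs m) ⟩
  sumℚ (List.map g′ (allPairs m))
    ≡⟨ sumℚ-concatMap g′ row (allFin m) ⟩
  sumℚ (List.map (λ i → sumℚ (List.map g′ (row i))) (allFin m))
    ≡⟨ sumℚ-allFin (λ i → sumℚ (List.map g′ (row i))) ⟩
  ∑[ i < m ] sumℚ (List.map g′ (row i))
    ≡⟨ sum-cong-≗ (λ i → trans (sumℚ-concatMap g′ _ (allFin m)) (trans (sumℚ-allFin {m} (λ j → sumℚ (List.map g′ (if i ≺ j then [ (i , j) ] else [])))) (sum-cong-≗ (λ j → sumℚ-singleton-if g′ (i ≺ j) (i , j))))) ⟩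
  ∑[ i < m ] ∑[ j < m ] when (i ≺ j) (when (adj I i j) (g (i , j))) ∎
  where
  open ≡-Reasoning
  g′ : Fin m × Fin m → ℚ
  g′ (i , j) = when (adj I i j) (g (i , j))
  row : Fin m → List (Fin m × Fin m)
  row i = concatMap (λ j → if i ≺ j then [ (i , j) ] else []) (allFin m)

∈-concatMap⁻ : ∀ {A B : Set} (f : A → List B) {y} xs → y ∈ concatMap f xs → ∃[ x ] y ∈ f x
∈-concatMap⁻ f xs y∈ = Any.satisfied (AnyP.concatMap⁻ f {xs = xs} y∈)

∈-concatMap⁺ : ∀ {A B : Set} (f : A → List B) {x y} xs → x ∈ xs → y ∈ f x → y ∈ concatMap f xs
∈-concatMap⁺ f xs x∈xs y∈fx = AnyP.concatMap⁺ f (Any.map (λ { refl → y∈fx }) x∈xs)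

∈-if⁻ : ∀ {A : Set} b {x y : A} → y ∈ (if b then [ x ] else []) → y ≡ x × b ≡ true
∈-if⁻ true (here y≡x) = y≡x , refl

∈-edges⁻ : ∀ {m} (I : Graph m) {i j} → (i , j) ∈ edges I → (i ≺ j) ≡ true × adj I i j ≡ true
∈-edges⁻ {m} I {i} {j} ij∈ with Membership.∈-filter⁻ (T? ∘ λ (a , b) → adj I a b) {xs = allPairs m} ij∈
... | ij∈pairs , adj-ij with ∈-concatMap⁻ _ (allFin m) ij∈pairs
... | i′ , ij∈row with ∈-concatMap⁻ _ (allFin m) ij∈row
... | j′ , ij∈if with ∈-if⁻ (i′ ≺ j′) ij∈if
... | refl , i≺j = i≺j , Equivalence.to T-≡ adj-ij

∈-edges⁺ : ∀ {m} (I : Graph m) {i j} → (i ≺ j) ≡ true → adj I i j ≡ true → (i , j) ∈ edges I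
∈-edges⁺ {m} I {i} {j} i≺j adj-ij = Membership.∈-filter⁺ (T? ∘ λ (a , b) → adj I a b)
  (∈-concatMap⁺ _ (allFin m) (Membership.∈-allFin i) (∈-concatMap⁺ _ (allFin m) (Membership.∈-allFin j) ij∈if))
  (Equivalence.from T-≡ adj-ij)
  where
  ij∈if : (i , j) ∈ (if i ≺ j then [ (i , j) ] else [])
  ij∈if rewrite i≺j = here refl

Antisymmetric : ∀ {m} → (Fin m → Fin m → ℚ) → Set
Antisymmetric ω = ∀ i j → ω j i ≡ - ω i j

SupportedOn : ∀ {m} → (Fin m → Fin m → Bool) → (Fin m → Fin m → ℚ) → Set
SupportedOn A ω = ∀ i j → A i j ≡ false → ω i j ≡ 0ℚ

IsStress : ∀ {d m} → Config d m → (Fin m → Fin m → ℚ) → Set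
IsStress {m = m} q ω = ∀ k c → ∑[ j < m ] (ω k j * q j c) ≡ 0ℚ

StressFree : ∀ {d m} → Config d m → (Fin m → Fin m → Bool) → Set
StressFree q A = ∀ ω → Antisymmetric ω → SupportedOn A ω → IsStress q ω → ∀ i j → ω i j ≡ 0ℚ

antisymmetric-diagonal : ∀ {m} {ω : Fin m → Fin m → ℚ} → Antisymmetric ω → ∀ i → ω i i ≡ 0ℚ
antisymmetric-diagonal {ω = ω} antisym i = x*y≡0⇒x≡0 (ω i i) (1ℚ + 1ℚ) (begin
  ω i i * (1ℚ + 1ℚ)  ≡⟨ solve 1 (λ a → a :* (con 1ℚ :+ con 1ℚ) := a :+ a) refl (ω i i) ⟩
  ω i i + ω i i      ≡⟨ cong (ω i i +_) (antisym i i) ⟩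
  ω i i + - ω i i    ≡⟨ ℚ.+-inverseʳ (ω i i) ⟩
  0ℚ                 ∎) λ ()
  where open ≡-Reasoning

stressFree-cong : ∀ {d n} {q q′ : Config d n} A → (∀ j c → q j c ≡ q′ j c) → StressFree q A → StressFree q′ A
stressFree-cong A q≗q′ stress-free ω antisym supported stress =
  stress-free ω antisym supported (λ k c → trans (sum-cong-≗ (λ j → cong (ω k j *_) (q≗q′ j c))) (stress k c))

supportedOn-mono : ∀ {m} {A A′ : Fin m → Fin m → Bool} {ω} → (∀ i j → A i j ≡ true → A′ i j ≡ true) →
  SupportedOn A ω → SupportedOn A′ ω
supportedOn-mono {A = A} A⊆A′ supported i j ij∉A′ with A i j in Aij
... | true = ⊥-elim (true≢false (trans (sym (A⊆A′ i j Aij)) ij∉A′))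
... | false = supported i j Aij

-- The stress whose value on an edge i < j is the coefficient λ (i , j) of row {i,j}.
stressOf : ∀ {m} → (Fin m → Fin m → Bool) → (Fin m × Fin m → ℚ) → Fin m → Fin m → ℚ
stressOf A λc k j = when (A k j) (if k ≺ j then λc (k , j) else (if j ≺ k then - λc (j , k) else 0ℚ))

hyperRow-≺ : ∀ {d m} (p : Config d m) {i j} k c → (i ≺ j) ≡ true →
  hyperRow p (i , j) k c ≡ when (k == i) (p j c) + when (k == j) (- p i c)
hyperRow-≺ p {i} {j} k c i≺j with k Fin.≟ i
... | yes refl = begin
  p j c                   ≡⟨ ℚ.+-identityʳ (p j c) ⟨
  p j c + 0ℚ              ≡⟨ cong (p j c +_) (when-false (- p k c) (≢⇒==-false k≢j)) ⟨
  p j c + when (k == j) (- p k c) ∎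
  where
  open ≡-Reasoning
  k≢j : k ≢ j
  k≢j refl = true≢false (trans (sym i≺j) (≺-irrefl k))
... | no _ with k == j
...   | true = sym (ℚ.+-identityˡ _)
...   | false = refl

private
  when-distrib : ∀ a b b′ l x y →
    when a (l * (when b x + when b′ y)) ≡ when b (when a (l * x)) + when b′ (when a (l * y))
  when-distrib false b b′ l x y = sym (trans (cong₂ _+_ (when-0 b) (when-0 b′)) (ℚ.+-identityˡ 0ℚ))
  when-distrib true true true l x y = ℚ.*-distribˡ-+ l x y
  when-distrib true true false l x y = trans (cong (l *_) (ℚ.+-identityʳ x)) (sym (ℚ.+-identityʳ (l * x)))
  when-distrib true false true l x y = trans (cong (l *_) (ℚ.+-identityˡ y)) (sym (ℚ.+-identityˡ (l * y)))
  when-distrib true false false l x y = trans (cong (l *_) (ℚ.+-identityˡ 0ℚ)) (trans (ℚ.*-zeroʳ l) (sym (ℚ.+-identityˡ 0ℚ)))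

  when-merge : ∀ b b′ a l l′ x → (b ≡ true → b′ ≡ false) →
    when b (when a (l * x)) + when b′ (when a (l′ * - x)) ≡ when a (if b then l else (if b′ then - l′ else 0ℚ)) * x
  when-merge true b′ a l l′ x b⇒¬b′ rewrite b⇒¬b′ refl = trans (ℚ.+-identityʳ _) (when-*ʳ a l x)
  when-merge false true a l l′ x _ = trans (ℚ.+-identityˡ _) (trans (cong (when a) (trans (sym (ℚ.neg-distribʳ-* l′ x)) (ℚ.neg-distribˡ-* l′ x))) (when-*ʳ a (- l′) x))
  when-merge false false a l l′ x _ = trans (ℚ.+-identityˡ 0ℚ) (trans (sym (ℚ.*-zeroˡ x)) (cong (_* x) (sym (when-0 a))))

hyperRow-combination : ∀ {d m} (p : Config d m) (I : Graph m) (λc : Fin m × Fin m → ℚ) k c →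
  sumℚ (List.map (λ e → λc e * hyperRow p e k c) (edges I)) ≡ ∑[ j < m ] (stressOf (adj I) λc k j * p j c)
hyperRow-combination {m = m} p I λc k c = begin
  sumℚ (List.map (λ e → λc e * hyperRow p e k c) (edges I))
    ≡⟨ sumℚ-edges I (λ e → λc e * hyperRow p e k c) ⟩
  ∑[ i < m ] ∑[ j < m ] when (i ≺ j) (when (A i j) (λc (i , j) * hyperRow p (i , j) k c))
    ≡⟨ sum-cong-≗ (λ i → sum-cong-≗ (λ j → split i j)) ⟩
  ∑[ i < m ] ∑[ j < m ] (when (k == i) (U i j) + when (k == j) (V i j))
    ≡⟨ sum-cong-≗ (λ i → ∑-distrib-+ (λ j → when (k == i) (U i j)) (λ j → when (k == j) (V i j))) ⟩
  ∑[ i < m ] (∑[ j < m ] when (k == i) (U i j) + ∑[ j < m ] when (k == j) (V i j))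
    ≡⟨ ∑-distrib-+ (λ i → ∑[ j < m ] when (k == i) (U i j)) (λ i → ∑[ j < m ] when (k == j) (V i j)) ⟩
  ∑[ i < m ] ∑[ j < m ] when (k == i) (U i j) + ∑[ i < m ] ∑[ j < m ] when (k == j) (V i j)
    ≡⟨ cong₂ _+_ (trans (sum-cong-≗ (λ i → sum-when (k == i) (U i))) (sum-δ′ k (λ i → sum (U i))))
                 (trans (∑-comm (λ i j → when (k == j) (V i j)))
                   (trans (sum-cong-≗ (λ j → sum-when (k == j) (λ i → V i j))) (sum-δ′ k (λ j → ∑[ i < m ] V i j)))) ⟩
  sum (U k) + ∑[ i < m ] V i k
    ≡⟨ ∑-distrib-+ (U k) (λ j → V j k) ⟨
  ∑[ j < m ] (U k j + V j k)
    ≡⟨ sum-cong-≗ (λ j → trans (cong (λ a → U k j + when (j ≺ k) (when a (λc (j , k) * - p j c))) (Graph.sym I j k))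
                                (when-merge (k ≺ j) (j ≺ k) (A k j) (λc (k , j)) (λc (j , k)) (p j c) (≺-asym k j))) ⟩
  ∑[ j < m ] (stressOf A λc k j * p j c) ∎
  where
  open ≡-Reasoning
  A = adj I
  U V : Fin m → Fin m → ℚ
  U i j = when (i ≺ j) (when (A i j) (λc (i , j) * p j c))
  V i j = when (i ≺ j) (when (A i j) (λc (i , j) * - p i c))
  split : ∀ i j → when (i ≺ j) (when (A i j) (λc (i , j) * hyperRow p (i , j) k c)) ≡ when (k == i) (U i j) + when (k == j) (V i j)
  split i j with i ≺ j in i≺j
  ... | false = sym (trans (cong₂ _+_ (when-0 (k == i)) (when-0 (k == j))) (ℚ.+-identityˡ 0ℚ))
  ... | true = trans (cong (λ z → when (A i j) (λc (i , j) * z)) (hyperRow-≺ p k c i≺j))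
                     (when-distrib (A i j) (k == i) (k == j) (λc (i , j)) (p j c) (- p i c))

module _ {d m} (p : Config d m) (I : Graph m) where

  private
    A = adj I

    adjacent-≺-cases : ∀ i j → A i j ≡ true → (i ≺ j) ≡ false → (j ≺ i) ≡ true
    adjacent-≺-cases i j adj-ij i⊀j with j ≺ i in j≺i
    ... | true = refl
    ... | false = ⊥-elim (true≢false (trans (sym adj-ij) (subst (λ z → A i z ≡ false) (≺-connex i j i⊀j j≺i) (Graph.irref I i))))

  rowsIndep⇒stressFree : RowsIndep p I → StressFree p A
  rowsIndep⇒stressFree independent ω antisym supported stress = ω≡0
    where
    λω : Fin m × Fin m → ℚ
    λω (i , j) = ω i j
    stressOf-λω : ∀ k j → stressOf A λω k j ≡ ω k j
    stressOf-λω k j with A k j in adj-kj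
    ... | false = sym (supported k j adj-kj)
    ... | true with k ≺ j in k≺j
    ...   | true = refl
    ...   | false rewrite adjacent-≺-cases k j adj-kj k≺j = sym (antisym j k)
    λω≡0 : ∀ e → e ∈ edges I → λω e ≡ 0ℚ
    λω≡0 = independent λω λ k c →
      trans (hyperRow-combination p I λω k c) (trans (sum-cong-≗ (λ j → cong (_* p j c) (stressOf-λω k j))) (stress k c))
    ω≡0 : ∀ i j → ω i j ≡ 0ℚ
    ω≡0 i j with A i j in adj-ij
    ... | false = supported i j adj-ij
    ... | true with i ≺ j in i≺j
    ...   | true = λω≡0 (i , j) (∈-edges⁺ I i≺j adj-ij)
    ...   | false = trans (antisym j i) (-x≡0 (λω≡0 (j , i) (∈-edges⁺ I (adjacent-≺-cases i j adj-ij i≺j) (trans (Graph.sym I j i) adj-ij))))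

  stressFree⇒rowsIndep : StressFree p A → RowsIndep p I
  stressFree⇒rowsIndep stress-free λc combination-zero (i , j) ij∈ =
    trans (sym ω≡λ) (stress-free ω antisym supported stress i j)
    where
    ω = stressOf A λc
    antisym : Antisymmetric ω
    antisym a b rewrite Graph.sym I b a with A a b
    ... | false = refl
    ... | true with a ≺ b in a≺b
    ...   | true rewrite ≺-asym a b a≺b = refl
    ...   | false with b ≺ a
    ...     | true = solve 1 (λ x → x := :- (:- x)) refl (λc (b , a))
    ...     | false = refl
    supported : SupportedOn A ω
    supported a b adj-ab rewrite adj-ab = refl
    stress : IsStress p ω
    stress k c = trans (sym (hyperRow-combination p I λc k c)) (combination-zero k c)
    ω≡λ : ω i j ≡ λc (i , j)
    ω≡λ rewrite proj₂ (∈-edges⁻ I ij∈) | proj₁ (∈-edges⁻ I ij∈) = refl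

_⊕_ : ∀ {U X Y} → Linear U X → Linear U Y → Linear U (X ⊎ Y)
L ⊕ M = record
  { app = λ { f (inj₁ x) → app L f x ; f (inj₂ y) → app M f y }
  ; app-cong = λ { f≗g (inj₁ x) → app-cong L f≗g x ; f≗g (inj₂ y) → app-cong M f≗g y }
  ; app-+ = λ { f g (inj₁ x) → app-+ L f g x ; f g (inj₂ y) → app-+ M f g y }
  ; app-* = λ { a f (inj₁ x) → app-* L a f x ; a f (inj₂ y) → app-* M a f y } }

0ᴸ : ∀ {U X} → Linear U X
0ᴸ = record
  { app = λ _ _ → 0ℚ
  ; app-cong = λ _ _ → refl
  ; app-+ = λ _ _ _ → sym (ℚ.+-identityˡ 0ℚ)
  ; app-* = λ a _ _ → sym (ℚ.*-zeroʳ a) }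

equilibrium : ∀ {d n} → Config d n → Linear (Fin n × Fin n) (Fin n × Fin d)
equilibrium {n = n} q = record
  { app = λ f (k , c) → ∑[ j < n ] (f (k , j) * q j c)
  ; app-cong = λ f≗g (k , c) → sum-cong-≗ (λ j → cong (_* q j c) (f≗g (k , j)))
  ; app-+ = λ f g (k , c) → trans (sum-cong-≗ (λ j → ℚ.*-distribʳ-+ (q j c) (f (k , j)) (g (k , j)))) (∑-distrib-+ (λ j → f (k , j) * q j c) (λ j → g (k , j) * q j c))
  ; app-* = λ a f (k , c) → trans (sum-cong-≗ (λ j → ℚ.*-assoc a (f (k , j)) (q j c))) (sym (*-distribˡ-sum a (λ j → f (k , j) * q j c))) }

-- Rows forcing antisymmetry and support in A, so that the kernel of stressMap consists of stresses.
constraints : ∀ {n} → (Fin n → Fin n → Bool) → Linear (Fin n × Fin n) ((Fin n × Fin n) ⊎ (Fin n × Fin n))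
constraints A = record
  { app = λ { f (inj₁ (a , b)) → f (a , b) + f (b , a) ; f (inj₂ (a , b)) → when (not (A a b)) (f (a , b)) }
  ; app-cong = λ { f≗g (inj₁ (a , b)) → cong₂ _+_ (f≗g (a , b)) (f≗g (b , a))
                 ; f≗g (inj₂ (a , b)) → cong (when (not (A a b))) (f≗g (a , b)) }
  ; app-+ = λ { f g (inj₁ (a , b)) → solve 4 (λ x y z t → (x :+ y) :+ (z :+ t) := (x :+ z) :+ (y :+ t)) refl (f (a , b)) (g (a , b)) (f (b , a)) (g (b , a))
              ; f g (inj₂ (a , b)) → when-+ (not (A a b)) (f (a , b)) (g (a , b)) }
  ; app-* = λ { c f (inj₁ (a , b)) → sym (ℚ.*-distribˡ-+ c (f (a , b)) (f (b , a)))
              ; c f (inj₂ (a , b)) → when-*ˡ (not (A a b)) c (f (a , b)) } }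

stressMap : ∀ {d n} → Config d n → (Fin n → Fin n → Bool) →
  Linear (Fin n × Fin n) ((Fin n × Fin d) ⊎ ((Fin n × Fin n) ⊎ (Fin n × Fin n)))
stressMap q A = equilibrium q ⊕ constraints A

stressRowsᴱ : ∀ d n → Enumeration ((Fin n × Fin d) ⊎ ((Fin n × Fin n) ⊎ (Fin n × Fin n)))
stressRowsᴱ d n = (allFinᴱ n ×ᴱ allFinᴱ d) ⊎ᴱ (pairsᴱ ⊎ᴱ pairsᴱ)
  where pairsᴱ = allFinᴱ n ×ᴱ allFinᴱ n

module _ {d n} (q : Config d n) (A : Fin n → Fin n → Bool) where

  kernel⇒stress : ∀ f → Kernel (stressMap q A) f →
    Antisymmetric (λ a b → f (a , b)) × SupportedOn A (λ a b → f (a , b)) × IsStress q (λ a b → f (a , b))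
  kernel⇒stress f f-ker = antisym , supported , stress
    where
    antisym : Antisymmetric (λ a b → f (a , b))
    antisym a b = x+y≡0⇒x≡-y (trans (ℚ.+-comm (f (b , a)) (f (a , b))) (f-ker (inj₂ (inj₁ (a , b)))))
    supported : SupportedOn A (λ a b → f (a , b))
    supported a b adj-ab = trans (sym (when-true (f (a , b)) (cong not adj-ab))) (f-ker (inj₂ (inj₂ (a , b))))
    stress : IsStress q (λ a b → f (a , b))
    stress k c = f-ker (inj₁ (k , c))

  stressFree⇒injective : StressFree q A → Injective (stressMap q A)
  stressFree⇒injective stress-free f f-ker (i , j) = stress-free _ antisym supported stress i j
    where open Σ (kernel⇒stress f f-ker) renaming (proj₁ to antisym; proj₂ to rest)
          supported = proj₁ rest
          stress = proj₂ rest

  injective⇒stressFree : Injective (stressMap q A) → StressFree q A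
  injective⇒stressFree injective ω antisym supported stress i j = injective (λ (a , b) → ω a b) ω-ker (i , j)
    where
    ω-ker : Kernel (stressMap q A) (λ (a , b) → ω a b)
    ω-ker (inj₁ (k , c)) = stress k c
    ω-ker (inj₂ (inj₁ (a , b))) = trans (cong (ω a b +_) (antisym a b)) (ℚ.+-inverseʳ (ω a b))
    ω-ker (inj₂ (inj₂ (a , b))) with A a b in adj-ab
    ... | true = refl
    ... | false = supported a b adj-ab

  stressFree-or-stress : StressFree q A ⊎ Σ (Fin n × Fin n → ℚ) (λ f → Nontrivial f × Kernel (stressMap q A) f)
  stressFree-or-stress with injective-or-kernel-↔ Fin.*↔× (stressMap q A) (stressRowsᴱ d n)
  ... | inj₁ injective = inj₁ (injective⇒stressFree injective)
  ... | inj₂ kernel = inj₂ kernel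

  stressFree? : Dec (StressFree q A)
  stressFree? with stressFree-or-stress
  ... | inj₁ stress-free = yes stress-free
  ... | inj₂ (f , (u , fu≢0) , f-ker) = no λ stress-free → fu≢0 (stressFree⇒injective stress-free f f-ker u)

-- Independent points and the moment curve

PointsIndependent : ∀ {d n} → Config d n → (Fin n → Bool) → Set
PointsIndependent {d} {n} q S =
  ∀ (γ : Fin n → ℚ) → (∀ c → ∑[ j < n ] when (S j) (γ j * q j c) ≡ 0ℚ) → ∀ j → S j ≡ true → γ j ≡ 0ℚ

combinationMap : ∀ {d n} → Config d n → (Fin n → Bool) → Linear (Fin n) (Fin d)
combinationMap {n = n} q S = record
  { app = λ γ c → ∑[ j < n ] when (S j) (γ j * q j c)
  ; app-cong = λ γ≗γ′ c → sum-cong-≗ (λ j → cong (λ z → when (S j) (z * q j c)) (γ≗γ′ j))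
  ; app-+ = λ γ γ′ c → trans (sum-cong-≗ (λ j → trans (cong (when (S j)) (ℚ.*-distribʳ-+ (q j c) (γ j) (γ′ j))) (when-+ (S j) _ _)))
                              (∑-distrib-+ (λ j → when (S j) (γ j * q j c)) (λ j → when (S j) (γ′ j * q j c)))
  ; app-* = λ a γ c → trans (sum-cong-≗ (λ j → trans (cong (when (S j)) (ℚ.*-assoc a (γ j) (q j c))) (when-*ˡ (S j) a _)))
                             (sym (*-distribˡ-sum a (λ j → when (S j) (γ j * q j c)))) }

offSupport : ∀ {n} → (Fin n → Bool) → Linear (Fin n) (Fin n)
offSupport S = record
  { app = λ γ j → when (not (S j)) (γ j)
  ; app-cong = λ γ≗γ′ j → cong (when (not (S j))) (γ≗γ′ j)
  ; app-+ = λ γ γ′ j → when-+ (not (S j)) (γ j) (γ′ j)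
  ; app-* = λ a γ j → when-*ˡ (not (S j)) a (γ j) }

pointsMap : ∀ {d n} → Config d n → (Fin n → Bool) → Linear (Fin n) (Fin d ⊎ Fin n)
pointsMap q S = combinationMap q S ⊕ offSupport S

module _ {d n} (q : Config d n) (S : Fin n → Bool) where

  pointsIndependent⇒injective : PointsIndependent q S → Injective (pointsMap q S)
  pointsIndependent⇒injective independent γ γ-ker j with S j in Sj
  ... | true = independent γ (γ-ker ∘ inj₁) j Sj
  ... | false = trans (sym (when-true (γ j) (cong not Sj))) (γ-ker (inj₂ j))

  injective⇒pointsIndependent : Injective (pointsMap q S) → PointsIndependent q S
  injective⇒pointsIndependent injective γ γ-comb j Sj = trans (sym (when-true (γ j) Sj)) (injective γS γS-ker j)
    where
    γS = λ j → when (S j) (γ j)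
    γS-ker : Kernel (pointsMap q S) γS
    γS-ker (inj₁ c) = trans (sum-cong-≗ (λ j → idem (S j) (γ j) (q j c))) (γ-comb c)
      where idem : ∀ b x y → when b (when b x * y) ≡ when b (x * y)
            idem true x y = refl
            idem false x y = refl
    γS-ker (inj₂ j) = off (S j) (γ j)
      where off : ∀ b x → when (not b) (when b x) ≡ 0ℚ
            off true x = refl
            off false x = refl

  pointsIndependent? : Dec (PointsIndependent q S)
  pointsIndependent? with injective-or-kernel (pointsMap q S) (allFinᴱ d ⊎ᴱ allFinᴱ n)
  ... | inj₁ injective = yes (injective⇒pointsIndependent injective)
  ... | inj₂ (γ , (j , γj≢0) , γ-ker) = no λ independent → γj≢0 (pointsIndependent⇒injective independent γ γ-ker j)

𝟙 : Bool → ℕ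
𝟙 true = 1
𝟙 false = 0

count : ∀ {n} → (Fin n → Bool) → ℕ
count {n} S = Σℕ.sum (λ j → 𝟙 (S j))

count-remove : ∀ {n} (S : Fin n → Bool) j₀ → S j₀ ≡ true → count S ≡ ℕ.suc (count (λ j → S j ∧ not (j == j₀)))
count-remove {ℕ.suc n} S j₀ Sj₀ = begin
  count S
    ≡⟨ Σℕ.sum-remove {i = j₀} (λ j → 𝟙 (S j)) ⟩
  𝟙 (S j₀) ℕ.+ Σℕ.sum (λ j → 𝟙 (S (punchIn j₀ j)))
    ≡⟨ cong₂ (λ a b → 𝟙 a ℕ.+ b) Sj₀ (Σℕ.sum-cong-≗ λ j → cong 𝟙 (away j)) ⟩
  ℕ.suc (Σℕ.sum (λ j → 𝟙 (S′ (punchIn j₀ j))))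
    ≡⟨ cong (λ b → ℕ.suc (𝟙 b ℕ.+ Σℕ.sum (λ j → 𝟙 (S′ (punchIn j₀ j))))) at-j₀ ⟨
  ℕ.suc (𝟙 (S′ j₀) ℕ.+ Σℕ.sum (λ j → 𝟙 (S′ (punchIn j₀ j))))
    ≡⟨ cong ℕ.suc (Σℕ.sum-remove {i = j₀} (λ j → 𝟙 (S′ j))) ⟨
  ℕ.suc (count S′) ∎
  where
  open ≡-Reasoning
  S′ = λ j → S j ∧ not (j == j₀)
  away : ∀ j → S (punchIn j₀ j) ≡ S′ (punchIn j₀ j)
  away j = sym (trans (cong (λ b → S (punchIn j₀ j) ∧ not b) (≢⇒==-false (Fin.punchInᵢ≢i j₀ j))) (∧-identityʳ _))
  at-j₀ : S′ j₀ ≡ false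
  at-j₀ = trans (cong (λ b → S j₀ ∧ not b) (==-refl j₀)) (∧-zeroʳ (S j₀))

vandermonde : ∀ d {n} (τ : Fin n → ℚ) (S : Fin n → Bool) →
  (∀ a b → S a ≡ true → S b ≡ true → τ a ≡ τ b → a ≡ b) → count S ≤ d → PointsIndependent (moment {d} τ) S
vandermonde ℕ.zero τ S distinct count≤0 γ _ j Sj =
  ⊥-elim (ℕ.n≮0 (subst (_≤ 0) (count-remove S j Sj) count≤0))
vandermonde (ℕ.suc d) {n} τ S distinct count≤ γ γ-comb with Fin.any? (λ j → S j Bool.≟ true)
... | no none = λ j Sj → ⊥-elim (none (j , Sj))
... | yes (j₀ , Sj₀) = γ≡0
  where
  open ≡-Reasoning
  S′ = λ j → S j ∧ not (j == j₀)
  S′⇒S : ∀ j → S′ j ≡ true → S j ≡ true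
  S′⇒S j = ∧-conicalˡ (S j) _
  count-S′ : count S′ ≤ d
  count-S′ = ℕ.≤-pred (subst (_≤ ℕ.suc d) (count-remove S j₀ Sj₀) count≤)
  γ′ : Fin n → ℚ
  γ′ j = γ j * (τ j - τ j₀)
  shifted-term : ∀ b e g t t₀ x → (e ≡ true → t ≡ t₀) →
    when (b ∧ not e) (g * (t - t₀) * x) ≡ when b (g * (t * x)) + (- t₀) * when b (g * x)
  shifted-term false e g t t₀ x _ = solve 1 (λ t₀ → con 0ℚ := con 0ℚ :+ t₀ :* con 0ℚ) refl (- t₀)
  shifted-term true false g t t₀ x _ = solve 4 (λ g t t₀ x → g :* (t :+ (:- t₀)) :* x := g :* (t :* x) :+ (:- t₀) :* (g :* x)) refl g t t₀ x
  shifted-term true true g t t₀ x e⇒t≡t₀ with e⇒t≡t₀ refl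
  ... | refl = solve 3 (λ g t x → con 0ℚ := g :* (t :* x) :+ (:- t) :* (g :* x)) refl g t x
  γ′-comb : ∀ (c : Fin d) → ∑[ j < n ] when (S′ j) (γ′ j * (τ j ^ℚ toℕ c)) ≡ 0ℚ
  γ′-comb c = begin
    ∑[ j < n ] when (S′ j) (γ′ j * (τ j ^ℚ toℕ c))
      ≡⟨ sum-cong-≗ (λ j → shifted-term (S j) (j == j₀) (γ j) (τ j) (τ j₀) (τ j ^ℚ toℕ c) (cong τ ∘ ==⇒≡)) ⟩
    ∑[ j < n ] (when (S j) (γ j * (τ j * (τ j ^ℚ toℕ c))) + (- τ j₀) * when (S j) (γ j * (τ j ^ℚ toℕ c)))
      ≡⟨ ∑-distrib-+ (λ j → when (S j) (γ j * (τ j * (τ j ^ℚ toℕ c)))) (λ j → (- τ j₀) * when (S j) (γ j * (τ j ^ℚ toℕ c))) ⟩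
    ∑[ j < n ] when (S j) (γ j * (τ j * (τ j ^ℚ toℕ c))) + ∑[ j < n ] ((- τ j₀) * when (S j) (γ j * (τ j ^ℚ toℕ c)))
      ≡⟨ cong₂ _+_ (γ-comb (suc c)) (trans (sym (*-distribˡ-sum (- τ j₀) (λ j → when (S j) (γ j * (τ j ^ℚ toℕ c)))))
                                       (cong ((- τ j₀) *_) (trans (sum-cong-≗ (λ j → cong (λ k → when (S j) (γ j * (τ j ^ℚ k))) (sym (Fin.toℕ-inject₁ c))))
                                                                  (γ-comb (Fin.inject₁ c))))) ⟩
    0ℚ + (- τ j₀) * 0ℚ
      ≡⟨ solve 1 (λ t → con 0ℚ :+ t :* con 0ℚ := con 0ℚ) refl (- τ j₀) ⟩
    0ℚ ∎
  γ′≡0 : ∀ j → S′ j ≡ true → γ′ j ≡ 0ℚ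
  γ′≡0 = vandermonde d τ S′ (λ a b S′a S′b → distinct a b (S′⇒S a S′a) (S′⇒S b S′b)) count-S′ γ′ γ′-comb
  γ≡0-away : ∀ j → S j ≡ true → j ≢ j₀ → γ j ≡ 0ℚ
  γ≡0-away j Sj j≢j₀ = x*y≡0⇒x≡0 (γ j) _ (γ′≡0 j (trans (cong₂ _∧_ Sj (cong not (≢⇒==-false j≢j₀))) refl))
                                         (x≢y⇒x-y≢0 (j≢j₀ ∘ distinct j j₀ Sj Sj₀))
  γj₀≡0 : γ j₀ ≡ 0ℚ
  γj₀≡0 = begin
    γ j₀                                          ≡⟨ sum-δ j₀ γ ⟨
    ∑[ j < n ] when (j == j₀) (γ j)               ≡⟨ sum-cong-≗ only-j₀ ⟨
    ∑[ j < n ] when (S j) (γ j * 1ℚ)              ≡⟨ γ-comb zero ⟩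
    0ℚ                                            ∎
    where
    only-j₀ : ∀ j → when (S j) (γ j * 1ℚ) ≡ when (j == j₀) (γ j)
    only-j₀ j with j Fin.≟ j₀
    ... | yes refl = trans (cong (λ b → when b (γ j₀ * 1ℚ)) Sj₀) (ℚ.*-identityʳ (γ j₀))
    ... | no j≢j₀ with S j in Sj
    ...   | true = trans (ℚ.*-identityʳ (γ j)) (γ≡0-away j Sj j≢j₀)
    ...   | false = refl
  γ≡0 : ∀ j → S j ≡ true → γ j ≡ 0ℚ
  γ≡0 j Sj with j Fin.≟ j₀
  ... | yes refl = γj₀≡0
  ... | no j≢j₀ = γ≡0-away j Sj j≢j₀

-- Counting edges

length-filterᵇ : ∀ {A : Set} (p : A → Bool) xs → length (filterᵇ p xs) ≡ ℕL.sum (List.map (𝟙 ∘ p) xs)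
length-filterᵇ p [] = refl
length-filterᵇ p (x ∷ xs) with p x
... | true = cong ℕ.suc (length-filterᵇ p xs)
... | false = length-filterᵇ p xs

sumℕ-concatMap : ∀ {A B : Set} (f : B → ℕ) (g : A → List B) xs →
  ℕL.sum (List.map f (concatMap g xs)) ≡ ℕL.sum (List.map (λ x → ℕL.sum (List.map f (g x))) xs)
sumℕ-concatMap f g [] = refl
sumℕ-concatMap f g (x ∷ xs) = begin
  ℕL.sum (List.map f (g x List.++ concatMap g xs))                  ≡⟨ cong ℕL.sum (List.map-++ f (g x) (concatMap g xs)) ⟩
  ℕL.sum (List.map f (g x) List.++ List.map f (concatMap g xs))     ≡⟨ ℕL.sum-++ (List.map f (g x)) _ ⟩
  ℕL.sum (List.map f (g x)) ℕ.+ ℕL.sum (List.map f (concatMap g xs)) ≡⟨ cong (ℕL.sum (List.map f (g x)) ℕ.+_) (sumℕ-concatMap f g xs) ⟩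
  ℕL.sum (List.map f (g x)) ℕ.+ ℕL.sum (List.map (λ x → ℕL.sum (List.map f (g x))) xs) ∎
  where open ≡-Reasoning

sumℕ-tabulate : ∀ {A : Set} {n} (f : A → ℕ) (g : Fin n → A) → ℕL.sum (List.map f (List.tabulate g)) ≡ Σℕ.sum (f ∘ g)
sumℕ-tabulate {n = ℕ.zero} f g = refl
sumℕ-tabulate {n = ℕ.suc n} f g = cong (f (g zero) ℕ.+_) (sumℕ-tabulate f (g ∘ suc))

sumℕ-singleton-if : ∀ {A : Set} (f : A → ℕ) b x → ℕL.sum (List.map f (if b then [ x ] else [])) ≡ 𝟙 b ℕ.* f x
sumℕ-singleton-if f true x = trans (ℕ.+-identityʳ (f x)) (sym (ℕ.+-identityʳ (f x)))
sumℕ-singleton-if f false x = refl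

𝟙-∧ : ∀ a b → 𝟙 a ℕ.* 𝟙 b ≡ 𝟙 (a ∧ b)
𝟙-∧ true true = refl
𝟙-∧ true false = refl
𝟙-∧ false b = refl

𝟙-∨ : ∀ a b → a ∧ b ≡ false → 𝟙 (a ∨ b) ≡ 𝟙 a ℕ.+ 𝟙 b
𝟙-∨ true false _ = refl
𝟙-∨ false b _ = refl

𝟙-split : ∀ a b → 𝟙 a ≡ 𝟙 (a ∧ not b) ℕ.+ 𝟙 (a ∧ b)
𝟙-split true true = refl
𝟙-split true false = refl
𝟙-split false b = refl

count-filterᵇ : ∀ {n} (B : Fin n → Bool) → length (filterᵇ B (allFin n)) ≡ count B
count-filterᵇ {n} B = trans (length-filterᵇ B (allFin n)) (sumℕ-tabulate (𝟙 ∘ B) (λ i → i))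

numEdges-≺ : ∀ {m} (H : Graph m) → numEdges H ≡ Σℕ.sum (λ i → Σℕ.sum (λ j → 𝟙 ((i ≺ j) ∧ adj H i j)))
numEdges-≺ {m} H = begin
  length (filterᵇ _ (allPairs m))
    ≡⟨ length-filterᵇ _ (allPairs m) ⟩
  ℕL.sum (List.map f (allPairs m))
    ≡⟨ sumℕ-concatMap f row (allFin m) ⟩
  ℕL.sum (List.map (λ i → ℕL.sum (List.map f (row i))) (allFin m))
    ≡⟨ sumℕ-tabulate (λ i → ℕL.sum (List.map f (row i))) (λ i → i) ⟩
  Σℕ.sum (λ i → ℕL.sum (List.map f (row i)))
    ≡⟨ Σℕ.sum-cong-≗ (λ i → trans (sumℕ-concatMap f _ (allFin m)) (trans (sumℕ-tabulate (λ j → ℕL.sum (List.map f (if i ≺ j then [ (i , j) ] else []))) (λ j → j))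
         (Σℕ.sum-cong-≗ (λ j → trans (sumℕ-singleton-if f (i ≺ j) (i , j)) (𝟙-∧ (i ≺ j) (adj H i j)))))) ⟩
  Σℕ.sum (λ i → Σℕ.sum (λ j → 𝟙 ((i ≺ j) ∧ adj H i j))) ∎
  where
  open ≡-Reasoning
  f : Fin m × Fin m → ℕ
  f (i , j) = 𝟙 (adj H i j)
  row : Fin m → List (Fin m × Fin m)
  row i = concatMap (λ j → if i ≺ j then [ (i , j) ] else []) (allFin m)

degreeSum : ∀ {m} → (Fin m → Fin m → Bool) → ℕ
degreeSum A = Σℕ.sum (λ i → Σℕ.sum (λ j → 𝟙 (A i j)))

degreeSum-cong : ∀ {m} {A A′ : Fin m → Fin m → Bool} → (∀ i j → A i j ≡ A′ i j) → degreeSum A ≡ degreeSum A′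
degreeSum-cong A≡A′ = Σℕ.sum-cong-≗ (λ i → Σℕ.sum-cong-≗ (λ j → cong 𝟙 (A≡A′ i j)))

degreeSum-∨ : ∀ {m} (A A′ : Fin m → Fin m → Bool) → (∀ i j → A i j ∧ A′ i j ≡ false) →
  degreeSum (λ i j → A i j ∨ A′ i j) ≡ degreeSum A ℕ.+ degreeSum A′
degreeSum-∨ A A′ disjoint = trans
  (Σℕ.sum-cong-≗ (λ i → trans (Σℕ.sum-cong-≗ (λ j → 𝟙-∨ (A i j) (A′ i j) (disjoint i j))) (Σℕ.∑-distrib-+ (λ j → 𝟙 (A i j)) _)))
  (Σℕ.∑-distrib-+ (λ i → Σℕ.sum (λ j → 𝟙 (A i j))) _)

degreeSum-split : ∀ {m} (A X : Fin m → Fin m → Bool) →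
  degreeSum A ≡ degreeSum (λ i j → A i j ∧ not (X i j)) ℕ.+ degreeSum (λ i j → A i j ∧ X i j)
degreeSum-split A X = trans
  (Σℕ.sum-cong-≗ (λ i → trans (Σℕ.sum-cong-≗ (λ j → 𝟙-split (A i j) (X i j))) (Σℕ.∑-distrib-+ (λ j → 𝟙 (A i j ∧ not (X i j))) _)))
  (Σℕ.∑-distrib-+ (λ i → Σℕ.sum (λ j → 𝟙 (A i j ∧ not (X i j)))) _)

handshake : ∀ {m} (H : Graph m) → degreeSum (adj H) ≡ 2 ℕ.* numEdges H
handshake {m} H = begin
  degreeSum (adj H)
    ≡⟨ Σℕ.sum-cong-≗ (λ i → Σℕ.sum-cong-≗ (λ j → by-orientation i j)) ⟩
  Σℕ.sum (λ i → Σℕ.sum (λ j → 𝟙 ((i ≺ j) ∧ adj H i j) ℕ.+ 𝟙 ((j ≺ i) ∧ adj H j i)))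
    ≡⟨ Σℕ.sum-cong-≗ (λ i → Σℕ.∑-distrib-+ (λ j → 𝟙 ((i ≺ j) ∧ adj H i j)) _) ⟩
  Σℕ.sum (λ i → Σℕ.sum (λ j → 𝟙 ((i ≺ j) ∧ adj H i j)) ℕ.+ Σℕ.sum (λ j → 𝟙 ((j ≺ i) ∧ adj H j i)))
    ≡⟨ Σℕ.∑-distrib-+ (λ i → Σℕ.sum (λ j → 𝟙 ((i ≺ j) ∧ adj H i j))) _ ⟩
  E ℕ.+ Σℕ.sum (λ i → Σℕ.sum (λ j → 𝟙 ((j ≺ i) ∧ adj H j i)))
    ≡⟨ cong (E ℕ.+_) (Σℕ.∑-comm (λ i j → 𝟙 ((j ≺ i) ∧ adj H j i))) ⟩
  E ℕ.+ E
    ≡⟨ cong (E ℕ.+_) (ℕ.+-identityʳ E) ⟨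
  2 ℕ.* E
    ≡⟨ cong (2 ℕ.*_) (numEdges-≺ H) ⟨
  2 ℕ.* numEdges H ∎
  where
  open ≡-Reasoning
  E = Σℕ.sum (λ i → Σℕ.sum (λ j → 𝟙 ((i ≺ j) ∧ adj H i j)))
  by-orientation : ∀ i j → 𝟙 (adj H i j) ≡ 𝟙 ((i ≺ j) ∧ adj H i j) ℕ.+ 𝟙 ((j ≺ i) ∧ adj H j i)
  by-orientation i j with i ≺ j in i≺j
  ... | true rewrite ≺-asym i j i≺j = sym (ℕ.+-identityʳ _)
  ... | false with j ≺ i in j≺i
  ...   | true rewrite Graph.sym H i j = refl
  ...   | false rewrite ≺-connex i j i≺j j≺i | Graph.irref H j = refl

numEdges-from-degreeSum : ∀ {m} (H : Graph m) {k} → degreeSum (adj H) ≡ 2 ℕ.* k → numEdges H ≡ k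
numEdges-from-degreeSum H {k} eq = ℕ.*-cancelˡ-≡ (numEdges H) k 2 (trans (sym (handshake H)) eq)

numEdges-cong : ∀ {m} (H H′ : Graph m) → (∀ i j → adj H i j ≡ adj H′ i j) → numEdges H ≡ numEdges H′
numEdges-cong H H′ H≡H′ = numEdges-from-degreeSum H (trans (degreeSum-cong H≡H′) (handshake H′))

star : ∀ {n} → Fin n → (Fin n → Bool) → Fin n → Fin n → Bool
star v B x y = ((x == v) ∧ B y) ∨ ((y == v) ∧ B x)

star-sym : ∀ {n} (v : Fin n) (B : Fin n → Bool) x y → star v B x y ≡ star v B y x
star-sym v B x y = ∨-comm ((x == v) ∧ B y) ((y == v) ∧ B x)

star-sound : ∀ {n} (v : Fin n) (B : Fin n → Bool) {x y} → star v B x y ≡ true → (x ≡ v × B y ≡ true) ⊎ (y ≡ v × B x ≡ true)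
star-sound v B {x} {y} xy∈ with x == v in x≟v | B y in By
... | true | true = inj₁ (==⇒≡ x≟v , refl)
... | true | false with y == v in y≟v
...   | true = inj₂ (==⇒≡ y≟v , xy∈)
star-sound v B {x} {y} xy∈ | false | _ with y == v in y≟v
...   | true = inj₂ (==⇒≡ y≟v , xy∈)

star-disjoint : ∀ {n} (v : Fin n) (B : Fin n → Bool) → B v ≡ false → ∀ x y → ((x == v) ∧ B y) ∧ ((y == v) ∧ B x) ≡ false
star-disjoint v B Bv≡false x y with x Fin.≟ v
... | no _ = refl
... | yes refl rewrite Bv≡false | ∧-zeroʳ (y == x) = ∧-zeroʳ (B y)

star-irrefl : ∀ {n} (v : Fin n) (B : Fin n → Bool) → B v ≡ false → ∀ x → star v B x x ≡ false
star-irrefl v B Bv≡false x with x Fin.≟ v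
... | no _ = refl
... | yes refl rewrite Bv≡false = refl

sum-𝟙-==-∧ : ∀ {n} (v : Fin n) (f : Fin n → Bool) → Σℕ.sum (λ a → 𝟙 ((a == v) ∧ f a)) ≡ 𝟙 (f v)
sum-𝟙-==-∧ {ℕ.suc n} v f = begin
  Σℕ.sum (λ a → 𝟙 ((a == v) ∧ f a))
    ≡⟨ Σℕ.sum-remove {i = v} (λ a → 𝟙 ((a == v) ∧ f a)) ⟩
  𝟙 ((v == v) ∧ f v) ℕ.+ Σℕ.sum (λ j → 𝟙 ((punchIn v j == v) ∧ f (punchIn v j)))
    ≡⟨ cong₂ (λ a b → 𝟙 (a ∧ f v) ℕ.+ b) (==-refl v)
             (Σℕ.sum-cong-≗ (λ j → cong (λ b → 𝟙 (b ∧ f (punchIn v j))) (≢⇒==-false (Fin.punchInᵢ≢i v j)))) ⟩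
  𝟙 (f v) ℕ.+ Σℕ.sum {n} (λ _ → 0)
    ≡⟨ cong (𝟙 (f v) ℕ.+_) (Σℕ.sum-replicate-zero n) ⟩
  𝟙 (f v) ℕ.+ 0
    ≡⟨ ℕ.+-identityʳ (𝟙 (f v)) ⟩
  𝟙 (f v) ∎
  where open ≡-Reasoning

degreeSum-star : ∀ {n} (v : Fin n) (B : Fin n → Bool) → B v ≡ false → degreeSum (star v B) ≡ count B ℕ.+ count B
degreeSum-star {n} v B Bv≡false = begin
  degreeSum (star v B)
    ≡⟨ degreeSum-∨ (λ x y → (x == v) ∧ B y) (λ x y → (y == v) ∧ B x) (star-disjoint v B Bv≡false) ⟩
  Σℕ.sum (λ x → Σℕ.sum (λ y → 𝟙 ((x == v) ∧ B y))) ℕ.+ Σℕ.sum (λ x → Σℕ.sum (λ y → 𝟙 ((y == v) ∧ B x)))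
    ≡⟨ cong₂ ℕ._+_ (trans (Σℕ.∑-comm (λ x y → 𝟙 ((x == v) ∧ B y))) (Σℕ.sum-cong-≗ (λ y → sum-𝟙-==-∧ v (λ _ → B y))))
                   (Σℕ.sum-cong-≗ (λ x → sum-𝟙-==-∧ v (λ _ → B x))) ⟩
  count B ℕ.+ count B ∎
  where open ≡-Reasoning

degreeSum-⊆ : ∀ {m} (A X : Fin m → Fin m → Bool) → (∀ x y → X x y ≡ true → A x y ≡ true) →
  degreeSum A ≡ degreeSum (λ x y → A x y ∧ not (X x y)) ℕ.+ degreeSum X
degreeSum-⊆ A X X⊆A = trans (degreeSum-split A X) (cong (degreeSum (λ x y → A x y ∧ not (X x y)) ℕ.+_) (degreeSum-cong A∧X≡X))
  where
  A∧X≡X : ∀ x y → A x y ∧ X x y ≡ X x y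
  A∧X≡X x y with X x y in Xxy
  ... | true = trans (cong (_∧ true) (X⊆A x y Xxy)) refl
  ... | false = ∧-zeroʳ (A x y)

edge : ∀ {n} → Fin n → Fin n → Fin n → Fin n → Bool
edge a b = star a (_== b)

count-== : ∀ {n} (b : Fin n) → count (_== b) ≡ 1
count-== b = trans (Σℕ.sum-cong-≗ (λ a → cong 𝟙 (sym (∧-identityʳ (a == b))))) (sum-𝟙-==-∧ b (λ _ → true))

degreeSum-edge : ∀ {n} {a b : Fin n} → a ≢ b → degreeSum (edge a b) ≡ 2
degreeSum-edge {a = a} {b} a≢b = trans (degreeSum-star a (_== b) (≢⇒==-false a≢b)) (cong₂ ℕ._+_ (count-== b) (count-== b))

edge-self : ∀ {n} (a b : Fin n) → edge a b a b ≡ true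
edge-self a b rewrite ==-refl a | ==-refl b = refl

edge⊆ : ∀ {n} (H : Graph n) {a b} → adj H a b ≡ true → ∀ x y → edge a b x y ≡ true → adj H x y ≡ true
edge⊆ H {a} {b} ab∈H x y xy∈ with star-sound a (_== b) {x} {y} xy∈
... | inj₁ (refl , y≟b) rewrite ==⇒≡ y≟b = ab∈H
... | inj₂ (refl , x≟b) rewrite ==⇒≡ x≟b = trans (Graph.sym H b a) ab∈H

edge-disjoint : ∀ {n} (H : Graph n) {a b} → adj H a b ≡ false → ∀ x y → adj H x y ∧ edge a b x y ≡ false
edge-disjoint H {a} {b} ab∉H x y with edge a b x y in xy∈
... | false = ∧-zeroʳ (adj H x y)
... | true with star-sound a (_== b) {x} {y} xy∈
...   | inj₁ (refl , y≟b) rewrite ==⇒≡ y≟b | ab∉H = refl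
...   | inj₂ (refl , x≟b) rewrite ==⇒≡ x≟b | Graph.sym H b a | ab∉H = refl

star-self : ∀ {n} (v : Fin n) (B : Fin n → Bool) {b} → B b ≡ true → star v B v b ≡ true
star-self v B Bb rewrite ==-refl v | Bb = refl

star-edge : ∀ {n} (v : Fin n) (B : Fin n → Bool) {b} → B b ≡ true → ∀ {x y} → edge v b x y ≡ true → star v B x y ≡ true
star-edge v B {b} Bb {x} {y} xy∈ with star-sound v (_== b) {x} {y} xy∈
... | inj₁ (refl , y≟b) rewrite ==⇒≡ y≟b = star-self v B Bb
... | inj₂ (refl , x≟b) rewrite ==⇒≡ x≟b = trans (star-sym v B b v) (star-self v B Bb)

star-edge⁻ : ∀ {n} (v : Fin n) (B : Fin n → Bool) {b} → B b ≡ true → ∀ {x y} → star v B x y ≡ false → edge v b x y ≡ false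
star-edge⁻ v B {b} Bb {x} {y} xy∉star with edge v b x y in xy≟vb
... | false = refl
... | true = ⊥-elim (true≢false (trans (sym (star-edge v B Bb {x} {y} xy≟vb)) xy∉star))

star-edge⁻′ : ∀ {n} (v : Fin n) (B : Fin n → Bool) {b} → B b ≡ true → ∀ {x y} → star v B x y ≡ false → edge x y v b ≡ false
star-edge⁻′ v B {b} Bb {x} {y} xy∉star with edge x y v b in vb≟xy
... | false = refl
... | true with star-sound x (_== y) {v} {b} vb≟xy
...   | inj₁ (refl , b≟y) = ⊥-elim (true≢false (trans (sym (subst (λ z → star v B v z ≡ true) (==⇒≡ b≟y) (star-self v B Bb))) xy∉star))
...   | inj₂ (refl , v≟y) = ⊥-elim (true≢false (trans (sym (subst (λ z → star v B b z ≡ true) (==⇒≡ v≟y) (trans (star-sym v B b v) (star-self v B Bb)))) xy∉star))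

addEdge : ∀ {n} → Graph n → (a b : Fin n) → a ≢ b → Graph n
addEdge H a b a≢b = record
  { adj = λ x y → adj H x y ∨ edge a b x y
  ; sym = λ x y → cong₂ _∨_ (Graph.sym H x y) (star-sym a (_== b) x y)
  ; irref = λ x → cong₂ _∨_ (Graph.irref H x) (star-irrefl a (_== b) (≢⇒==-false a≢b) x) }

removeEdge : ∀ {n} → Graph n → (a b : Fin n) → Graph n
removeEdge H a b = record
  { adj = λ x y → adj H x y ∧ not (edge a b x y)
  ; sym = λ x y → cong₂ (λ s t → s ∧ not t) (Graph.sym H x y) (star-sym a (_== b) x y)
  ; irref = λ x → cong (_∧ not (edge a b x x)) (Graph.irref H x) }

addEdge-removeEdge⊆ : ∀ {n} (H : Graph n) {a b x y} (a≢b : a ≢ b) → ∀ i j →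
  adj (addEdge (removeEdge H x y) a b a≢b) i j ≡ true → adj (addEdge H a b a≢b) i j ≡ true
addEdge-removeEdge⊆ H {a} {b} {x} {y} a≢b i j = weaken (adj H i j) (edge x y i j) (edge a b i j)
  where
  weaken : ∀ s t u → (s ∧ not t) ∨ u ≡ true → s ∨ u ≡ true
  weaken true t u _ = refl
  weaken false t u u≡true = u≡true

numEdges-addEdge : ∀ {n} (H : Graph n) a b (a≢b : a ≢ b) → adj H a b ≡ false →
  numEdges (addEdge H a b a≢b) ≡ ℕ.suc (numEdges H)
numEdges-addEdge H a b a≢b ab∉H = numEdges-from-degreeSum (addEdge H a b a≢b) (begin
  degreeSum (λ x y → adj H x y ∨ edge a b x y)   ≡⟨ degreeSum-∨ (adj H) (edge a b) (edge-disjoint H ab∉H) ⟩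
  degreeSum (adj H) ℕ.+ degreeSum (edge a b)     ≡⟨ cong₂ ℕ._+_ (handshake H) (degreeSum-edge a≢b) ⟩
  2 ℕ.* numEdges H ℕ.+ 2                         ≡⟨ ℕ.+-comm (2 ℕ.* numEdges H) 2 ⟩
  2 ℕ.+ 2 ℕ.* numEdges H                         ≡⟨ ℕ.*-suc 2 (numEdges H) ⟨
  2 ℕ.* ℕ.suc (numEdges H)                       ∎)
  where
  open ≡-Reasoning

numEdges-removeEdge : ∀ {n} (H : Graph n) a b → a ≢ b → adj H a b ≡ true →
  numEdges H ≡ ℕ.suc (numEdges (removeEdge H a b))
numEdges-removeEdge H a b a≢b ab∈H = numEdges-from-degreeSum H (begin
  degreeSum (adj H)                                   ≡⟨ degreeSum-⊆ (adj H) (edge a b) (edge⊆ H ab∈H) ⟩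
  degreeSum (adj (removeEdge H a b)) ℕ.+ degreeSum (edge a b)
                                                      ≡⟨ cong₂ ℕ._+_ (handshake (removeEdge H a b)) (degreeSum-edge a≢b) ⟩
  2 ℕ.* numEdges (removeEdge H a b) ℕ.+ 2             ≡⟨ ℕ.+-comm (2 ℕ.* numEdges (removeEdge H a b)) 2 ⟩
  2 ℕ.+ 2 ℕ.* numEdges (removeEdge H a b)             ≡⟨ ℕ.*-suc 2 (numEdges (removeEdge H a b)) ⟨
  2 ℕ.* ℕ.suc (numEdges (removeEdge H a b))           ∎)
  where
  open ≡-Reasoning

-- Vertex splits

data LastView {n} : Fin (ℕ.suc n) → Set where
  old : ∀ a → LastView (inject₁ a)
  new : LastView (fromℕ n)

lastView : ∀ {n} (x : Fin (ℕ.suc n)) → LastView x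
lastView {ℕ.zero} zero = new
lastView {ℕ.suc n} zero = old zero
lastView {ℕ.suc n} (suc x) with lastView x
... | old a = old (suc a)
... | new = new

view-inject₁ : ∀ {n} (a : Fin n) → view (inject₁ a) ≡ just a
view-inject₁ {ℕ.suc n} zero = refl
view-inject₁ {ℕ.suc n} (suc a) rewrite view-inject₁ a = refl

view-fromℕ : ∀ n → view (fromℕ n) ≡ nothing
view-fromℕ ℕ.zero = refl
view-fromℕ (ℕ.suc n) rewrite view-fromℕ n = refl

-- The new vertex v′ = fromℕ n gets the data of v.
clone : ∀ {A : Set} {n} → (Fin n → A) → Fin n → Fin (ℕ.suc n) → A
clone f v x with view x
... | just a = f a
... | nothing = f v

clone-inject₁ : ∀ {A : Set} {n} (f : Fin n → A) v a → clone f v (inject₁ a) ≡ f a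
clone-inject₁ f v a rewrite view-inject₁ a = refl

clone-fromℕ : ∀ {A : Set} {n} (f : Fin n → A) v → clone f v (fromℕ n) ≡ f v
clone-fromℕ {n = n} f v rewrite view-fromℕ n = refl

moment-clone : ∀ {d n} (τ : Fin n → ℚ) v x (c : Fin d) → moment (clone τ v) x c ≡ clone (moment τ) v x c
moment-clone τ v x c with view x
... | just a = refl
... | nothing = refl

module _ {n} (G : Graph n) (v : Fin n) (B C : Fin n → Bool) where

  splitAdj-old-old : ∀ a b → splitAdj G v B C (inject₁ a) (inject₁ b) ≡ adj G a b ∧ not (star v C a b)
  splitAdj-old-old a b rewrite view-inject₁ a | view-inject₁ b = refl

  splitAdj-old-new : ∀ a → splitAdj G v B C (inject₁ a) (fromℕ n) ≡ (a == v) ∨ B a ∨ C a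
  splitAdj-old-new a rewrite view-inject₁ a | view-fromℕ n = refl

  splitAdj-new-old : ∀ b → splitAdj G v B C (fromℕ n) (inject₁ b) ≡ (b == v) ∨ B b ∨ C b
  splitAdj-new-old b rewrite view-inject₁ b | view-fromℕ n = refl

  splitAdj-new-new : splitAdj G v B C (fromℕ n) (fromℕ n) ≡ false
  splitAdj-new-new rewrite view-fromℕ n = refl

splitGraph : ∀ {n} → Graph n → Fin n → (Fin n → Bool) → (Fin n → Bool) → Graph (ℕ.suc n)
splitGraph {n} G v B C = record { adj = splitAdj G v B C ; sym = symmetric ; irref = irreflexive }
  where
  symmetric : ∀ x y → splitAdj G v B C x y ≡ splitAdj G v B C y x
  symmetric x y with lastView x | lastView y
  ... | old a | old b = begin
    splitAdj G v B C (inject₁ a) (inject₁ b)  ≡⟨ splitAdj-old-old G v B C a b ⟩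
    adj G a b ∧ not (star v C a b)            ≡⟨ cong₂ (λ s t → s ∧ not t) (Graph.sym G a b) (star-sym v C a b) ⟩
    adj G b a ∧ not (star v C b a)            ≡⟨ splitAdj-old-old G v B C b a ⟨
    splitAdj G v B C (inject₁ b) (inject₁ a)  ∎
    where open ≡-Reasoning
  ... | old a | new = trans (splitAdj-old-new G v B C a) (sym (splitAdj-new-old G v B C a))
  ... | new | old b = trans (splitAdj-new-old G v B C b) (sym (splitAdj-old-new G v B C b))
  ... | new | new = refl
  irreflexive : ∀ x → splitAdj G v B C x x ≡ false
  irreflexive x with lastView x
  ... | old a = trans (splitAdj-old-old G v B C a a) (cong (_∧ not (star v C a a)) (Graph.irref G a))
  ... | new = splitAdj-new-new G v B C

degreeSum-last : ∀ {n} (A : Fin (ℕ.suc n) → Fin (ℕ.suc n) → Bool) →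
  degreeSum A ≡ (degreeSum (λ a b → A (inject₁ a) (inject₁ b)) ℕ.+ Σℕ.sum (λ a → 𝟙 (A (inject₁ a) (fromℕ n))))
                ℕ.+ (Σℕ.sum (λ b → 𝟙 (A (fromℕ n) (inject₁ b))) ℕ.+ 𝟙 (A (fromℕ n) (fromℕ n)))
degreeSum-last {n} A = trans (Σℕ.sum-init-last (λ x → Σℕ.sum (λ y → 𝟙 (A x y))))
  (cong₂ ℕ._+_ (trans (Σℕ.sum-cong-≗ (λ a → Σℕ.sum-init-last (λ y → 𝟙 (A (inject₁ a) y))))
                      (Σℕ.∑-distrib-+ (λ a → Σℕ.sum (λ b → 𝟙 (A (inject₁ a) (inject₁ b)))) _))
               (Σℕ.sum-init-last (λ y → 𝟙 (A (fromℕ n) y))))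

leaf≢centre : ∀ {n} (J : Graph n) {v} {L : Fin n → Bool} → (∀ w → L w ≡ true → adj J v w ≡ true) → L v ≡ false
leaf≢centre J {v} {L} L⊆N with L v in Lv
... | true = ⊥-elim (true≢false (trans (sym (L⊆N v Lv)) (Graph.irref J v)))
... | false = refl

star⊆ : ∀ {n} (J : Graph n) {v} {L : Fin n → Bool} → (∀ w → L w ≡ true → adj J v w ≡ true) →
  ∀ a b → star v L a b ≡ true → adj J a b ≡ true
star⊆ J {v} {L} L⊆N a b ab∈ with star-sound v L {a} {b} ab∈
... | inj₁ (refl , Lb) = L⊆N b Lb
... | inj₂ (refl , La) = trans (Graph.sym J a b) (L⊆N a La)

module _ {n} (J : Graph n) (v : Fin n) (B C : Fin n → Bool)
  (B⊆N : ∀ w → B w ≡ true → adj J v w ≡ true) (C⊆N : ∀ w → C w ≡ true → adj J v w ≡ true)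
  where

  count-neighbours : (∀ w → B w ∧ C w ≡ false) → Σℕ.sum (λ a → 𝟙 ((a == v) ∨ B a ∨ C a)) ≡ ℕ.suc (count B ℕ.+ count C)
  count-neighbours B∩C≡∅ = begin
    Σℕ.sum (λ a → 𝟙 ((a == v) ∨ B a ∨ C a))
      ≡⟨ Σℕ.sum-cong-≗ (λ a → trans (𝟙-∨ (a == v) (B a ∨ C a) (v∉B∪C a)) (cong (𝟙 (a == v) ℕ.+_) (𝟙-∨ (B a) (C a) (B∩C≡∅ a)))) ⟩
    Σℕ.sum (λ a → 𝟙 (a == v) ℕ.+ (𝟙 (B a) ℕ.+ 𝟙 (C a)))
      ≡⟨ Σℕ.∑-distrib-+ (λ a → 𝟙 (a == v)) _ ⟩
    count (_== v) ℕ.+ Σℕ.sum (λ a → 𝟙 (B a) ℕ.+ 𝟙 (C a))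
      ≡⟨ cong₂ ℕ._+_ (count-== v) (Σℕ.∑-distrib-+ (λ a → 𝟙 (B a)) _) ⟩
    ℕ.suc (count B ℕ.+ count C) ∎
    where
    open ≡-Reasoning
    v∉B∪C : ∀ a → (a == v) ∧ (B a ∨ C a) ≡ false
    v∉B∪C a with a Fin.≟ v
    ... | no _ = refl
    ... | yes refl rewrite leaf≢centre J B⊆N | leaf≢centre J C⊆N = refl

  numEdges-split : (∀ w → B w ∧ C w ≡ false) → numEdges (splitGraph J v B C) ≡ numEdges J ℕ.+ ℕ.suc (count B)
  numEdges-split B∩C≡∅ = numEdges-from-degreeSum (splitGraph J v B C) (begin
    degreeSum (splitAdj J v B C)
      ≡⟨ degreeSum-last (splitAdj J v B C) ⟩
    (degreeSum (λ a b → splitAdj J v B C (inject₁ a) (inject₁ b)) ℕ.+ Σℕ.sum (λ a → 𝟙 (splitAdj J v B C (inject₁ a) (fromℕ n))))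
      ℕ.+ (Σℕ.sum (λ b → 𝟙 (splitAdj J v B C (fromℕ n) (inject₁ b))) ℕ.+ 𝟙 (splitAdj J v B C (fromℕ n) (fromℕ n)))
      ≡⟨ cong₂ ℕ._+_ (cong₂ ℕ._+_ (degreeSum-cong (splitAdj-old-old J v B C))
                                  (trans (Σℕ.sum-cong-≗ (λ a → cong 𝟙 (splitAdj-old-new J v B C a))) (count-neighbours B∩C≡∅)))
                     (cong₂ ℕ._+_ (trans (Σℕ.sum-cong-≗ (λ b → cong 𝟙 (splitAdj-new-old J v B C b))) (count-neighbours B∩C≡∅))
                                  (cong 𝟙 (splitAdj-new-new J v B C))) ⟩
    (kept ℕ.+ ℕ.suc (count B ℕ.+ count C)) ℕ.+ (ℕ.suc (count B ℕ.+ count C) ℕ.+ 0)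
      ≡⟨ ℕSolver.solve 3 (λ k b c → (k ℕSolver.:+ (ℕSolver.con 1 ℕSolver.:+ (b ℕSolver.:+ c))) ℕSolver.:+ ((ℕSolver.con 1 ℕSolver.:+ (b ℕSolver.:+ c)) ℕSolver.:+ ℕSolver.con 0)
                                   ℕSolver.:= (k ℕSolver.:+ (c ℕSolver.:+ c)) ℕSolver.:+ ℕSolver.con 2 ℕSolver.:* (ℕSolver.con 1 ℕSolver.:+ b)) refl kept (count B) (count C) ⟩
    (kept ℕ.+ (count C ℕ.+ count C)) ℕ.+ 2 ℕ.* ℕ.suc (count B)
      ≡⟨ cong (ℕ._+ 2 ℕ.* ℕ.suc (count B)) (trans (cong (kept ℕ.+_) (sym (degreeSum-star v C (leaf≢centre J C⊆N))))
                                                   (trans (sym (degreeSum-⊆ (adj J) (star v C) (star⊆ J C⊆N))) (handshake J))) ⟩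
    2 ℕ.* numEdges J ℕ.+ 2 ℕ.* ℕ.suc (count B)
      ≡⟨ ℕ.*-distribˡ-+ 2 (numEdges J) (ℕ.suc (count B)) ⟨
    2 ℕ.* (numEdges J ℕ.+ ℕ.suc (count B)) ∎)
    where
    open ≡-Reasoning
    kept = degreeSum (λ a b → adj J a b ∧ not (star v C a b))

-- With v′ placed at v, a stress of the split graph with the edges at v′ moved back to v is a stress of J,
-- so it vanishes; what remains at v′ is a dependency among the points at v and B.
module SplitStressFree {d n} (q : Config d n) (J : Graph n) (v : Fin n) (B C : Fin n → Bool)
  (B⊆N : ∀ w → B w ≡ true → adj J v w ≡ true) (C⊆N : ∀ w → C w ≡ true → adj J v w ≡ true)
  (independent : PointsIndependent q (λ j → (j == v) ∨ B j)) (stress-free : StressFree q (adj J))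
  (ω′ : Fin (ℕ.suc n) → Fin (ℕ.suc n) → ℚ) (antisym′ : Antisymmetric ω′)
  (supported′ : SupportedOn (splitAdj J v B C) ω′) (stress′ : IsStress (clone q v) ω′)
  where

  open ≡-Reasoning

  v′ = fromℕ n

  β γ : Fin n → ℚ
  β b = ω′ v′ (inject₁ b)
  γ a = ω′ (inject₁ a) v′

  γ≡-β : ∀ a → γ a ≡ - β a
  γ≡-β a = antisym′ v′ (inject₁ a)

  stress-at-old : ∀ k c → ∑[ b < n ] (ω′ (inject₁ k) (inject₁ b) * q b c) + γ k * q v c ≡ 0ℚ
  stress-at-old k c = begin
    ∑[ b < n ] (ω′ (inject₁ k) (inject₁ b) * q b c) + γ k * q v c
      ≡⟨ cong₂ _+_ (sum-cong-≗ (λ b → cong (ω′ (inject₁ k) (inject₁ b) *_) (cong-app (clone-inject₁ q v b) c)))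
                   (cong (γ k *_) (cong-app (clone-fromℕ q v) c)) ⟨
    ∑[ b < n ] (ω′ (inject₁ k) (inject₁ b) * clone q v (inject₁ b) c) + γ k * clone q v v′ c
      ≡⟨ sum-init-last (λ y → ω′ (inject₁ k) y * clone q v y c) ⟨
    ∑[ y < ℕ.suc n ] (ω′ (inject₁ k) y * clone q v y c)
      ≡⟨ stress′ (inject₁ k) c ⟩
    0ℚ ∎

  stress-at-new : ∀ c → ∑[ b < n ] (β b * q b c) ≡ 0ℚ
  stress-at-new c = begin
    ∑[ b < n ] (β b * q b c)
      ≡⟨ ℚ.+-identityʳ _ ⟨
    ∑[ b < n ] (β b * q b c) + 0ℚ
      ≡⟨ cong (∑[ b < n ] (β b * q b c) +_) (trans (cong (_* q v c) (antisymmetric-diagonal antisym′ v′)) (ℚ.*-zeroˡ (q v c))) ⟨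
    ∑[ b < n ] (β b * q b c) + ω′ v′ v′ * q v c
      ≡⟨ cong₂ _+_ (sum-cong-≗ (λ b → cong (β b *_) (cong-app (clone-inject₁ q v b) c))) (cong (ω′ v′ v′ *_) (cong-app (clone-fromℕ q v) c)) ⟨
    ∑[ b < n ] (β b * clone q v (inject₁ b) c) + ω′ v′ v′ * clone q v v′ c
      ≡⟨ sum-init-last (λ y → ω′ v′ y * clone q v y c) ⟨
    ∑[ y < ℕ.suc n ] (ω′ v′ y * clone q v y c)
      ≡⟨ stress′ v′ c ⟩
    0ℚ ∎

  ω : Fin n → Fin n → ℚ
  ω a b = ω′ (inject₁ a) (inject₁ b) + when (a == v) (β b) + when (b == v) (γ a)

  ω-antisym : Antisymmetric ω
  ω-antisym a b = begin
    ω′ (inject₁ b) (inject₁ a) + when (b == v) (β a) + when (a == v) (γ b)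
      ≡⟨ cong₂ (λ x y → x + y + when (a == v) (γ b)) (antisym′ (inject₁ a) (inject₁ b)) (cong (when (b == v)) (antisym′ (inject₁ a) v′)) ⟩
    - ω′ (inject₁ a) (inject₁ b) + when (b == v) (- γ a) + when (a == v) (γ b)
      ≡⟨ cong (λ z → - ω′ (inject₁ a) (inject₁ b) + when (b == v) (- γ a) + when (a == v) z) (γ≡-β b) ⟩
    - ω′ (inject₁ a) (inject₁ b) + when (b == v) (- γ a) + when (a == v) (- β b)
      ≡⟨ cong₂ (λ x y → - ω′ (inject₁ a) (inject₁ b) + x + y) (when-neg (b == v) (γ a)) (when-neg (a == v) (β b)) ⟩
    - ω′ (inject₁ a) (inject₁ b) + - when (b == v) (γ a) + - when (a == v) (β b)
      ≡⟨ solve 3 (λ x y z → (:- x) :+ (:- z) :+ (:- y) := :- (x :+ y :+ z)) refl (ω′ (inject₁ a) (inject₁ b)) (when (a == v) (β b)) (when (b == v) (γ a)) ⟩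
    - ω a b ∎

  not-neighbour : ∀ w → adj J v w ≡ false → w ≢ v → (w == v) ∨ B w ∨ C w ≡ false
  not-neighbour w vw∉J w≢v rewrite ≢⇒==-false w≢v with B w in Bw | C w in Cw
  ... | true | _ = ⊥-elim (true≢false (trans (sym (B⊆N w Bw)) vw∉J))
  ... | false | true = ⊥-elim (true≢false (trans (sym (C⊆N w Cw)) vw∉J))
  ... | false | false = refl

  old-edge-absent : ∀ a b → adj J a b ≡ false → ω′ (inject₁ a) (inject₁ b) ≡ 0ℚ
  old-edge-absent a b ab∉J = supported′ (inject₁ a) (inject₁ b) (trans (splitAdj-old-old J v B C a b) (cong (_∧ not (star v C a b)) ab∉J))

  ω-supported : SupportedOn (adj J) ω
  ω-supported a b ab∉J with toSum (a Fin.≟ v) | toSum (b Fin.≟ v)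
  ... | inj₁ refl | inj₁ refl = antisymmetric-diagonal ω-antisym a
  ... | inj₁ refl | inj₂ b≢v = begin
    ω′ (inject₁ a) (inject₁ b) + when (a == a) (β b) + when (b == a) (γ a)
      ≡⟨ cong₂ (λ x y → x + when (a == a) (β b) + y) (old-edge-absent a b ab∉J) (when-false (γ a) (≢⇒==-false b≢v)) ⟩
    0ℚ + when (a == a) (β b) + 0ℚ
      ≡⟨ cong (λ x → 0ℚ + x + 0ℚ) (trans (when-true (β b) (==-refl a))
                                         (supported′ v′ (inject₁ b) (trans (splitAdj-new-old J v B C b) (not-neighbour b ab∉J b≢v)))) ⟩
    0ℚ ∎
  ... | inj₂ a≢v | inj₁ refl = begin
    ω′ (inject₁ a) (inject₁ b) + when (a == b) (β b) + when (b == b) (γ a)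
      ≡⟨ cong₂ (λ x y → x + y + when (b == b) (γ a)) (old-edge-absent a b ab∉J) (when-false (β b) (≢⇒==-false a≢v)) ⟩
    0ℚ + 0ℚ + when (b == b) (γ a)
      ≡⟨ cong (λ x → 0ℚ + 0ℚ + x) (trans (when-true (γ a) (==-refl b))
                                         (supported′ (inject₁ a) v′ (trans (splitAdj-old-new J v B C a) (not-neighbour a (trans (Graph.sym J b a) ab∉J) a≢v)))) ⟩
    0ℚ ∎
  ... | inj₂ a≢v | inj₂ b≢v = begin
    ω′ (inject₁ a) (inject₁ b) + when (a == v) (β b) + when (b == v) (γ a)
      ≡⟨ cong₂ (λ x y → x + y + when (b == v) (γ a)) (old-edge-absent a b ab∉J) (when-false (β b) (≢⇒==-false a≢v)) ⟩
    0ℚ + 0ℚ + when (b == v) (γ a)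
      ≡⟨ cong (0ℚ + 0ℚ +_) (when-false (γ a) (≢⇒==-false b≢v)) ⟩
    0ℚ ∎

  ω-stress : IsStress q ω
  ω-stress k c = begin
    ∑[ b < n ] (ω k b * q b c)
      ≡⟨ sum-cong-≗ (λ b → solve 4 (λ x y z w → (x :+ y :+ z) :* w := (x :* w :+ y :* w) :+ z :* w) refl
                                   (ω′ (inject₁ k) (inject₁ b)) (when (k == v) (β b)) (when (b == v) (γ k)) (q b c)) ⟩
    ∑[ b < n ] ((ω′ (inject₁ k) (inject₁ b) * q b c + when (k == v) (β b) * q b c) + when (b == v) (γ k) * q b c)
      ≡⟨ ∑-distrib-+ (λ b → ω′ (inject₁ k) (inject₁ b) * q b c + when (k == v) (β b) * q b c) (λ b → when (b == v) (γ k) * q b c) ⟩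
    ∑[ b < n ] (ω′ (inject₁ k) (inject₁ b) * q b c + when (k == v) (β b) * q b c) + ∑[ b < n ] (when (b == v) (γ k) * q b c)
      ≡⟨ cong₂ _+_ (∑-distrib-+ (λ b → ω′ (inject₁ k) (inject₁ b) * q b c) (λ b → when (k == v) (β b) * q b c))
                   (trans (sum-cong-≗ (λ b → sym (when-*ʳ (b == v) (γ k) (q b c)))) (sum-δ v (λ b → γ k * q b c))) ⟩
    (∑[ b < n ] (ω′ (inject₁ k) (inject₁ b) * q b c) + ∑[ b < n ] (when (k == v) (β b) * q b c)) + γ k * q v c
      ≡⟨ cong (λ z → (∑[ b < n ] (ω′ (inject₁ k) (inject₁ b) * q b c) + z) + γ k * q v c)
              (trans (sum-cong-≗ (λ b → sym (when-*ʳ (k == v) (β b) (q b c))))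
                     (trans (sum-when (k == v) (λ b → β b * q b c)) (trans (cong (when (k == v)) (stress-at-new c)) (when-0 (k == v))))) ⟩
    (∑[ b < n ] (ω′ (inject₁ k) (inject₁ b) * q b c) + 0ℚ) + γ k * q v c
      ≡⟨ cong (_+ γ k * q v c) (ℚ.+-identityʳ (∑[ b < n ] (ω′ (inject₁ k) (inject₁ b) * q b c))) ⟩
    ∑[ b < n ] (ω′ (inject₁ k) (inject₁ b) * q b c) + γ k * q v c
      ≡⟨ stress-at-old k c ⟩
    0ℚ ∎

  ω≡0 : ∀ a b → ω a b ≡ 0ℚ
  ω≡0 = stress-free ω ω-antisym ω-supported ω-stress

  S : Fin n → Bool
  S j = (j == v) ∨ B j

  β-off-S : ∀ b → S b ≡ false → β b ≡ 0ℚ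
  β-off-S b Sb with toSum (b Fin.≟ v)
  ... | inj₁ refl = ⊥-elim (true≢false (trans (sym (==-refl b)) (∨-conicalˡ (b == b) (B b) Sb)))
  ... | inj₂ b≢v with C b in Cb
  ...   | false = supported′ v′ (inject₁ b) (trans (splitAdj-new-old J v B C b) (trans (sym (∨-assoc (b == v) (B b) (C b))) (trans (cong (_∨ C b) Sb) Cb)))
  ...   | true = begin
    β b
      ≡⟨ solve 1 (λ x → x := con 0ℚ :+ x :+ con 0ℚ) refl (β b) ⟩
    0ℚ + β b + 0ℚ
      ≡⟨ cong₂ (λ x y → x + β b + y) (supported′ (inject₁ v) (inject₁ b) vb-moved) (when-false (γ v) (≢⇒==-false b≢v)) ⟨
    ω′ (inject₁ v) (inject₁ b) + β b + when (b == v) (γ v)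
      ≡⟨ cong (λ x → ω′ (inject₁ v) (inject₁ b) + x + when (b == v) (γ v)) (when-true (β b) (==-refl v)) ⟨
    ω v b
      ≡⟨ ω≡0 v b ⟩
    0ℚ ∎
    where
    vb-moved : splitAdj J v B C (inject₁ v) (inject₁ b) ≡ false
    vb-moved rewrite splitAdj-old-old J v B C v b | ==-refl v | Cb = ∧-zeroʳ (adj J v b)

  β≡0 : ∀ b → β b ≡ 0ℚ
  β≡0 b with S b in Sb
  ... | true = independent β combination b Sb
    where
    combination : ∀ c → ∑[ j < n ] when (S j) (β j * q j c) ≡ 0ℚ
    combination c = trans (sum-cong-≗ on-S) (stress-at-new c)
      where
      on-S : ∀ j → when (S j) (β j * q j c) ≡ β j * q j c
      on-S j with S j in Sj
      ... | true = refl
      ... | false = sym (trans (cong (_* q j c) (β-off-S j Sj)) (ℚ.*-zeroˡ (q j c)))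
  ... | false = β-off-S b Sb

  γ≡0 : ∀ a → γ a ≡ 0ℚ
  γ≡0 a = trans (γ≡-β a) (-x≡0 (β≡0 a))

  old-old≡0 : ∀ a b → ω′ (inject₁ a) (inject₁ b) ≡ 0ℚ
  old-old≡0 a b = begin
    ω′ (inject₁ a) (inject₁ b)
      ≡⟨ solve 1 (λ x → x := x :+ con 0ℚ :+ con 0ℚ) refl _ ⟩
    ω′ (inject₁ a) (inject₁ b) + 0ℚ + 0ℚ
      ≡⟨ cong₂ (λ x y → ω′ (inject₁ a) (inject₁ b) + x + y)
               (trans (cong (when (a == v)) (β≡0 b)) (when-0 (a == v))) (trans (cong (when (b == v)) (γ≡0 a)) (when-0 (b == v))) ⟨
    ω a b
      ≡⟨ ω≡0 a b ⟩
    0ℚ ∎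

  ω′≡0 : ∀ x y → ω′ x y ≡ 0ℚ
  ω′≡0 x y with lastView x | lastView y
  ... | old a | old b = old-old≡0 a b
  ... | old a | new = γ≡0 a
  ... | new | old b = β≡0 b
  ... | new | new = antisymmetric-diagonal antisym′ v′

stressFree-split : ∀ {d n} (q : Config d n) (J : Graph n) (v : Fin n) (B C : Fin n → Bool) →
  (∀ w → B w ≡ true → adj J v w ≡ true) → (∀ w → C w ≡ true → adj J v w ≡ true) →
  PointsIndependent q (λ j → (j == v) ∨ B j) → StressFree q (adj J) →
  StressFree (clone q v) (splitAdj J v B C)
stressFree-split q J v B C B⊆N C⊆N independent stress-free ω′ antisym′ supported′ stress′ =
  SplitStressFree.ω′≡0 q J v B C B⊆N C⊆N independent stress-free ω′ antisym′ supported′ stress′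

-- Circuit exchange

module _ {m} {ω ω₀ : Fin m → Fin m → ℚ} (μ : ℚ) where

  antisymmetric-−* : Antisymmetric ω → Antisymmetric ω₀ → Antisymmetric (λ a b → ω a b - μ * ω₀ a b)
  antisymmetric-−* antisym antisym₀ a b = begin
    ω b a - μ * ω₀ b a           ≡⟨ cong₂ (λ s t → s - μ * t) (antisym a b) (antisym₀ a b) ⟩
    - ω a b - μ * - ω₀ a b       ≡⟨ solve 3 (λ x m y → (:- x) :+ (:- (m :* (:- y))) := :- (x :+ (:- (m :* y)))) refl (ω a b) μ (ω₀ a b) ⟩
    - (ω a b - μ * ω₀ a b)       ∎
    where open ≡-Reasoning

  supportedOn-−* : ∀ {A} → SupportedOn A ω → SupportedOn A ω₀ → SupportedOn A (λ a b → ω a b - μ * ω₀ a b)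
  supportedOn-−* supported supported₀ a b ab∉A = begin
    ω a b - μ * ω₀ a b   ≡⟨ cong₂ (λ s t → s - μ * t) (supported a b ab∉A) (supported₀ a b ab∉A) ⟩
    0ℚ - μ * 0ℚ          ≡⟨ solve 1 (λ m → con 0ℚ :+ (:- (m :* con 0ℚ)) := con 0ℚ) refl μ ⟩
    0ℚ                   ∎
    where open ≡-Reasoning

  isStress-−* : ∀ {d} {q : Config d m} → IsStress q ω → IsStress q ω₀ → IsStress q (λ a b → ω a b - μ * ω₀ a b)
  isStress-−* {q = q} stress stress₀ k c = begin
    ∑[ j < m ] ((ω k j - μ * ω₀ k j) * q j c)
      ≡⟨ sum-cong-≗ (λ j → solve 4 (λ x m y z → (x :+ (:- (m :* y))) :* z := x :* z :+ (:- m) :* (y :* z)) refl (ω k j) μ (ω₀ k j) (q j c)) ⟩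
    ∑[ j < m ] (ω k j * q j c + (- μ) * (ω₀ k j * q j c))
      ≡⟨ ∑-distrib-+ (λ j → ω k j * q j c) (λ j → (- μ) * (ω₀ k j * q j c)) ⟩
    ∑[ j < m ] (ω k j * q j c) + ∑[ j < m ] ((- μ) * (ω₀ k j * q j c))
      ≡⟨ cong₂ _+_ (stress k c) (trans (sym (*-distribˡ-sum (- μ) (λ j → ω₀ k j * q j c))) (cong ((- μ) *_) (stress₀ k c))) ⟩
    0ℚ + (- μ) * 0ℚ
      ≡⟨ solve 1 (λ m → con 0ℚ :+ m :* con 0ℚ := con 0ℚ) refl (- μ) ⟩
    0ℚ ∎
    where open ≡-Reasoning

supportedOn-addEdge⁻ : ∀ {n} (J : Graph n) {a b} (a≢b : a ≢ b) {ω} → Antisymmetric ω →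
  SupportedOn (adj (addEdge J a b a≢b)) ω → ω a b ≡ 0ℚ → SupportedOn (adj J) ω
supportedOn-addEdge⁻ J {a} {b} a≢b {ω} antisym supported ωab≡0 i j ij∉J with edge a b i j in ij≟ab
... | false = supported i j (trans (cong (_∨ edge a b i j) ij∉J) ij≟ab)
... | true with star-sound a (_== b) {i} {j} ij≟ab
...   | inj₁ (refl , j≟b) rewrite ==⇒≡ j≟b = ωab≡0
...   | inj₂ (refl , i≟b) rewrite ==⇒≡ i≟b = trans (antisym a b) (-x≡0 ωab≡0)

module _ {d n} (q : Config d n) (J : Graph n) (stress-free : StressFree q (adj J)) {a b : Fin n} (a≢b : a ≢ b)
  {ω₀ : Fin n → Fin n → ℚ} (antisym₀ : Antisymmetric ω₀)
  (supported₀ : SupportedOn (adj (addEdge J a b a≢b)) ω₀) (stress₀ : IsStress q ω₀) where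

  stress-at-new-edge : Nontrivial (λ (e : Fin n × Fin n) → ω₀ (proj₁ e) (proj₂ e)) → ω₀ a b ≢ 0ℚ
  stress-at-new-edge ((i , j) , ω₀ij≢0) ω₀ab≡0 =
    ω₀ij≢0 (stress-free ω₀ antisym₀ (supportedOn-addEdge⁻ J a≢b antisym₀ supported₀ ω₀ab≡0) stress₀ i j)

  -- A stress of J − xy + ab minus a multiple of ω₀ vanishes on ab, so it is a stress of J and hence zero;
  -- at xy this forces the multiple, and with it the stress, to be zero.
  stressFree-exchange : ∀ {x y} → edge a b x y ≡ false → ω₀ x y ≢ 0ℚ → ω₀ a b ≢ 0ℚ →
    StressFree q (adj (addEdge (removeEdge J x y) a b a≢b))
  stressFree-exchange {x} {y} xy≢ab ω₀xy≢0 ω₀ab≢0 ω antisym supported stress = ω≡0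
    where
    open ≡-Reasoning
    instance _ = ℚ.≢-nonZero ω₀ab≢0
    μ = ω a b * ℚ.1/ (ω₀ a b)
    ω″ : Fin n → Fin n → ℚ
    ω″ i j = ω i j - μ * ω₀ i j
    ω″ab≡0 : ω″ a b ≡ 0ℚ
    ω″ab≡0 = begin
      ω a b - (ω a b * ℚ.1/ (ω₀ a b)) * ω₀ a b     ≡⟨ cong (λ z → ω a b - z) (ℚ.*-assoc (ω a b) _ (ω₀ a b)) ⟩
      ω a b - ω a b * (ℚ.1/ (ω₀ a b) * ω₀ a b)     ≡⟨ cong (λ z → ω a b - ω a b * z) (ℚ.*-inverseˡ (ω₀ a b)) ⟩
      ω a b - ω a b * 1ℚ                           ≡⟨ solve 1 (λ x → x :+ (:- (x :* con 1ℚ)) := con 0ℚ) refl (ω a b) ⟩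
      0ℚ                                           ∎
    ω″≡0 : ∀ i j → ω″ i j ≡ 0ℚ
    ω″≡0 = stress-free ω″ (antisymmetric-−* μ antisym antisym₀)
      (supportedOn-addEdge⁻ J a≢b (antisymmetric-−* μ antisym antisym₀)
        (supportedOn-−* μ (supportedOn-mono (addEdge-removeEdge⊆ J a≢b) supported) supported₀) ω″ab≡0)
      (isStress-−* {ω = ω} {ω₀ = ω₀} μ {q = q} stress stress₀)
    ωxy≡0 : ω x y ≡ 0ℚ
    ωxy≡0 = supported x y (begin
      (adj J x y ∧ not (edge x y x y)) ∨ edge a b x y   ≡⟨ cong (λ t → (adj J x y ∧ not t) ∨ edge a b x y) (edge-self x y) ⟩
      (adj J x y ∧ false) ∨ edge a b x y                ≡⟨ cong (_∨ edge a b x y) (∧-zeroʳ (adj J x y)) ⟩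
      edge a b x y                                       ≡⟨ xy≢ab ⟩
      false                                              ∎)
    μ≡0 : μ ≡ 0ℚ
    μ≡0 = x*y≡0⇒x≡0 μ (ω₀ x y) (begin
      μ * ω₀ x y         ≡⟨ solve 3 (λ w m z → m :* z := w :+ (:- (w :+ (:- (m :* z))))) refl (ω x y) μ (ω₀ x y) ⟩
      ω x y - ω″ x y     ≡⟨ cong₂ _-_ ωxy≡0 (ω″≡0 x y) ⟩
      0ℚ - 0ℚ            ≡⟨⟩
      0ℚ                 ∎) ω₀xy≢0
    ω≡0 : ∀ i j → ω i j ≡ 0ℚ
    ω≡0 i j = begin
      ω i j                   ≡⟨ solve 3 (λ w m z → w := (w :+ (:- (m :* z))) :+ m :* z) refl (ω i j) μ (ω₀ i j) ⟩
      ω″ i j + μ * ω₀ i j     ≡⟨ cong₂ (λ s t → s + t * ω₀ i j) (ω″≡0 i j) μ≡0 ⟩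
      0ℚ + 0ℚ * ω₀ i j        ≡⟨ solve 1 (λ z → con 0ℚ :+ con 0ℚ :* z := con 0ℚ) refl (ω₀ i j) ⟩
      0ℚ                      ∎

-- Add the edges from v to B one at a time; when vw closes a circuit, the circuit leaves the star
-- (which is stress-free) and one of its edges outside the star is exchanged for vw.
module Augment {d n} (q : Config d n) (G : Graph n) (v : Fin n) (B : Fin n → Bool)
  (B⊆N : ∀ w → B w ≡ true → adj G v w ≡ true)
  (independent : PointsIndependent q (λ j → (j == v) ∨ B j)) where

  v≢leaf : ∀ {w} → B w ≡ true → v ≢ w
  v≢leaf Bw refl = true≢false (trans (sym Bw) (leaf≢centre G B⊆N))

  position-nonzero : ∀ a → (∀ c → a * q v c ≡ 0ℚ) → a ≡ 0ℚ
  position-nonzero a av≡0 = trans (sym (when-true a (==-refl v))) (independent γ γ-comb v (cong (_∨ B v) (==-refl v)))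
    where
    γ = λ j → when (j == v) a
    at-v : ∀ c j → when ((j == v) ∨ B j) (γ j * q j c) ≡ when (j == v) (a * q j c)
    at-v c j with j == v
    ... | true = refl
    ... | false = trans (cong (when (B j)) (ℚ.*-zeroˡ (q j c))) (when-0 (B j))
    γ-comb : ∀ c → ∑[ j < n ] when ((j == v) ∨ B j) (γ j * q j c) ≡ 0ℚ
    γ-comb c = trans (sum-cong-≗ (at-v c)) (trans (sum-δ v (λ j → a * q j c)) (av≡0 c))

  -- Only the point q v is involved in the equilibrium at a leaf of the star.
  leaf-to-centre : ∀ {ω} → SupportedOn (star v B) ω → IsStress q ω → ∀ b → B b ≡ true → ω b v ≡ 0ℚ
  leaf-to-centre {ω} supported stress b Bb =
    position-nonzero (ω b v) λ c → trans (sym (sum-δ v (λ j → ω b j * q j c))) (trans (sum-cong-≗ (only-centre c)) (stress b c))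
    where
    bj∉star : ∀ {j} → j ≢ v → star v B b j ≡ false
    bj∉star j≢v rewrite ≢⇒==-false (v≢leaf Bb ∘ sym) | ≢⇒==-false j≢v = refl
    only-centre : ∀ c j → when (j == v) (ω b j * q j c) ≡ ω b j * q j c
    only-centre c j with toSum (j Fin.≟ v)
    ... | inj₁ refl = when-true _ (==-refl j)
    ... | inj₂ j≢v = trans (when-false _ (≢⇒==-false j≢v))
                           (sym (trans (cong (_* q j c) (supported b j (bj∉star j≢v))) (ℚ.*-zeroˡ (q j c))))

  star-stressFree : StressFree q (star v B)
  star-stressFree ω antisym supported stress x y with star v B x y in xy∈
  ... | false = supported x y xy∈
  ... | true with star-sound v B {x} {y} xy∈
  ...   | inj₁ (refl , By) = trans (antisym y x) (-x≡0 (leaf-to-centre supported stress y By))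
  ...   | inj₂ (refl , Bx) = leaf-to-centre supported stress x Bx

  off-star-or-on-star : ∀ (ω : Fin n → Fin n → ℚ) →
    Σ (Fin n) (λ x → Σ (Fin n) λ y → ω x y ≢ 0ℚ × star v B x y ≡ false) ⊎ SupportedOn (star v B) ω
  off-star-or-on-star ω with Fin.any? (λ x → Fin.any? (λ y → ¬? (ω x y ℚ.≟ 0ℚ) ×-dec (star v B x y Bool.≟ false)))
  ... | yes (x , y , witness) = inj₁ (x , y , witness)
  ... | no none = inj₂ λ x y xy∉star → decidable-stable (ω x y ℚ.≟ 0ℚ) (λ ωxy≢0 → none (x , y , ωxy≢0 , xy∉star))

  record Augmentation (I : Graph n) (ws : List (Fin n)) : Set where
    field
      graph        : Graph n
      graph⊆G      : graph ⊆G G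
      stressFree   : StressFree q (adj graph)
      star-covered : ∀ w → w ∈ ws → B w ≡ true → adj graph v w ≡ true
      enlarges     : numEdges I ≤ numEdges graph

  module Step {I : Graph n} {w : Fin n} {ws : List (Fin n)} (A : Augmentation I ws) where
    open Augmentation A renaming (graph to J)

    keep : (B w ≡ true → adj J v w ≡ true) → Augmentation I (w ∷ ws)
    keep vw∈J = record
      { graph = J ; graph⊆G = graph⊆G ; stressFree = stressFree ; enlarges = enlarges
      ; star-covered = λ { _ (here refl) → vw∈J ; w′ (there w′∈ws) → star-covered w′ w′∈ws } }

    module _ (Bw : B w ≡ true) (vw∉J : adj J v w ≡ false) where

      J+vw = addEdge J v w (v≢leaf Bw)

      J+vw⊆G : J+vw ⊆G G
      J+vw⊆G i j ij∈ with adj J i j in ij∈J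
      ... | true = graph⊆G i j ij∈J
      ... | false = edge⊆ G (B⊆N w Bw) i j ij∈

      add : StressFree q (adj J+vw) → Augmentation I (w ∷ ws)
      add stress-free = record
        { graph = J+vw ; graph⊆G = J+vw⊆G ; stressFree = stress-free
        ; star-covered = λ { _ (here refl) _ → trans (cong (adj J v w ∨_) (edge-self v w)) (∨-zeroʳ (adj J v w))
                           ; w′ (there w′∈ws) Bw′ → cong (_∨ edge v w v w′) (star-covered w′ w′∈ws Bw′) }
        ; enlarges = ℕ.≤-trans enlarges (ℕ.≤-trans (ℕ.n≤1+n _) (ℕ.≤-reflexive (sym (numEdges-addEdge J v w (v≢leaf Bw) vw∉J)))) }

      exchange : ∀ {ω₀} → Nontrivial (λ (e : Fin n × Fin n) → ω₀ (proj₁ e) (proj₂ e)) →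
        Antisymmetric ω₀ → SupportedOn (adj J+vw) ω₀ → IsStress q ω₀ → Augmentation I (w ∷ ws)
      exchange {ω₀} ω₀≢0 antisym₀ supported₀ stress₀ with off-star-or-on-star ω₀
      ... | inj₂ on-star = ⊥-elim (proj₂ ω₀≢0 (star-stressFree ω₀ antisym₀ on-star stress₀ (proj₁ (proj₁ ω₀≢0)) (proj₂ (proj₁ ω₀≢0))))
      ... | inj₁ (x , y , ω₀xy≢0 , xy∉star) = record
        { graph = J′ ; graph⊆G = λ i j → J+vw⊆G i j ∘ addEdge-removeEdge⊆ J (v≢leaf Bw) i j
        ; stressFree = stressFree-exchange q J stressFree (v≢leaf Bw) antisym₀ supported₀ stress₀ xy≢vw ω₀xy≢0
                         (stress-at-new-edge q J stressFree (v≢leaf Bw) antisym₀ supported₀ stress₀ ω₀≢0)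
        ; star-covered = covered ; enlarges = ℕ.≤-trans enlarges (ℕ.≤-reflexive same-size) }
        where
        xy≢vw : edge v w x y ≡ false
        xy≢vw = star-edge⁻ v B {w} Bw {x} {y} xy∉star
        xy∈J : adj J x y ≡ true
        xy∈J with adj J x y in xy∈
        ... | true = refl
        ... | false = ⊥-elim (ω₀xy≢0 (supported₀ x y (trans (cong (_∨ edge v w x y) xy∈) xy≢vw)))
        x≢y : x ≢ y
        x≢y refl = true≢false (trans (sym xy∈J) (Graph.irref J x))
        J′ = addEdge (removeEdge J x y) v w (v≢leaf Bw)
        covered : ∀ w′ → w′ ∈ w ∷ ws → B w′ ≡ true → adj J′ v w′ ≡ true
        covered _ (here refl) _ = trans (cong (adj (removeEdge J x y) v w ∨_) (edge-self v w)) (∨-zeroʳ _)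
        covered w′ (there w′∈ws) Bw′ rewrite star-covered w′ w′∈ws Bw′ | star-edge⁻′ v B {w′} Bw′ {x} {y} xy∉star = refl
        same-size : numEdges J ≡ numEdges J′
        same-size = trans (numEdges-removeEdge J x y x≢y xy∈J)
                          (sym (numEdges-addEdge (removeEdge J x y) v w (v≢leaf Bw) (cong (_∧ not (edge x y v w)) vw∉J)))

    extend : Augmentation I (w ∷ ws)
    extend with B w in Bw | adj J v w in vw∈J
    ... | false | _ = keep (λ Bw≡true → ⊥-elim (true≢false (trans (sym Bw≡true) Bw)))
    ... | true | true = keep (λ _ → vw∈J)
    ... | true | false with stressFree-or-stress q (adj (J+vw Bw vw∈J))
    ...   | inj₁ stress-free = add Bw vw∈J stress-free
    ...   | inj₂ (f , f≢0 , f-ker) =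
      let antisym₀ , supported₀ , stress₀ = kernel⇒stress q (adj (J+vw Bw vw∈J)) f f-ker
      in exchange Bw vw∈J f≢0 antisym₀ supported₀ stress₀

  augmentation : ∀ {I} → I ⊆G G → StressFree q (adj I) → ∀ ws → Augmentation I ws
  augmentation {I} I⊆G I-stressFree [] = record
    { graph = I ; graph⊆G = I⊆G ; stressFree = I-stressFree ; star-covered = λ _ () ; enlarges = ℕ.≤-refl }
  augmentation I⊆G I-stressFree (w ∷ ws) = Step.extend (augmentation I⊆G I-stressFree ws)

augment-star : ∀ {d n} (q : Config d n) (G : Graph n) (v : Fin n) (B : Fin n → Bool) →
  (∀ w → B w ≡ true → adj G v w ≡ true) → PointsIndependent q (λ j → (j == v) ∨ B j) →
  ∀ I → I ⊆G G → StressFree q (adj I) →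
  Σ (Graph n) λ J → J ⊆G G × StressFree q (adj J) × (∀ w → B w ≡ true → adj J v w ≡ true) × numEdges I ≤ numEdges J
augment-star {n = n} q G v B B⊆N independent I I⊆G I-stressFree =
  graph , graph⊆G , stressFree , (λ w → star-covered w (Membership.∈-allFin w)) , enlarges
  where open Augment.Augmentation (Augment.augmentation q G v B B⊆N independent {I} I⊆G I-stressFree (allFin n))

-- Generic perturbations

perturb : ∀ {d n} → Config d n → ℚ → Config d n → Config d n
perturb p s e j c = p j c + s * e j c

equilibrium-perturb : ∀ {d n} (p e : Config d n) s f x →
  app (equilibrium (perturb p s e)) f x ≡ app (equilibrium p) f x + s * app (equilibrium e) f x
equilibrium-perturb {n = n} p e s f (k , c) = begin
  ∑[ j < n ] (f (k , j) * (p j c + s * e j c))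
    ≡⟨ sum-cong-≗ (λ j → solve 4 (λ w p s e → w :* (p :+ s :* e) := w :* p :+ s :* (w :* e)) refl (f (k , j)) (p j c) s (e j c)) ⟩
  ∑[ j < n ] (f (k , j) * p j c + s * (f (k , j) * e j c))
    ≡⟨ ∑-distrib-+ (λ j → f (k , j) * p j c) (λ j → s * (f (k , j) * e j c)) ⟩
  ∑[ j < n ] (f (k , j) * p j c) + ∑[ j < n ] (s * (f (k , j) * e j c))
    ≡⟨ cong (∑[ j < n ] (f (k , j) * p j c) +_) (*-distribˡ-sum s (λ j → f (k , j) * e j c)) ⟨
  ∑[ j < n ] (f (k , j) * p j c) + s * ∑[ j < n ] (f (k , j) * e j c) ∎
  where open ≡-Reasoning

stressMap-perturb : ∀ {d n} (p e : Config d n) A s f x →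
  app (stressMap (perturb p s e) A) f x ≡ app (stressMap p A) f x + s * app (equilibrium e ⊕ 0ᴸ) f x
stressMap-perturb p e A s f (inj₁ x) = equilibrium-perturb p e s f x
stressMap-perturb p e A s f (inj₂ x) = sym (trans (cong (app (constraints A) f x +_) (ℚ.*-zeroʳ s)) (ℚ.+-identityʳ _))

combinationMap-perturb : ∀ {d n} (p e : Config d n) S s γ c →
  app (combinationMap (perturb p s e) S) γ c ≡ s * app (combinationMap e S) γ c + app (combinationMap p S) γ c
combinationMap-perturb {n = n} p e S s γ c = begin
  ∑[ j < n ] when (S j) (γ j * (p j c + s * e j c))
    ≡⟨ sum-cong-≗ (λ j → split (S j) (γ j) (p j c) (e j c)) ⟩
  ∑[ j < n ] (s * when (S j) (γ j * e j c) + when (S j) (γ j * p j c))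
    ≡⟨ ∑-distrib-+ (λ j → s * when (S j) (γ j * e j c)) (λ j → when (S j) (γ j * p j c)) ⟩
  ∑[ j < n ] (s * when (S j) (γ j * e j c)) + ∑[ j < n ] when (S j) (γ j * p j c)
    ≡⟨ cong (_+ ∑[ j < n ] when (S j) (γ j * p j c)) (*-distribˡ-sum s (λ j → when (S j) (γ j * e j c))) ⟨
  s * ∑[ j < n ] when (S j) (γ j * e j c) + ∑[ j < n ] when (S j) (γ j * p j c) ∎
  where
  open ≡-Reasoning
  split : ∀ b g p e → when b (g * (p + s * e)) ≡ s * when b (g * e) + when b (g * p)
  split true g p e = solve 4 (λ s g p e → g :* (p :+ s :* e) := s :* (g :* e) :+ g :* p) refl s g p e
  split false g p e = sym (trans (cong (_+ 0ℚ) (ℚ.*-zeroʳ s)) (ℚ.+-identityʳ 0ℚ))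

pointsMap-perturb : ∀ {d n} (p e : Config d n) S s γ → Kernel (pointsMap (perturb p s e) S) γ →
  ∀ x → s * app (pointsMap e S) γ x + app (combinationMap p S ⊕ 0ᴸ) γ x ≡ 0ℚ
pointsMap-perturb p e S s γ γ-ker (inj₁ c) = trans (sym (combinationMap-perturb p e S s γ c)) (γ-ker (inj₁ c))
pointsMap-perturb p e S s γ γ-ker (inj₂ j) = trans (ℚ.+-identityʳ _) (trans (cong (s *_) (γ-ker (inj₂ j))) (ℚ.*-zeroʳ s))

naturalMoment : ∀ {d n} → Config d n
naturalMoment = moment (toℚ ∘ toℕ)

-- Along p + s·e both conditions fail only where a pencil A + s B with injective A is singular,
-- which happens for at most dim(domain) values of s.
perturb-generic : ∀ {d n} (p : Config d n) (A : Fin n → Fin n → Bool) (S : Fin n → Bool) →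
  StressFree p A → count S ≤ d → Σ (Config d n) λ q → StressFree q A × PointsIndependent q S
perturb-generic {d} {n} p A S p-stressFree count≤d =
  let (k , stress-free , independent) = failsAtMost⇒∃ both both? in q k , stress-free , independent
  where
  e = naturalMoment
  q = λ k → perturb p (toℚ k) e
  e-independent : PointsIndependent e S
  e-independent = vandermonde d (toℚ ∘ toℕ) S (λ a b _ _ eq → Fin.toℕ-injective (toℚ-injective eq)) count≤d
  stays-stressFree : FailsAtMost _ (λ k → StressFree (q k) A)
  stays-stressFree = pencil-failsAtMost′ (allFinᴱ n ×ᴱ allFinᴱ n) (stressMap p A) (equilibrium e ⊕ 0ᴸ)
    (stressFree⇒injective p A p-stressFree) _ witness
    where
    witness : ∀ k → ¬ StressFree (q k) A → _
    witness k not-free with stressFree-or-stress (q k) A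
    ... | inj₁ stress-free = ⊥-elim (not-free stress-free)
    ... | inj₂ (f , f≢0 , f-ker) = f , f≢0 , λ x → trans (sym (stressMap-perturb p e A (toℚ k) f x)) (f-ker x)
  becomes-independent : FailsAtMost _ (λ k → PointsIndependent (q k) S)
  becomes-independent = pencil-failsAtMost (allFinᴱ n) (pointsMap e S) (combinationMap p S ⊕ 0ᴸ)
    (pointsIndependent⇒injective e S e-independent) _ witness
    where
    witness : ∀ k → ¬ PointsIndependent (q k) S → _
    witness k dependent with injective-or-kernel (pointsMap (q k) S) (allFinᴱ d ⊎ᴱ allFinᴱ n)
    ... | inj₁ injective = ⊥-elim (dependent (injective⇒pointsIndependent (q k) S injective))
    ... | inj₂ (γ , γ≢0 , γ-ker) = γ , γ≢0 , pointsMap-perturb p e S (toℚ k) γ γ-ker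
  both = failsAtMost-∩ stays-stressFree becomes-independent (λ k → stressFree? (q k) A)
  both? = λ k → stressFree? (q k) A ×-dec pointsIndependent? (q k) S

-- coeff a b c r is the coefficient of sʳ in (a + s b)ᶜ.
coeff : ℚ → ℚ → ℕ → ℕ → ℚ
coeff a b ℕ.zero ℕ.zero = 1ℚ
coeff a b ℕ.zero (ℕ.suc r) = 0ℚ
coeff a b (ℕ.suc c) ℕ.zero = a * coeff a b c 0
coeff a b (ℕ.suc c) (ℕ.suc r) = a * coeff a b c (ℕ.suc r) + b * coeff a b c r

coeff-high : ∀ a b c r → c ℕ.< r → coeff a b c r ≡ 0ℚ
coeff-high a b ℕ.zero (ℕ.suc r) _ = refl
coeff-high a b (ℕ.suc c) (ℕ.suc r) (ℕ.s≤s c<r) = begin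
  a * coeff a b c (ℕ.suc r) + b * coeff a b c r
    ≡⟨ cong₂ (λ x y → a * x + b * y) (coeff-high a b c (ℕ.suc r) (ℕ.m<n⇒m<1+n c<r)) (coeff-high a b c r c<r) ⟩
  a * 0ℚ + b * 0ℚ
    ≡⟨ solve 2 (λ a b → a :* con 0ℚ :+ b :* con 0ℚ := con 0ℚ) refl a b ⟩
  0ℚ ∎
  where open ≡-Reasoning

coeff-0 : ∀ a b c → coeff a b c 0 ≡ a ^ℚ c
coeff-0 a b ℕ.zero = refl
coeff-0 a b (ℕ.suc c) = cong (a *_) (coeff-0 a b c)

sumUpTo : ℕ → (ℕ → ℚ) → ℚ
sumUpTo ℕ.zero f = 0ℚ
sumUpTo (ℕ.suc N) f = f 0 + sumUpTo N (f ∘ ℕ.suc)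

sumUpTo-cong : ∀ N {f g : ℕ → ℚ} → (∀ r → f r ≡ g r) → sumUpTo N f ≡ sumUpTo N g
sumUpTo-cong ℕ.zero f≗g = refl
sumUpTo-cong (ℕ.suc N) f≗g = cong₂ _+_ (f≗g 0) (sumUpTo-cong N (f≗g ∘ ℕ.suc))

sumUpTo-+ : ∀ N (f g : ℕ → ℚ) → sumUpTo N (λ r → f r + g r) ≡ sumUpTo N f + sumUpTo N g
sumUpTo-+ ℕ.zero f g = sym (ℚ.+-identityˡ 0ℚ)
sumUpTo-+ (ℕ.suc N) f g = trans (cong ((f 0 + g 0) +_) (sumUpTo-+ N (f ∘ ℕ.suc) (g ∘ ℕ.suc)))
  (solve 4 (λ a b c d → (a :+ b) :+ (c :+ d) := (a :+ c) :+ (b :+ d)) refl (f 0) (g 0) (sumUpTo N (f ∘ ℕ.suc)) (sumUpTo N (g ∘ ℕ.suc)))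

sumUpTo-* : ∀ N a (f : ℕ → ℚ) → sumUpTo N (λ r → a * f r) ≡ a * sumUpTo N f
sumUpTo-* ℕ.zero a f = sym (ℚ.*-zeroʳ a)
sumUpTo-* (ℕ.suc N) a f = trans (cong (a * f 0 +_) (sumUpTo-* N a (f ∘ ℕ.suc))) (sym (ℚ.*-distribˡ-+ a (f 0) _))

sumUpTo-zero : ∀ N {f : ℕ → ℚ} → (∀ r → f r ≡ 0ℚ) → sumUpTo N f ≡ 0ℚ
sumUpTo-zero ℕ.zero f≡0 = refl
sumUpTo-zero (ℕ.suc N) f≡0 = trans (cong₂ _+_ (f≡0 0) (sumUpTo-zero N (f≡0 ∘ ℕ.suc))) (ℚ.+-identityˡ 0ℚ)

sumUpTo-last : ∀ N (f : ℕ → ℚ) → sumUpTo (ℕ.suc N) f ≡ sumUpTo N f + f N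
sumUpTo-last ℕ.zero f = trans (ℚ.+-identityʳ (f 0)) (sym (ℚ.+-identityˡ (f 0)))
sumUpTo-last (ℕ.suc N) f = trans (cong (f 0 +_) (sumUpTo-last N (f ∘ ℕ.suc))) (sym (ℚ.+-assoc (f 0) _ (f (ℕ.suc N))))

sum-toℕ : ∀ N (f : ℕ → ℚ) → ∑[ r < N ] f (toℕ r) ≡ sumUpTo N f
sum-toℕ ℕ.zero f = refl
sum-toℕ (ℕ.suc N) f = cong (f 0 +_) (sum-toℕ N (f ∘ ℕ.suc))

expand-power : ∀ a b s N c → c ℕ.< N → (a + s * b) ^ℚ c ≡ sumUpTo N (λ r → (s ^ℚ r) * coeff a b c r)
expand-power a b s (ℕ.suc N) ℕ.zero _ =
  sym (trans (cong₂ _+_ (ℚ.*-identityˡ 1ℚ) (sumUpTo-zero N (λ r → ℚ.*-zeroʳ (s * (s ^ℚ r))))) (ℚ.+-identityʳ 1ℚ))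
expand-power a b s (ℕ.suc N) (ℕ.suc c) (ℕ.s≤s c<N) = sym (begin
  1ℚ * (a * coeff a b c 0) + sumUpTo N (λ r → (s * (s ^ℚ r)) * (a * coeff a b c (ℕ.suc r) + b * coeff a b c r))
    ≡⟨ cong₂ _+_ (solve 2 (λ a x → con 1ℚ :* (a :* x) := a :* (con 1ℚ :* x)) refl a (coeff a b c 0))
                 (trans (sumUpTo-cong N (λ r → solve 6 (λ s sʳ a b x y → (s :* sʳ) :* (a :* x :+ b :* y) := a :* ((s :* sʳ) :* x) :+ (s :* b) :* (sʳ :* y))
                                                       refl s (s ^ℚ r) a b (coeff a b c (ℕ.suc r)) (coeff a b c r)))
                        (trans (sumUpTo-+ N (λ r → a * F (ℕ.suc r)) (λ r → (s * b) * F r)) (cong₂ _+_ (sumUpTo-* N a (F ∘ ℕ.suc)) (sumUpTo-* N (s * b) F)))) ⟩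
  a * F 0 + (a * sumUpTo N (F ∘ ℕ.suc) + (s * b) * sumUpTo N F)
    ≡⟨ cong (λ z → a * F 0 + (a * sumUpTo N (F ∘ ℕ.suc) + (s * b) * z)) top-vanishes ⟩
  a * F 0 + (a * sumUpTo N (F ∘ ℕ.suc) + (s * b) * X)
    ≡⟨ solve 4 (λ a f₀ fᵣ sb → a :* f₀ :+ (a :* fᵣ :+ sb :* (f₀ :+ fᵣ)) := (a :+ sb) :* (f₀ :+ fᵣ)) refl a (F 0) (sumUpTo N (F ∘ ℕ.suc)) (s * b) ⟩
  (a + s * b) * X
    ≡⟨ cong ((a + s * b) *_) (expand-power a b s (ℕ.suc N) c (ℕ.m<n⇒m<1+n c<N)) ⟨
  (a + s * b) * ((a + s * b) ^ℚ c) ∎)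
  where
  open ≡-Reasoning
  F : ℕ → ℚ
  F r = (s ^ℚ r) * coeff a b c r
  X = sumUpTo (ℕ.suc N) F
  top-vanishes : sumUpTo N F ≡ X
  top-vanishes = sym (begin
    sumUpTo (ℕ.suc N) F          ≡⟨ sumUpTo-last N F ⟩
    sumUpTo N F + F N            ≡⟨ cong (λ z → sumUpTo N F + (s ^ℚ N) * z) (coeff-high a b c N c<N) ⟩
    sumUpTo N F + (s ^ℚ N) * 0ℚ  ≡⟨ solve 2 (λ x y → x :+ y :* con 0ℚ := x) refl (sumUpTo N F) (s ^ℚ N) ⟩
    sumUpTo N F                  ∎)

-- The polynomial pencil Σᵣ sʳ Mᵣ, linearised: (L₀ + s L₁) Λ = 0 iff Λ (r , _) = sʳ Λ (0 , _) and Σᵣ sʳ Mᵣ Λ₀ = 0.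
module Linearize {U X : Set} (EU : Enumeration U) (d′ : ℕ) (M : Fin (ℕ.suc d′) → Linear U X) (M₀-injective : Injective (M zero)) where

  U′ = Fin (ℕ.suc d′) × U
  X′ = (Fin d′ × U) ⊎ X

  L₀ : Linear U′ X′
  L₀ = record
    { app = λ { Λ (inj₁ (r , u)) → Λ (suc r , u) ; Λ (inj₂ x) → ∑[ r < ℕ.suc d′ ] app (M r) (λ u → Λ (r , u)) x }
    ; app-cong = λ { Λ≗Λ′ (inj₁ (r , u)) → Λ≗Λ′ (suc r , u)
                   ; Λ≗Λ′ (inj₂ x) → sum-cong-≗ (λ r → app-cong (M r) (λ u → Λ≗Λ′ (r , u)) x) }
    ; app-+ = λ { Λ Λ′ (inj₁ _) → refl
                ; Λ Λ′ (inj₂ x) → trans (sum-cong-≗ (λ r → app-+ (M r) (λ u → Λ (r , u)) (λ u → Λ′ (r , u)) x))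
                                                  (∑-distrib-+ (λ r → app (M r) (λ u → Λ (r , u)) x) (λ r → app (M r) (λ u → Λ′ (r , u)) x)) }
    ; app-* = λ { a Λ (inj₁ _) → refl
                ; a Λ (inj₂ x) → trans (sum-cong-≗ (λ r → app-* (M r) a (λ u → Λ (r , u)) x))
                                                (sym (*-distribˡ-sum a (λ r → app (M r) (λ u → Λ (r , u)) x))) } }

  L₁ : Linear U′ X′
  L₁ = record
    { app = λ { Λ (inj₁ (r , u)) → - Λ (inject₁ r , u) ; Λ (inj₂ x) → 0ℚ }
    ; app-cong = λ { Λ≗Λ′ (inj₁ (r , u)) → cong -_ (Λ≗Λ′ (inject₁ r , u)) ; Λ≗Λ′ (inj₂ x) → refl }
    ; app-+ = λ { Λ Λ′ (inj₁ (r , u)) → ℚ.neg-distrib-+ (Λ (inject₁ r , u)) (Λ′ (inject₁ r , u))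
                ; Λ Λ′ (inj₂ x) → sym (ℚ.+-identityˡ 0ℚ) }
    ; app-* = λ { a Λ (inj₁ (r , u)) → ℚ.neg-distribʳ-* a (Λ (inject₁ r , u))
                ; a Λ (inj₂ x) → sym (ℚ.*-zeroʳ a) } }

  L₀-injective : Injective L₀
  L₀-injective Λ Λ-ker = Λ≡0
    where
    higher≡0 : ∀ r u → Λ (suc r , u) ≡ 0ℚ
    higher≡0 r u = Λ-ker (inj₁ (r , u))
    constant-ker : Kernel (M zero) (λ u → Λ (zero , u))
    constant-ker x = begin
      app (M zero) (λ u → Λ (zero , u)) x
        ≡⟨ ℚ.+-identityʳ (app (M zero) (λ u → Λ (zero , u)) x) ⟨
      app (M zero) (λ u → Λ (zero , u)) x + 0ℚ
        ≡⟨ cong (app (M zero) (λ u → Λ (zero , u)) x +_) (sum-zero (λ r → trans (app-cong (M (suc r)) (higher≡0 r) x) (app-0 (M (suc r)) x))) ⟨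
      ∑[ r < ℕ.suc d′ ] app (M r) (λ u → Λ (r , u)) x
        ≡⟨ Λ-ker (inj₂ x) ⟩
      0ℚ ∎
      where open ≡-Reasoning
    Λ≡0 : ∀ ru → Λ ru ≡ 0ℚ
    Λ≡0 (zero , u) = M₀-injective _ constant-ker u
    Λ≡0 (suc r , u) = higher≡0 r u

  polynomial-pencil-failsAtMost : (P : ℕ → Set) →
    (∀ k → ¬ P k → Σ (U → ℚ) λ f → Nontrivial f × (∀ x → ∑[ r < ℕ.suc d′ ] ((toℚ k ^ℚ toℕ r) * app (M r) f x) ≡ 0ℚ)) →
    FailsAtMost (size (allFinᴱ (ℕ.suc d′) ×ᴱ EU)) P
  polynomial-pencil-failsAtMost P witness = pencil-failsAtMost′ (allFinᴱ (ℕ.suc d′) ×ᴱ EU) L₀ L₁ L₀-injective P linearised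
    where
    linearised : ∀ k → ¬ P k → Σ (U′ → ℚ) λ Λ → Nontrivial Λ × (∀ x → app L₀ Λ x + toℚ k * app L₁ Λ x ≡ 0ℚ)
    linearised k ¬Pk = Λ , ((zero , u₀) , λ Λ₀≡0 → fu₀≢0 (trans (sym (ℚ.*-identityˡ (f u₀))) Λ₀≡0)) , Λ-ker
      where
      s = toℚ k
      f = proj₁ (witness k ¬Pk)
      u₀ = proj₁ (proj₁ (proj₂ (witness k ¬Pk)))
      fu₀≢0 = proj₂ (proj₁ (proj₂ (witness k ¬Pk)))
      root = proj₂ (proj₂ (witness k ¬Pk))
      Λ : U′ → ℚ
      Λ (r , u) = (s ^ℚ toℕ r) * f u
      Λ-ker : ∀ x → app L₀ Λ x + s * app L₁ Λ x ≡ 0ℚ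
      Λ-ker (inj₁ (r , u)) rewrite Fin.toℕ-inject₁ r =
        solve 3 (λ s sʳ fu → (s :* sʳ) :* fu :+ s :* (:- (sʳ :* fu)) := con 0ℚ) refl s (s ^ℚ toℕ r) (f u)
      Λ-ker (inj₂ x) = begin
        ∑[ r < ℕ.suc d′ ] app (M r) (λ u → (s ^ℚ toℕ r) * f u) x + s * 0ℚ
          ≡⟨ cong (∑[ r < ℕ.suc d′ ] app (M r) (λ u → (s ^ℚ toℕ r) * f u) x +_) (ℚ.*-zeroʳ s) ⟩
        ∑[ r < ℕ.suc d′ ] app (M r) (λ u → (s ^ℚ toℕ r) * f u) x + 0ℚ
          ≡⟨ ℚ.+-identityʳ (∑[ r < ℕ.suc d′ ] app (M r) (λ u → (s ^ℚ toℕ r) * f u) x) ⟩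
        ∑[ r < ℕ.suc d′ ] app (M r) (λ u → (s ^ℚ toℕ r) * f u) x
          ≡⟨ sum-cong-≗ (λ r → app-* (M r) (s ^ℚ toℕ r) f x) ⟩
        ∑[ r < ℕ.suc d′ ] ((s ^ℚ toℕ r) * app (M r) f x)
          ≡⟨ root x ⟩
        0ℚ ∎
        where open ≡-Reasoning

module Shifted {n} (t : Fin n → ℚ) where

  shifted : ℕ → Fin n → ℚ
  shifted k j = t j + toℚ k * toℚ (toℕ j)

  Separates : ℕ → Fin n × Fin n → Set
  Separates k (a , b) = a ≢ b → shifted k a ≢ shifted k b

  separates? : ∀ k ab → Dec (Separates k ab)
  separates? k (a , b) = ¬? (a Fin.≟ b) →-dec ¬? (shifted k a ℚ.≟ shifted k b)

  -- shifted k a − shifted k b is affine in k with nonzero slope a − b.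
  separates-failsAtMost : ∀ ab → FailsAtMost 1 (λ k → Separates k ab)
  separates-failsAtMost ab [] _ _ = ℕ.z≤n
  separates-failsAtMost ab (k ∷ []) _ _ = ℕ.s≤s ℕ.z≤n
  separates-failsAtMost (a , b) (k ∷ l ∷ ks) ((k≢l ∷ _) ∷ _) (k-fails ∷ l-fails ∷ _) =
    ⊥-elim (k≢l (toℚ-injective (x-y≡0⇒x≡y (x*y≡0⇒x≡0 _ _ slopes a-b≢0))))
    where
    collides : ∀ {m} → ¬ Separates m (a , b) → a ≢ b × shifted m a ≡ shifted m b
    collides {m} ¬separates = (λ a≡b → ¬separates (λ a≢b → ⊥-elim (a≢b a≡b)))
                            , decidable-stable (shifted m a ℚ.≟ shifted m b) (λ ≢ → ¬separates (λ _ → ≢))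
    a-b≢0 : toℚ (toℕ a) - toℚ (toℕ b) ≢ 0ℚ
    a-b≢0 = x≢y⇒x-y≢0 (proj₁ (collides {k} k-fails) ∘ Fin.toℕ-injective ∘ toℚ-injective)
    slopes : (toℚ k - toℚ l) * (toℚ (toℕ a) - toℚ (toℕ b)) ≡ 0ℚ
    slopes = begin
      (toℚ k - toℚ l) * (toℚ (toℕ a) - toℚ (toℕ b))
        ≡⟨ solve 6 (λ k l a b ta tb → (k :+ (:- l)) :* (a :+ (:- b)) := ((ta :+ k :* a) :+ (:- (tb :+ k :* b))) :+ (:- ((ta :+ l :* a) :+ (:- (tb :+ l :* b)))))
                   refl (toℚ k) (toℚ l) (toℚ (toℕ a)) (toℚ (toℕ b)) (t a) (t b) ⟩
      (shifted k a - shifted k b) - (shifted l a - shifted l b)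
        ≡⟨ cong₂ _-_ (trans (cong (_- shifted k b) (proj₂ (collides {k} k-fails))) (ℚ.+-inverseʳ (shifted k b)))
                     (trans (cong (_- shifted l b) (proj₂ (collides {l} l-fails))) (ℚ.+-inverseʳ (shifted l b))) ⟩
      0ℚ - 0ℚ
        ≡⟨⟩
      0ℚ ∎
      where open ≡-Reasoning

  separatesAll-failsAtMost : ∀ pairs → FailsAtMost (length pairs) (λ k → All (Separates k) pairs)
  separatesAll-failsAtMost [] [] _ _ = ℕ.z≤n
  separatesAll-failsAtMost [] (k ∷ ks) _ (k-fails ∷ _) = ⊥-elim (k-fails [])
  separatesAll-failsAtMost (ab ∷ pairs) = failsAtMost-mono (λ _ (s , ss) → s ∷ ss)
    (failsAtMost-∩ (separates-failsAtMost ab) (separatesAll-failsAtMost pairs) (λ k → separates? k ab))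

  separatesAll⇒injective : ∀ {k} → All (Separates k) (elements (allFinᴱ n ×ᴱ allFinᴱ n)) → ∀ a b → shifted k a ≡ shifted k b → a ≡ b
  separatesAll⇒injective separates a b eq with a Fin.≟ b
  ... | yes a≡b = a≡b
  ... | no a≢b = ⊥-elim (All.lookup separates (complete (allFinᴱ n ×ᴱ allFinᴱ n) (a , b)) a≢b eq)

-- Moving the parameters t along t + s·(0, 1, …, n − 1): the stress map of the moment configuration is
-- a polynomial in s whose constant term is injective, and the parameters become distinct.
perturb-moment-generic⁺ : ∀ {d′ n} (t : Fin n → ℚ) (A : Fin n → Fin n → Bool) (S : Fin n → Bool) →
  StressFree (moment {ℕ.suc d′} t) A → count S ≤ ℕ.suc d′ →
  Σ (Fin n → ℚ) λ τ → StressFree (moment {ℕ.suc d′} τ) A × PointsIndependent (moment {ℕ.suc d′} τ) S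
perturb-moment-generic⁺ {d′} {n} t A S t-stressFree count≤d =
  let (k , stress-free , separates) = failsAtMost⇒∃ both both? in
  shifted k , stress-free , vandermonde d (shifted k) S (λ a b _ _ → separatesAll⇒injective {k} separates a b) count≤d
  where
  open Shifted t
  open ≡-Reasoning
  d = ℕ.suc d′
  pairs = elements (allFinᴱ n ×ᴱ allFinᴱ n)
  Q : Fin d → Config d n
  Q r j c = coeff (t j) (toℚ (toℕ j)) (toℕ c) (toℕ r)
  M : Fin d → Linear (Fin n × Fin n) ((Fin n × Fin d) ⊎ ((Fin n × Fin n) ⊎ (Fin n × Fin n)))
  M zero = equilibrium (Q zero) ⊕ constraints A
  M (suc r) = equilibrium (Q (suc r)) ⊕ 0ᴸ
  M-equilibrium : ∀ r f x → app (M r) f (inj₁ x) ≡ app (equilibrium (Q r)) f x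
  M-equilibrium zero f x = refl
  M-equilibrium (suc r) f x = refl
  M₀-injective : Injective (M zero)
  M₀-injective = stressFree⇒injective (Q zero) A (stressFree-cong A (λ j c → sym (coeff-0 (t j) (toℚ (toℕ j)) (toℕ c))) t-stressFree)
  expansion : ∀ k f x → app (stressMap (moment (shifted k)) A) f x ≡ ∑[ r < d ] ((toℚ k ^ℚ toℕ r) * app (M r) f x)
  expansion k f (inj₁ (i , c)) = begin
    ∑[ j < n ] (f (i , j) * (shifted k j ^ℚ toℕ c))
      ≡⟨ sum-cong-≗ (λ j → cong (f (i , j) *_) (trans (expand-power (t j) (toℚ (toℕ j)) s d (toℕ c) (Fin.toℕ<n c)) (sym (sum-toℕ d (λ r → (s ^ℚ r) * coeff (t j) (toℚ (toℕ j)) (toℕ c) r))))) ⟩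
    ∑[ j < n ] (f (i , j) * ∑[ r < d ] ((s ^ℚ toℕ r) * Q r j c))
      ≡⟨ sum-cong-≗ (λ j → trans (*-distribˡ-sum (f (i , j)) (λ r → (s ^ℚ toℕ r) * Q r j c))
                                 (sum-cong-≗ (λ r → solve 3 (λ x y z → x :* (y :* z) := y :* (x :* z)) refl (f (i , j)) (s ^ℚ toℕ r) (Q r j c)))) ⟩
    ∑[ j < n ] ∑[ r < d ] ((s ^ℚ toℕ r) * (f (i , j) * Q r j c))
      ≡⟨ ∑-comm (λ j r → (s ^ℚ toℕ r) * (f (i , j) * Q r j c)) ⟩
    ∑[ r < d ] ∑[ j < n ] ((s ^ℚ toℕ r) * (f (i , j) * Q r j c))
      ≡⟨ sum-cong-≗ (λ r → trans (sym (*-distribˡ-sum (s ^ℚ toℕ r) (λ j → f (i , j) * Q r j c)))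
                                 (cong ((s ^ℚ toℕ r) *_) (sym (M-equilibrium r f (i , c))))) ⟩
    ∑[ r < d ] ((s ^ℚ toℕ r) * app (M r) f (inj₁ (i , c))) ∎
    where s = toℚ k
  expansion k f (inj₂ x) = sym (begin
    1ℚ * app (constraints A) f x + ∑[ r < d′ ] ((toℚ k * (toℚ k ^ℚ toℕ r)) * 0ℚ)
      ≡⟨ cong₂ _+_ (ℚ.*-identityˡ (app (constraints A) f x)) (sum-zero {d′} (λ r → ℚ.*-zeroʳ (toℚ k * (toℚ k ^ℚ toℕ r)))) ⟩
    app (constraints A) f x + 0ℚ
      ≡⟨ ℚ.+-identityʳ _ ⟩
    app (constraints A) f x ∎)
  stays-stressFree : FailsAtMost _ (λ k → StressFree (moment {d} (shifted k)) A)
  stays-stressFree = Linearize.polynomial-pencil-failsAtMost (allFinᴱ n ×ᴱ allFinᴱ n) d′ M M₀-injective _ witness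
    where
    witness : ∀ k → ¬ StressFree (moment (shifted k)) A → _
    witness k not-free with stressFree-or-stress (moment {d} (shifted k)) A
    ... | inj₁ stress-free = ⊥-elim (not-free stress-free)
    ... | inj₂ (f , f≢0 , f-ker) = f , f≢0 , λ x → trans (sym (expansion k f x)) (f-ker x)
  both = failsAtMost-∩ stays-stressFree (separatesAll-failsAtMost pairs) (λ k → stressFree? (moment {d} (shifted k)) A)
  both? = λ k → stressFree? (moment {d} (shifted k)) A ×-dec All.all? (separates? k) pairs

perturb-moment-generic : ∀ {d n} (t : Fin n → ℚ) (A : Fin n → Fin n → Bool) (S : Fin n → Bool) →
  StressFree (moment {d} t) A → count S ≤ d →
  Σ (Fin n → ℚ) λ τ → StressFree (moment {d} τ) A × PointsIndependent (moment {d} τ) S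
perturb-moment-generic {ℕ.zero} t A S t-stressFree count≤0 = t , t-stressFree , vandermonde 0 t S S-empty count≤0
  where S-empty = λ a _ Sa _ _ → ⊥-elim (ℕ.n≮0 (subst (_≤ 0) (count-remove S a Sa) count≤0))
perturb-moment-generic {ℕ.suc d′} = perturb-moment-generic⁺

-- Lifting independent sets through a vertex split

corank-≤ : ∀ {n} (G : Graph n) (G′ : Graph (ℕ.suc n)) (M : IndepPred n) (M′ : IndepPred (ℕ.suc n)) (D : ℕ) →
  numEdges G′ ≡ D ℕ.+ numEdges G →
  (∀ I → I ⊆G G → M I → Σ (Graph (ℕ.suc n)) λ I′ → I′ ⊆G G′ × M′ I′ × D ℕ.+ numEdges I ≤ numEdges I′) →
  ∀ k k′ → IsCorank M G k → IsCorank M′ G′ k′ → k′ ≤ k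
corank-≤ G G′ M M′ D |G′| lift k k′ (r , ((I , I⊆G , MI , |I|≡r) , _) , k≡) (r′ , (_ , maximal′) , k′≡)
  with lift I I⊆G MI
... | I′ , I′⊆G′ , M′I′ , D+|I|≤|I′| = begin
  k′                              ≡⟨ k′≡ ⟩
  numEdges G′ ∸ r′                ≤⟨ ℕ.∸-monoʳ-≤ (numEdges G′) (ℕ.≤-trans D+r≤|I′| (maximal′ I′ I′⊆G′ M′I′)) ⟩
  numEdges G′ ∸ (D ℕ.+ r)         ≡⟨ cong (ℕ._∸ (D ℕ.+ r)) |G′| ⟩
  (D ℕ.+ numEdges G) ∸ (D ℕ.+ r)  ≡⟨ ℕ.[m+n]∸[m+o]≡n∸o D (numEdges G) r ⟩
  numEdges G ∸ r                  ≡⟨ k≡ ⟨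
  k                               ∎
  where
  open ℕ.≤-Reasoning
  D+r≤|I′| = subst (λ z → D ℕ.+ z ≤ numEdges I′) |I|≡r D+|I|≤|I′|

module VertexSplit {d n} (G : Graph n) (G′ : Graph (ℕ.suc n)) (v : Fin n) (B C : Fin n → Bool)
  (B⊆N : ∀ w → B w ≡ true → adj G v w ≡ true) (C⊆N : ∀ w → C w ≡ true → adj G v w ≡ true)
  (B∩C≡∅ : ∀ w → B w ∧ C w ≡ false) (G′≡split : ∀ x y → adj G′ x y ≡ splitAdj G v B C x y)
  (d≡ : d ≡ ℕ.suc (count B)) where

  S : Fin n → Bool
  S j = (j == v) ∨ B j

  count-S : count S ≤ d
  count-S = ℕ.≤-reflexive (begin
    count S                                   ≡⟨ Σℕ.sum-cong-≗ (λ j → 𝟙-∨ (j == v) (B j) (v∉B j)) ⟩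
    Σℕ.sum (λ j → 𝟙 (j == v) ℕ.+ 𝟙 (B j))      ≡⟨ Σℕ.∑-distrib-+ (λ j → 𝟙 (j == v)) (λ j → 𝟙 (B j)) ⟩
    count (_== v) ℕ.+ count B                  ≡⟨ cong (ℕ._+ count B) (count-== v) ⟩
    ℕ.suc (count B)                            ≡⟨ d≡ ⟨
    d                                          ∎)
    where
    open ≡-Reasoning
    v∉B : ∀ j → (j == v) ∧ B j ≡ false
    v∉B j with toSum (j Fin.≟ v)
    ... | inj₁ refl rewrite ==-refl j = leaf≢centre G B⊆N
    ... | inj₂ j≢v rewrite ≢⇒==-false j≢v = refl

  numEdges-G′ : numEdges G′ ≡ d ℕ.+ numEdges G
  numEdges-G′ = begin
    numEdges G′                                ≡⟨ numEdges-cong G′ (splitGraph G v B C) G′≡split ⟩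
    numEdges (splitGraph G v B C)              ≡⟨ numEdges-split G v B C B⊆N C⊆N B∩C≡∅ ⟩
    numEdges G ℕ.+ ℕ.suc (count B)             ≡⟨ ℕ.+-comm (numEdges G) (ℕ.suc (count B)) ⟩
    ℕ.suc (count B) ℕ.+ numEdges G             ≡⟨ cong (ℕ._+ numEdges G) d≡ ⟨
    d ℕ.+ numEdges G                           ∎
    where open ≡-Reasoning

  split-stressFree : ∀ {d′} {q : Config d′ n} → StressFree q (adj G) → PointsIndependent q S →
    StressFree (clone q v) (adj G′)
  split-stressFree {q = q} G-free S-independent ω antisym supported =
    stressFree-split q G v B C B⊆N C⊆N S-independent G-free ω antisym
      (supportedOn-mono (λ x y xy∈ → trans (sym (G′≡split x y)) xy∈) supported)

  star-restrict : ∀ (J : Graph n) a b → adj J a b ≡ true → star v (λ w → C w ∧ adj J v w) a b ≡ star v C a b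
  star-restrict J a b ab∈J with toSum (a Fin.≟ v) | toSum (b Fin.≟ v)
  ... | inj₁ refl | inj₁ refl = ⊥-elim (true≢false (trans (sym ab∈J) (Graph.irref J a)))
  ... | inj₁ refl | inj₂ b≢v rewrite ==-refl a | ≢⇒==-false b≢v | ab∈J | ∧-identityʳ (C b) = refl
  ... | inj₂ a≢v | inj₁ refl rewrite ==-refl b | ≢⇒==-false a≢v | Graph.sym J b a | ab∈J | ∧-identityʳ (C a) = refl
  ... | inj₂ a≢v | inj₂ b≢v rewrite ≢⇒==-false a≢v | ≢⇒==-false b≢v = refl

  lift : ∀ {d′} {q : Config d′ n} I → I ⊆G G → StressFree q (adj I) → PointsIndependent q S →
    Σ (Graph (ℕ.suc n)) λ I′ → I′ ⊆G G′ × StressFree (clone q v) (adj I′) × d ℕ.+ numEdges I ≤ numEdges I′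
  lift {q = q} I I⊆G I-free S-independent with augment-star q G v B B⊆N S-independent I I⊆G I-free
  ... | J , J⊆G , J-free , star⊆J , I≤J = I′ , I′⊆G′ , I′-free , I≤I′
    where
    -- J need not contain all edges from v to C; only those it contains are moved to v′.
    C′ : Fin n → Bool
    C′ w = C w ∧ adj J v w
    C′⊆N : ∀ w → C′ w ≡ true → adj J v w ≡ true
    C′⊆N w = ∧-conicalʳ (C w) (adj J v w)
    B∩C′≡∅ : ∀ w → B w ∧ C′ w ≡ false
    B∩C′≡∅ w rewrite sym (∧-assoc (B w) (C w) (adj J v w)) | B∩C≡∅ w = refl
    I′ = splitGraph J v B C′
    I′-free : StressFree (clone q v) (adj I′)
    I′-free = stressFree-split q J v B C′ star⊆J C′⊆N S-independent J-free
    I≤I′ : d ℕ.+ numEdges I ≤ numEdges I′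
    I≤I′ = begin
      d ℕ.+ numEdges I                 ≤⟨ ℕ.+-monoʳ-≤ d I≤J ⟩
      d ℕ.+ numEdges J                 ≡⟨ cong (ℕ._+ numEdges J) d≡ ⟩
      ℕ.suc (count B) ℕ.+ numEdges J   ≡⟨ ℕ.+-comm (ℕ.suc (count B)) (numEdges J) ⟩
      numEdges J ℕ.+ ℕ.suc (count B)   ≡⟨ numEdges-split J v B C′ star⊆J C′⊆N B∩C′≡∅ ⟨
      numEdges I′                      ∎
      where open ℕ.≤-Reasoning
    widen : ∀ a b c c′ → (c ≡ true → c′ ≡ true) → a ∨ b ∨ c ≡ true → a ∨ b ∨ c′ ≡ true
    widen true b c c′ _ _ = refl
    widen false true c c′ _ _ = refl
    widen false false c c′ c⇒c′ c≡true = c⇒c′ c≡true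
    I′⊆G′ : I′ ⊆G G′
    I′⊆G′ x y xy∈I′ rewrite G′≡split x y with lastView x | lastView y
    ... | old a | old b rewrite splitAdj-old-old G v B C a b =
      let xy∈ = trans (sym (splitAdj-old-old J v B C′ a b)) xy∈I′
          ab∈J = ∧-conicalˡ (adj J a b) _ xy∈
      in trans (cong₂ (λ s t → s ∧ not t) (J⊆G a b ab∈J) (sym (star-restrict J a b ab∈J))) (trans (cong (λ s → s ∧ not (star v C′ a b)) (sym ab∈J)) xy∈)
    ... | old a | new rewrite splitAdj-old-new G v B C a =
      widen (a == v) (B a) (C′ a) (C a) (∧-conicalˡ (C a) _) (trans (sym (splitAdj-old-new J v B C′ a)) xy∈I′)
    ... | new | old b rewrite splitAdj-new-old G v B C b =
      widen (b == v) (B b) (C′ b) (C b) (∧-conicalˡ (C b) _) (trans (sym (splitAdj-new-old J v B C′ b)) xy∈I′)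
    ... | new | new = ⊥-elim (false≢true (trans (sym (splitAdj-new-new J v B C′)) xy∈I′))

  lift-Hd : ∀ I → I ⊆G G → Hd d n I →
    Σ (Graph (ℕ.suc n)) λ I′ → I′ ⊆G G′ × Hd d (ℕ.suc n) I′ × d ℕ.+ numEdges I ≤ numEdges I′
  lift-Hd I I⊆G (p , p-rows) =
    let q , q-free , q-independent = perturb-generic p (adj I) S (rowsIndep⇒stressFree p I p-rows) count-S
        I′ , I′⊆G′ , I′-free , I≤I′ = lift I I⊆G q-free q-independent
    in I′ , I′⊆G′ , (clone q v , stressFree⇒rowsIndep (clone q v) I′ I′-free) , I≤I′

  lift-Pd : ∀ I → I ⊆G G → Pd d n I →
    Σ (Graph (ℕ.suc n)) λ I′ → I′ ⊆G G′ × Pd d (ℕ.suc n) I′ × d ℕ.+ numEdges I ≤ numEdges I′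
  lift-Pd I I⊆G (t , t-rows) =
    let τ , τ-free , τ-independent = perturb-moment-generic t (adj I) S (rowsIndep⇒stressFree (moment t) I t-rows) count-S
        I′ , I′⊆G′ , I′-free , I≤I′ = lift I I⊆G τ-free τ-independent
    in I′ , I′⊆G′ , (clone τ v , stressFree⇒rowsIndep (moment (clone τ v)) I′ (stressFree-cong (adj I′) (λ x c → sym (moment-clone τ v x c)) I′-free)) , I≤I′

  independent-Hd : Hd d n G → Hd d (ℕ.suc n) G′
  independent-Hd (p , p-rows) =
    let q , q-free , q-independent = perturb-generic p (adj G) S (rowsIndep⇒stressFree p G p-rows) count-S
    in clone q v , stressFree⇒rowsIndep (clone q v) G′ (split-stressFree q-free q-independent)

  independent-Pd : Pd d n G → Pd d (ℕ.suc n) G′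
  independent-Pd (t , t-rows) =
    let τ , τ-free , τ-independent = perturb-moment-generic t (adj G) S (rowsIndep⇒stressFree (moment t) G t-rows) count-S
    in clone τ v , stressFree⇒rowsIndep (moment (clone τ v)) G′ (stressFree-cong (adj G′) (λ x c → sym (moment-clone τ v x c)) (split-stressFree τ-free τ-independent))

proposition4p10 : ∀ {d n : ℕ} → 1 ≤ d → (G : Graph n) → (G' : Graph (suc n)) → IsVertexSplit d G G' →
    (∀ k k' → IsCorank (Hd d n) G k → IsCorank (Hd d (suc n)) G' k' → k' ≤ k) ×
    (∀ k k' → IsCorank (Pd d n) G k → IsCorank (Pd d (suc n)) G' k' → k' ≤ k) ×
    (Hd d n G → Hd d (suc n) G') ×
    (Pd d n G → Pd d (suc n) G')
proposition4p10 {d} {n} 1≤d G G′ (v , A , B , C , N≡A∪B∪C , _ , _ , B∩C≡∅ , |B|≡d∸1 , G′≡split) =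
  corank-≤ G G′ (Hd d n) (Hd d (ℕ.suc n)) d numEdges-G′ lift-Hd ,
  corank-≤ G G′ (Pd d n) (Pd d (ℕ.suc n)) d numEdges-G′ lift-Pd ,
  independent-Hd ,
  independent-Pd
  where
  B⊆N : ∀ w → B w ≡ true → adj G v w ≡ true
  B⊆N w Bw rewrite N≡A∪B∪C w | Bw = ∨-zeroʳ (A w)
  C⊆N : ∀ w → C w ≡ true → adj G v w ≡ true
  C⊆N w Cw rewrite N≡A∪B∪C w | Cw | ∨-zeroʳ (B w) = ∨-zeroʳ (A w)
  d≡ : d ≡ ℕ.suc (count B)
  d≡ = trans (sym (ℕ.suc-pred d {{ℕ.>-nonZero 1≤d}})) (cong ℕ.suc (trans (sym |B|≡d∸1) (count-filterᵇ B)))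
  open VertexSplit G G′ v B C B⊆N C⊆N B∩C≡∅ G′≡split d≡
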